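{- For any non-empty index $\boldsymbol{k}=(k_1, \ldots, k_r)$, \begin{align*} \sum_{m=0}^{\infty} \mathfrak{h}_m(\boldsymbol{k};t)u^m =y\frac{1}{1-xu}\Bigl(\frac{x}{1-xtu}\Bigr)^{k_1-1} \prod_{l=2}^r \left\{ \Bigl(y\frac{1-xtu}{1-xu}+xt\Bigr)\Bigl(\frac{x}{1-xtu}\Bigr)^{k_l-1} \right\}. \end{align*}
   Context: Let $\mathbb{Q}\langle x,y\rangle$ be the non-commutative polynomial ring; $\mathfrak{H}^1_t=\mathbb{Q}[t]+y\mathbb{Q}\langle x,y\rangle[t]$, identified with the $\mathbb{Q}[t]$-module of formal $\mathbb{Q}[t]$-linear combinations of indices via $(k_1,\dots,k_r)\leftrightarrow yx^{k_1-1}\cdots yx^{k_r-1}$. Indices are tuples of positive integers; $\mathrm{wt}$ is the sum of entries, $\mathrm{dep}$ the number of entries, $\oplus$ componentwise addition. Binomial coefficients with integer (possibly negative) top are $\binom{n}{j}=n(n-1)\cdots(n-j+1)/j!$. For non-empty $\boldsymbol{k}=(k_1,\dots,k_r)$ and $m\ge0$, $h_m(\boldsymbol{k};t)=\sum_{l=1}^{r}\sum_{e_1+\cdots+e_l+e'_1+\cdots+e'_l=m,\ e_i,e'_i\ge0} t^{r-l+e_1+\cdots+e_l}\sum_{\boldsymbol{k}=(\boldsymbol{k}_1,\dots,\boldsymbol{k}_l),\ \mathrm{dep}(\boldsymbol{k}_i)>0}\prod_{l'=1}^{l}\binom{\mathrm{wt}(\boldsymbol{k}_{l'})-\mathrm{dep}(\boldsymbol{k}_{l'})+e_{l'}+\delta_{l',1}-2}{e_{l'}}\times\bigl((\mathrm{wt}(\boldsymbol{k}_1),\dots,\mathrm{wt}(\boldsymbol{k}_l))\oplus\boldsymbol{e}\oplus\boldsymbol{e}'\bigr)$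 (inner sum over decompositions of $\boldsymbol{k}$ into consecutive non-empty blocks), and $\mathfrak{h}_m(\boldsymbol{k};t)\in\mathfrak{H}^1_t$ is the word corresponding to $h_m(\boldsymbol{k};t)$. The identity is in $\mathbb{Q}\langle x,y\rangle[[t,u]]$, with $\frac{1}{1-xu}=\sum_n x^nu^n$ etc. -}

module Defs where

open import Data.Nat as ℕ using (ℕ; zero; suc; _∸_)
open import Data.Integer as ℤ using (ℤ; +_)
open import Data.Rational as ℚ using (ℚ; 0ℚ; 1ℚ; _/_)
open import Data.Nat.ListAction using (sum)
open import Data.List using (List; []; _∷_; _++_; map; concatMap; replicate; length; foldr; zipWith; take; drop; upTo; filter)
open import Data.Product using (_×_; _,_; proj₁; proj₂)
open import Relation.Binary.PropositionalEquality using (_≡_; refl)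
open import Relation.Nullary using (Dec; yes; no)
import Data.List.Properties as LP

data Letter : Set where
  X Y : Letter

_≟L_ : (a b : Letter) → Dec (a ≡ b)
X ≟L X = yes refl
X ≟L Y = no (λ ())
Y ≟L X = no (λ ())
Y ≟L Y = yes refl

Word : Set
Word = List Letter

_≟W_ : (v w : Word) → Dec (v ≡ w)
_≟W_ = LP.≡-dec _≟L_

-- Formal power series in Q<<x,y>>[[t,u]], given by coefficients:
-- S w a b = coefficient of  w t^a u^b.  (Q<x,y>[[t,u]] embeds into this.)

Series : Set
Series = Word → ℕ → ℕ → ℚ

Σℚ : List ℚ → ℚ
Σℚ = foldr ℚ._+_ 0ℚ

splits : Word → List (Word × Word)
splits [] = ([] , []) ∷ []
splits (c ∷ w) = ([] , c ∷ w) ∷ map (λ p → (c ∷ proj₁ p , proj₂ p)) (splits w)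

nsplits : ℕ → List (ℕ × ℕ)
nsplits n = map (λ i → (i , n ∸ i)) (upTo (suc n))

δW : Word → Word → ℚ
δW v w with v ≟W w
... | yes _ = 1ℚ
... | no _ = 0ℚ

δN : ℕ → ℕ → ℚ
δN m n with m ℕ.≟ n
... | yes _ = 1ℚ
... | no _ = 0ℚ

mono : Word → ℕ → ℕ → Series
mono v a b w a' b' = δW v w ℚ.* (δN a a' ℚ.* δN b b')

𝟙 𝕩 𝕪 𝕥 𝕦 : Series
𝟙 = mono [] 0 0
𝕩 = mono (X ∷ []) 0 0
𝕪 = mono (Y ∷ []) 0 0
𝕥 = mono [] 1 0
𝕦 = mono [] 0 1

_⊕S_ : Series → Series → Series
(f ⊕S g) w a b = f w a b ℚ.+ g w a b

_⊖S_ : Series → Series → Series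
(f ⊖S g) w a b = f w a b ℚ.- g w a b

-- Cauchy product (x, y non-commuting; t, u central)
_⊛_ : Series → Series → Series
(f ⊛ g) w a b =
  Σℚ (map (λ ws → Σℚ (map (λ as → Σℚ (map (λ bs →
        f (proj₁ ws) (proj₁ as) (proj₁ bs) ℚ.* g (proj₂ ws) (proj₂ as) (proj₂ bs))
      (nsplits b))) (nsplits a))) (splits w))

infixl 7 _⊛_
infixl 6 _⊕S_ _⊖S_

_^S_ : Series → ℕ → Series
f ^S zero = 𝟙
f ^S suc n = f ⊛ (f ^S n)

-- 1/(1 - s) = Σ_n s^n, for s with zero constant term.  The coefficient of
-- w t^a u^b only receives contributions from n ≤ |w| + a + b, so the
-- truncated sum below is the exact coefficient of the geometric series.
geom : Series → Series
geom s w a b = Σℚ (map (λ n → (s ^S n) w a b) (upTo (suc (length w ℕ.+ a ℕ.+ b))))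

xPow : ℕ → Series
xPow n = (𝕩 ⊛ geom (𝕩 ⊛ 𝕥 ⊛ 𝕦)) ^S n

middle : Series
middle = 𝕪 ⊛ (𝟙 ⊖S 𝕩 ⊛ 𝕥 ⊛ 𝕦) ⊛ geom (𝕩 ⊛ 𝕦) ⊕S 𝕩 ⊛ 𝕥

RHS : ℕ → List ℕ → Series
RHS k₁ ks =
  𝕪 ⊛ geom (𝕩 ⊛ 𝕦) ⊛ xPow (k₁ ∸ 1) ⊛ prodTail ks
  where
  prodTail : List ℕ → Series
  prodTail [] = 𝟙
  prodTail (k ∷ ks′) = middle ⊛ xPow (k ∸ 1) ⊛ prodTail ks′

idxWord : List ℕ → Word
idxWord = concatMap (λ k → Y ∷ replicate (k ∸ 1) X)

binomℤ : ℤ → ℕ → ℚ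
binomℤ n zero = 1ℚ
binomℤ n (suc j) = binomℤ n j ℚ.* ((n ℤ.- + j) / suc j)

-- decompositions of a list into consecutive non-empty blocks
decomps : List ℕ → List (List (List ℕ))
decomps [] = [] ∷ []
decomps (k ∷ ks) = concatMap ext (decomps ks)
  where
  ext : List (List ℕ) → List (List (List ℕ))
  ext [] = ((k ∷ []) ∷ []) ∷ []
  ext (b ∷ bs) = ((k ∷ []) ∷ b ∷ bs) ∷ ((k ∷ b) ∷ bs) ∷ []

comps : ℕ → ℕ → List (List ℕ)
comps zero zero = [] ∷ []
comps zero (suc m) = []
comps (suc n) m = concatMap (λ p → map (proj₁ p ∷_) (comps n (proj₂ p))) (nsplits m)

wt dep : List ℕ → ℕ
wt = sum
dep = length

binomProd : ℕ → List (List ℕ) → List ℕ → ℚ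
binomProd δ (b ∷ bs) (e ∷ es) =
  binomℤ (+ wt b ℤ.- + dep b ℤ.+ + e ℤ.+ + δ ℤ.- + 2) e ℚ.* binomProd 0 bs es
binomProd δ _ _ = 1ℚ

-- a term  c t^a (index)  of h_m(k;t)
record Term : Set where
  constructor term
  field
    coeff : ℚ
    texp  : ℕ
    index : List ℕ

hTerms : ℕ → List ℕ → List Term
hTerms m k = concatMap (λ D → let l = length D in
    map (λ ee → let e = take l ee ; e′ = drop l ee in
          term (binomProd 1 D e)
               (length k ∸ l ℕ.+ sum e)
               (zipWith ℕ._+_ (zipWith ℕ._+_ (map wt D) e) e′))
        (comps (l ℕ.+ l) m))
  (decomps k)

-- Σ_m 𝔥_m(k;t) u^m : coefficient of w t^a u^m is the coefficient of w t^a in 𝔥_m(k;t)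
LHS : List ℕ → Series
LHS k w a m = Σℚ (map (λ τ → Term.coeff τ ℚ.* (δW (idxWord (Term.index τ)) w ℚ.* δN (Term.texp τ) a))
                      (hTerms m k))

module Submission where

-- By definition h_m(k;t) is a sum over the
-- decompositions of k into consecutive blocks, and the contribution of a decomposition
-- factors as a product over its blocks: a block b of weight W and depth D contributes
--   y · Σ_{e,e'} binom(W − D + e + δ − 2, e) x^(W−1+e+e') t^(D−1+e) u^(e+e'),
-- with δ = 1 for the first block and δ = 0 otherwise.  Expanding 1/(1 − xu) and
-- (x/(1 − xtu))^c by the negative binomial theorem identifies this with
--   y · 1/(1 − xu) · (xt)^(D−1) · H_δ · (x/(1 − xtu))^(W−D),   H_1 = 1,  H_0 = 1 − xtu,
-- where Pascal's rule absorbs the factor 1 − xtu.  On the right-hand side, each factor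
-- y(1 − xtu)/(1 − xu) + xt either starts a new block (its y-part) or appends the next
-- index k to the current block (its xt-part raises D by 1 and W − D by k − 1), which is
-- exactly the recursion satisfied by the sum over decompositions.  Geometric series are
-- computed through the uniqueness of the solution of Y = F + sY when s raises the u-degree.

open import Defs
open import Data.Nat as ℕ using (ℕ; zero; suc; _∸_; _≤_; _<_; z≤n; s≤s; _+_; _≤?_)
import Data.Nat.Properties as NP
import Data.Nat.Solver as ℕ-Solver
open import Data.Nat.ListAction using (sum)
open import Data.Nat.ListAction.Properties using (sum-++)
open import Data.Integer as ℤ using (ℤ; +_)
import Data.Integer.Properties as ZP
open import Data.Integer.Tactic.RingSolver using (solve-∀)
open import Data.Rational as ℚ using (ℚ; 0ℚ; 1ℚ; _/_; toℚᵘ)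
import Data.Rational.Properties as QP
import Data.Rational.Unnormalised as U
import Data.Rational.Unnormalised.Properties as UP
import Data.Rational.Solver as ℚ-Solver
open import Data.List using (List; []; _∷_; _++_; map; concatMap; replicate; length; foldr; applyUpTo; upTo; take; drop; zipWith)
import Data.List.Properties as LP
open import Data.List.Relation.Unary.All as All using (All; []; _∷_)
import Data.List.Relation.Unary.All.Properties as AllP
open import Data.Product using (Σ; _×_; _,_; proj₁; proj₂)
open import Data.Sum using (inj₁; inj₂)
open import Data.Unit using (⊤; tt)
open import Data.Empty using (⊥; ⊥-elim)
open import Relation.Nullary using (Dec; yes; no; ¬_)
open import Function using (_∘_)
open import Relation.Binary.PropositionalEquality
open import Relation.Binary.Bundles using (Setoid)
import Relation.Binary.Reasoning.Setoid as SetR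
open import Algebra.Bundles using (CommutativeMonoid)
open import Algebra.Properties.CommutativeSemigroup using (interchange)

module FiniteSums where

  open ≡-Reasoning

  -- Opaque copies of ℚ's + and *: they keep the type checker from normalising
  -- rational arithmetic inside the large sums below.
  infixl 6 _⊹_
  infixl 7 _·_
  opaque
    _⊹_ : ℚ → ℚ → ℚ
    _⊹_ = ℚ._+_
    _·_ : ℚ → ℚ → ℚ
    _·_ = ℚ._*_

  opaque
    unfolding _⊹_ _·_
    ⊹-def : ∀ x y → x ℚ.+ y ≡ x ⊹ y
    ⊹-def x y = refl
    ·-def : ∀ x y → x ℚ.* y ≡ x · y
    ·-def x y = refl
    ⊹-assoc : ∀ x y z → (x ⊹ y) ⊹ z ≡ x ⊹ (y ⊹ z)
    ⊹-assoc = QP.+-assoc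
    ⊹-comm : ∀ x y → x ⊹ y ≡ y ⊹ x
    ⊹-comm = QP.+-comm
    ⊹-idˡ : ∀ x → 0ℚ ⊹ x ≡ x
    ⊹-idˡ = QP.+-identityˡ
    ⊹-idʳ : ∀ x → x ⊹ 0ℚ ≡ x
    ⊹-idʳ = QP.+-identityʳ
    ⊹-interchange : ∀ a b c d → (a ⊹ b) ⊹ (c ⊹ d) ≡ (a ⊹ c) ⊹ (b ⊹ d)
    ⊹-interchange = interchange (CommutativeMonoid.commutativeSemigroup QP.+-0-commutativeMonoid)
    ·-interchange : ∀ a b c d → (a · b) · (c · d) ≡ (a · c) · (b · d)
    ·-interchange = interchange (CommutativeMonoid.commutativeSemigroup QP.*-1-commutativeMonoid)
    ·-assoc : ∀ x y z → (x · y) · z ≡ x · (y · z)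
    ·-assoc = QP.*-assoc
    ·-comm : ∀ x y → x · y ≡ y · x
    ·-comm = QP.*-comm
    ·-idˡ : ∀ x → 1ℚ · x ≡ x
    ·-idˡ = QP.*-identityˡ
    ·-idʳ : ∀ x → x · 1ℚ ≡ x
    ·-idʳ = QP.*-identityʳ
    ·-zeroˡ : ∀ x → 0ℚ · x ≡ 0ℚ
    ·-zeroˡ = QP.*-zeroˡ
    ·-zeroʳ : ∀ x → x · 0ℚ ≡ 0ℚ
    ·-zeroʳ = QP.*-zeroʳ
    ·-distribˡ : ∀ x y z → x · (y ⊹ z) ≡ x · y ⊹ x · z
    ·-distribˡ = QP.*-distribˡ-+
    ·-distribʳ : ∀ x y z → (y ⊹ z) · x ≡ y · x ⊹ z · x
    ·-distribʳ = QP.*-distribʳ-+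
    neg-distrib-⊹ : ∀ x y → ℚ.- (x ⊹ y) ≡ ℚ.- x ⊹ ℚ.- y
    neg-distrib-⊹ = QP.neg-distrib-+
    neg-distribˡ-· : ∀ x y → ℚ.- (x · y) ≡ ℚ.- x · y
    neg-distribˡ-· = QP.neg-distribˡ-*
    neg-distribʳ-· : ∀ x y → ℚ.- (x · y) ≡ x · ℚ.- y
    neg-distribʳ-· = QP.neg-distribʳ-*
    sub-def : ∀ x y → x ℚ.- y ≡ x ⊹ ℚ.- y
    sub-def x y = refl

  opaque
    SumL : ∀ {A : Set} → List A → (A → ℚ) → ℚ
    SumL L f = foldr _⊹_ 0ℚ (map f L)

  opaque
    unfolding SumL _⊹_
    SumL-def : ∀ {A : Set} (L : List A) (f : A → ℚ) → Σℚ (map f L) ≡ SumL L f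
    SumL-def L f = refl
    SumL-[] : ∀ {A : Set} (f : A → ℚ) → SumL [] f ≡ 0ℚ
    SumL-[] f = refl
    SumL-∷ : ∀ {A : Set} (x : A) (L : List A) (f : A → ℚ) → SumL (x ∷ L) f ≡ f x ⊹ SumL L f
    SumL-∷ x L f = refl

  module _ {A : Set} where
    opaque
      unfolding SumL
      Σ-cong : (L : List A) {f g : A → ℚ} → (∀ x → f x ≡ g x) → SumL L f ≡ SumL L g
      Σ-cong [] eq = refl
      Σ-cong (x ∷ L) eq = cong₂ _⊹_ (eq x) (Σ-cong L eq)

      Σ-congAll : {L : List A} {f g : A → ℚ} → All (λ x → f x ≡ g x) L → SumL L f ≡ SumL L g
      Σ-congAll [] = refl
      Σ-congAll (px ∷ a) = cong₂ _⊹_ px (Σ-congAll a)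

      Σ-++ : (L M : List A) (f : A → ℚ) → SumL (L ++ M) f ≡ SumL L f ⊹ SumL M f
      Σ-++ [] M f = sym (⊹-idˡ _)
      Σ-++ (x ∷ L) M f = trans (cong (f x ⊹_) (Σ-++ L M f)) (sym (⊹-assoc (f x) _ _))

      Σ-+ : (L : List A) (f g : A → ℚ) → SumL L (λ x → f x ⊹ g x) ≡ SumL L f ⊹ SumL L g
      Σ-+ [] f g = sym (⊹-idˡ _)
      Σ-+ (x ∷ L) f g = begin
        (f x ⊹ g x) ⊹ SumL L (λ x → f x ⊹ g x) ≡⟨ cong ((f x ⊹ g x) ⊹_) (Σ-+ L f g) ⟩
        (f x ⊹ g x) ⊹ (SumL L f ⊹ SumL L g) ≡⟨ ⊹-interchange (f x) (g x) (SumL L f) (SumL L g) ⟩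
        (f x ⊹ SumL L f) ⊹ (g x ⊹ SumL L g) ∎

      Σ-*ˡ : (L : List A) (c : ℚ) (f : A → ℚ) → c · SumL L f ≡ SumL L (λ x → c · f x)
      Σ-*ˡ [] c f = ·-zeroʳ c
      Σ-*ˡ (x ∷ L) c f = trans (·-distribˡ c (f x) _) (cong (c · f x ⊹_) (Σ-*ˡ L c f))

      Σ-*ʳ : (L : List A) (c : ℚ) (f : A → ℚ) → SumL L f · c ≡ SumL L (λ x → f x · c)
      Σ-*ʳ [] c f = ·-zeroˡ c
      Σ-*ʳ (x ∷ L) c f = trans (·-distribʳ c (f x) _) (cong (f x · c ⊹_) (Σ-*ʳ L c f))

      Σ-0 : (L : List A) → SumL L (λ _ → 0ℚ) ≡ 0ℚ
      Σ-0 [] = refl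
      Σ-0 (x ∷ L) = trans (⊹-idˡ _) (Σ-0 L)

      Σ-0' : (L : List A) (f : A → ℚ) → (∀ x → f x ≡ 0ℚ) → SumL L f ≡ 0ℚ
      Σ-0' L f eq = trans (Σ-cong L eq) (Σ-0 L)

      Σ-neg : (L : List A) (f : A → ℚ) → ℚ.- SumL L f ≡ SumL L (λ x → ℚ.- f x)
      Σ-neg [] f = refl
      Σ-neg (x ∷ L) f = trans (neg-distrib-⊹ (f x) _) (cong (ℚ.- f x ⊹_) (Σ-neg L f))

  module _ {A B : Set} where
    opaque
      unfolding SumL
      Σ-map : (L : List A) (g : A → B) (f : B → ℚ) → SumL (map g L) f ≡ SumL L (f ∘ g)
      Σ-map L g f = cong (foldr _⊹_ 0ℚ) (sym (LP.map-∘ L))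

      Σ-concatMap : (L : List A) (g : A → List B) (f : B → ℚ) →
        SumL (concatMap g L) f ≡ SumL L (λ x → SumL (g x) f)
      Σ-concatMap [] g f = refl
      Σ-concatMap (x ∷ L) g f = trans (Σ-++ (g x) (concatMap g L) f) (cong (SumL (g x) f ⊹_) (Σ-concatMap L g f))

      Σ-swap : (L : List A) (M : List B) (f : A → B → ℚ) →
        SumL L (λ x → SumL M (λ y → f x y)) ≡ SumL M (λ y → SumL L (λ x → f x y))
      Σ-swap [] M f = sym (Σ-0 M)
      Σ-swap (x ∷ L) M f = begin
        SumL M (f x) ⊹ SumL L (λ x → SumL M (f x)) ≡⟨ cong (SumL M (f x) ⊹_) (Σ-swap L M f) ⟩
        SumL M (f x) ⊹ SumL M (λ y → SumL L (λ x → f x y)) ≡⟨ sym (Σ-+ M (f x) _) ⟩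
        SumL M (λ y → f x y ⊹ SumL L (λ x → f x y)) ∎

open FiniteSums

module KroneckerDeltas where

  open ≡-Reasoning

  δN-refl : ∀ n → δN n n ≡ 1ℚ
  δN-refl n with n ℕ.≟ n
  ... | yes _ = refl
  ... | no ¬p = ⊥-elim (¬p refl)

  δN-≢ : ∀ {m n} → ¬ (m ≡ n) → δN m n ≡ 0ℚ
  δN-≢ {m} {n} ne with m ℕ.≟ n
  ... | yes p = ⊥-elim (ne p)
  ... | no _ = refl

  δN-suc : ∀ m n → δN (suc m) (suc n) ≡ δN m n
  δN-suc m n = h (m ℕ.≟ n)
    where
    h : Dec (m ≡ n) → δN (suc m) (suc n) ≡ δN m n
    h (yes refl) = trans (δN-refl (suc m)) (sym (δN-refl m))
    h (no ne) = trans (δN-≢ {suc m} {suc n} (λ e → ne (NP.suc-injective e))) (sym (δN-≢ ne))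

  δN-sym : ∀ m n → δN m n ≡ δN n m
  δN-sym m n with m ℕ.≟ n
  ... | yes refl = sym (δN-refl m)
  ... | no ne = sym (δN-≢ {n} {m} (λ e → ne (sym e)))

  δW-refl : ∀ w → δW w w ≡ 1ℚ
  δW-refl w with w ≟W w
  ... | yes _ = refl
  ... | no ¬p = ⊥-elim (¬p refl)

  δW-≢ : ∀ {v w} → ¬ (v ≡ w) → δW v w ≡ 0ℚ
  δW-≢ {v} {w} ne with v ≟W w
  ... | yes p = ⊥-elim (ne p)
  ... | no _ = refl

  δW-cons : ∀ c v w → δW (c ∷ v) (c ∷ w) ≡ δW v w
  δW-cons c v w = h (v ≟W w)
    where
    h : Dec (v ≡ w) → δW (c ∷ v) (c ∷ w) ≡ δW v w
    h (yes refl) = trans (δW-refl (c ∷ v)) (sym (δW-refl v))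
    h (no ne) = trans (δW-≢ {c ∷ v} {c ∷ w} (λ e → ne (proj₂ (LP.∷-injective e)))) (sym (δW-≢ ne))

  δW-cons≢ : ∀ c d v w → ¬ (c ≡ d) → δW (c ∷ v) (d ∷ w) ≡ 0ℚ
  δW-cons≢ c d v w ne = δW-≢ {c ∷ v} {d ∷ w} (λ e → ne (proj₁ (LP.∷-injective e)))

  δW-[]∷ : ∀ c w → δW [] (c ∷ w) ≡ 0ℚ
  δW-[]∷ c w = δW-≢ {[]} {c ∷ w} (λ ())

  δW-∷[] : ∀ c w → δW (c ∷ w) [] ≡ 0ℚ
  δW-∷[] c w = δW-≢ {c ∷ w} {[]} (λ ())

  listSplits : {A : Set} → List A → List (List A × List A)
  listSplits [] = ([] , []) ∷ []
  listSplits (c ∷ w) = ([] , c ∷ w) ∷ map (λ p → (c ∷ proj₁ p , proj₂ p)) (listSplits w)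

  module _ {A : Set} where
    opaque
      unfolding SumL
      listSplits-assoc : (w : List A) (F : List A → List A → List A → ℚ) →
        SumL (listSplits w) (λ p → SumL (listSplits (proj₁ p)) (λ q → F (proj₁ q) (proj₂ q) (proj₂ p))) ≡
        SumL (listSplits w) (λ p → SumL (listSplits (proj₂ p)) (λ q → F (proj₁ p) (proj₁ q) (proj₂ q)))
      listSplits-assoc [] F = refl
      listSplits-assoc (c ∷ w) F = begin
        (F [] [] (c ∷ w) ⊹ 0ℚ) ⊹ SumL (map (λ p → (c ∷ proj₁ p , proj₂ p)) (listSplits w)) L1
          ≡⟨ cong ((F [] [] (c ∷ w) ⊹ 0ℚ) ⊹_) (Σ-map (listSplits w) _ L1) ⟩
        (F [] [] (c ∷ w) ⊹ 0ℚ) ⊹ SumL (listSplits w) (λ p → F [] (c ∷ proj₁ p) (proj₂ p) ⊹ SumL (map (λ q → (c ∷ proj₁ q , proj₂ q)) (listSplits (proj₁ p))) (λ q → F (proj₁ q) (proj₂ q) (proj₂ p)))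
          ≡⟨ cong ((F [] [] (c ∷ w) ⊹ 0ℚ) ⊹_) (Σ-cong (listSplits w) (λ p → cong (F [] (c ∷ proj₁ p) (proj₂ p) ⊹_) (Σ-map (listSplits (proj₁ p)) _ _))) ⟩
        (F [] [] (c ∷ w) ⊹ 0ℚ) ⊹ SumL (listSplits w) (λ p → F [] (c ∷ proj₁ p) (proj₂ p) ⊹ SumL (listSplits (proj₁ p)) (λ q → F (c ∷ proj₁ q) (proj₂ q) (proj₂ p)))
          ≡⟨ cong ((F [] [] (c ∷ w) ⊹ 0ℚ) ⊹_) (Σ-+ (listSplits w) _ _) ⟩
        (F [] [] (c ∷ w) ⊹ 0ℚ) ⊹ (X1 ⊹ SumL (listSplits w) (λ p → SumL (listSplits (proj₁ p)) (λ q → F (c ∷ proj₁ q) (proj₂ q) (proj₂ p))))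
          ≡⟨ cong (λ z → (F [] [] (c ∷ w) ⊹ 0ℚ) ⊹ (X1 ⊹ z)) (listSplits-assoc w (λ a b d → F (c ∷ a) b d)) ⟩
        (F [] [] (c ∷ w) ⊹ 0ℚ) ⊹ (X1 ⊹ R')
          ≡⟨ sym (⊹-assoc (F [] [] (c ∷ w) ⊹ 0ℚ) X1 R') ⟩
        ((F [] [] (c ∷ w) ⊹ 0ℚ) ⊹ X1) ⊹ R'
          ≡⟨ cong (_⊹ R') (trans (cong (_⊹ X1) (⊹-idʳ (F [] [] (c ∷ w)))) (cong (F [] [] (c ∷ w) ⊹_) (sym (Σ-map (listSplits w) _ (λ q → F [] (proj₁ q) (proj₂ q)))))) ⟩
        SumL (listSplits (c ∷ w)) (λ q → F [] (proj₁ q) (proj₂ q)) ⊹ R'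
          ≡⟨ cong (SumL (listSplits (c ∷ w)) (λ q → F [] (proj₁ q) (proj₂ q)) ⊹_) (sym (Σ-map (listSplits w) _ (λ p → SumL (listSplits (proj₂ p)) (λ q → F (proj₁ p) (proj₁ q) (proj₂ q))))) ⟩
        SumL (listSplits (c ∷ w)) (λ q → F [] (proj₁ q) (proj₂ q)) ⊹ SumL (map (λ p → (c ∷ proj₁ p , proj₂ p)) (listSplits w)) (λ p → SumL (listSplits (proj₂ p)) (λ q → F (proj₁ p) (proj₁ q) (proj₂ q))) ∎
        where
        L1 : List A × List A → ℚ
        L1 = λ p → SumL (listSplits (proj₁ p)) (λ q → F (proj₁ q) (proj₂ q) (proj₂ p))
        X1 : ℚ
        X1 = SumL (listSplits w) (λ p → F [] (c ∷ proj₁ p) (proj₂ p))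
        R' : ℚ
        R' = SumL (listSplits w) (λ p → SumL (listSplits (proj₂ p)) (λ q → F (c ∷ proj₁ p) (proj₁ q) (proj₂ q)))

  splits≡listSplits : (w : Word) → splits w ≡ listSplits w
  splits≡listSplits [] = refl
  splits≡listSplits (c ∷ w) = cong (λ z → ([] , c ∷ w) ∷ map (λ p → (c ∷ proj₁ p , proj₂ p)) z) (splits≡listSplits w)

open KroneckerDeltas

module TwoPartCompositions where

  open ≡-Reasoning

  incrˡ : ℕ × ℕ → ℕ × ℕ
  incrˡ p = (suc (proj₁ p) , proj₂ p)

  nsplits-suc : ∀ n → nsplits (suc n) ≡ (0 , suc n) ∷ map (λ p → (suc (proj₁ p) , proj₂ p)) (nsplits n)
  nsplits-suc n = cong ((0 , suc n) ∷_) (begin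
    map (λ i → (i , suc n ∸ i)) (applyUpTo suc (suc n)) ≡⟨ LP.map-applyUpTo suc (λ i → (i , suc n ∸ i)) (suc n) ⟩
    applyUpTo (λ i → (suc i , n ∸ i)) (suc n) ≡⟨ sym (LP.map-upTo (λ i → (suc i , n ∸ i)) (suc n)) ⟩
    map (λ i → (suc i , n ∸ i)) (upTo (suc n)) ≡⟨ LP.map-∘ (upTo (suc n)) ⟩
    map (λ p → (suc (proj₁ p) , proj₂ p)) (nsplits n) ∎)

  applyUpTo-cong : ∀ {A : Set} (k : ℕ) (f g : ℕ → A) → (∀ i → i < k → f i ≡ g i) → applyUpTo f k ≡ applyUpTo g k
  applyUpTo-cong zero f g eq = refl
  applyUpTo-cong (suc k) f g eq = cong₂ _∷_ (eq 0 (s≤s z≤n)) (applyUpTo-cong k (f ∘ suc) (g ∘ suc) (λ i i<k → eq (suc i) (s≤s i<k)))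

  nsplits-sucʳ : ∀ n → nsplits (suc n) ≡ map (λ p → (proj₁ p , suc (proj₂ p))) (nsplits n) ++ (suc n , 0) ∷ []
  nsplits-sucʳ n = begin
    map g (upTo (suc (suc n))) ≡⟨ cong (map g) (sym (LP.upTo-∷ʳ (suc n))) ⟩
    map g (upTo (suc n) ++ suc n ∷ []) ≡⟨ LP.map-++ g (upTo (suc n)) _ ⟩
    map g (upTo (suc n)) ++ (suc n , n ∸ n) ∷ [] ≡⟨ cong₂ (λ a b → a ++ (suc n , b) ∷ []) map-shifted (NP.n∸n≡0 n) ⟩
    map (λ p → (proj₁ p , suc (proj₂ p))) (nsplits n) ++ (suc n , 0) ∷ [] ∎
    where
    g : ℕ → ℕ × ℕ
    g = λ i → (i , suc n ∸ i)
    map-shifted : map g (upTo (suc n)) ≡ map (λ p → (proj₁ p , suc (proj₂ p))) (nsplits n)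
    map-shifted = begin
      map g (upTo (suc n)) ≡⟨ LP.map-upTo g (suc n) ⟩
      applyUpTo g (suc n) ≡⟨ applyUpTo-cong (suc n) g _ (λ i i<k → cong (i ,_) (NP.+-∸-assoc 1 (NP.≤-pred i<k))) ⟩
      applyUpTo (λ i → (i , suc (n ∸ i))) (suc n) ≡⟨ sym (LP.map-upTo _ (suc n)) ⟩
      map (λ i → (i , suc (n ∸ i))) (upTo (suc n)) ≡⟨ LP.map-∘ (upTo (suc n)) ⟩
      map (λ p → (proj₁ p , suc (proj₂ p))) (nsplits n) ∎

  replicate-tt-length : (u : List ⊤) → replicate (length u) tt ≡ u
  replicate-tt-length [] = refl
  replicate-tt-length (tt ∷ u) = cong (tt ∷_) (replicate-tt-length u)

  opaque
   unfolding SumL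
   -- Writing n = i + (n − i) is splitting a list of length n, which transfers the
   -- associativity of listSplits to nsplits.
   Σ-nsplits-as-listSplits : ∀ n (F : ℕ × ℕ → ℚ) → SumL (nsplits n) F ≡ SumL (listSplits (replicate n tt)) (λ p → F (length (proj₁ p) , length (proj₂ p)))
   Σ-nsplits-as-listSplits zero F = refl
   Σ-nsplits-as-listSplits (suc n) F = begin
     SumL (nsplits (suc n)) F ≡⟨ cong (λ L → SumL L F) (nsplits-suc n) ⟩
     F (0 , suc n) ⊹ SumL (map (λ p → (suc (proj₁ p) , proj₂ p)) (nsplits n)) F ≡⟨ cong (F (0 , suc n) ⊹_) (Σ-map (nsplits n) incrˡ F) ⟩
     F (0 , suc n) ⊹ SumL (nsplits n) (λ p → F (suc (proj₁ p) , proj₂ p)) ≡⟨ cong (F (0 , suc n) ⊹_) (Σ-nsplits-as-listSplits n (λ p → F (suc (proj₁ p) , proj₂ p))) ⟩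
     F (0 , suc n) ⊹ SumL (listSplits (replicate n tt)) (λ p → F (suc (length (proj₁ p)) , length (proj₂ p))) ≡⟨ cong₂ (λ a b → F (0 , a) ⊹ b) (sym (cong suc (LP.length-replicate n))) (sym (Σ-map (listSplits (replicate n tt)) (λ p → (tt ∷ proj₁ p , proj₂ p)) (λ p → F (length (proj₁ p) , length (proj₂ p))))) ⟩
     SumL (listSplits (replicate (suc n) tt)) (λ p → F (length (proj₁ p) , length (proj₂ p))) ∎

   Σ-nsplits-assoc : ∀ n (F : ℕ → ℕ → ℕ → ℚ) →
     SumL (nsplits n) (λ p → SumL (nsplits (proj₁ p)) (λ q → F (proj₁ q) (proj₂ q) (proj₂ p))) ≡
     SumL (nsplits n) (λ p → SumL (nsplits (proj₂ p)) (λ q → F (proj₁ p) (proj₁ q) (proj₂ q)))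
   Σ-nsplits-assoc n F = begin
     SumL (nsplits n) (λ p → SumL (nsplits (proj₁ p)) (λ q → F (proj₁ q) (proj₂ q) (proj₂ p)))
       ≡⟨ Σ-nsplits-as-listSplits n (λ p → SumL (nsplits (proj₁ p)) (λ q → F (proj₁ q) (proj₂ q) (proj₂ p))) ⟩
     SumL R (λ p → SumL (nsplits (length (proj₁ p))) (λ q → F (proj₁ q) (proj₂ q) (length (proj₂ p))))
       ≡⟨ Σ-cong R (λ p → trans (Σ-nsplits-as-listSplits (length (proj₁ p)) (λ q → F (proj₁ q) (proj₂ q) (length (proj₂ p)))) (cong (λ z → SumL (listSplits z) (λ q → F (length (proj₁ q)) (length (proj₂ q)) (length (proj₂ p)))) (replicate-tt-length (proj₁ p)))) ⟩
     SumL R (λ p → SumL (listSplits (proj₁ p)) (λ q → F (length (proj₁ q)) (length (proj₂ q)) (length (proj₂ p))))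
       ≡⟨ listSplits-assoc (replicate n tt) (λ a b c → F (length a) (length b) (length c)) ⟩
     SumL R (λ p → SumL (listSplits (proj₂ p)) (λ q → F (length (proj₁ p)) (length (proj₁ q)) (length (proj₂ q))))
       ≡⟨ sym (Σ-cong R (λ p → trans (Σ-nsplits-as-listSplits (length (proj₂ p)) (λ q → F (length (proj₁ p)) (proj₁ q) (proj₂ q))) (cong (λ z → SumL (listSplits z) (λ q → F (length (proj₁ p)) (length (proj₁ q)) (length (proj₂ q)))) (replicate-tt-length (proj₂ p))))) ⟩
     SumL R (λ p → SumL (nsplits (length (proj₂ p))) (λ q → F (length (proj₁ p)) (proj₁ q) (proj₂ q)))
       ≡⟨ sym (Σ-nsplits-as-listSplits n (λ p → SumL (nsplits (proj₂ p)) (λ q → F (proj₁ p) (proj₁ q) (proj₂ q)))) ⟩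
     SumL (nsplits n) (λ p → SumL (nsplits (proj₂ p)) (λ q → F (proj₁ p) (proj₁ q) (proj₂ q))) ∎
     where
    R : List (List ⊤ × List ⊤)
    R = listSplits (replicate n tt)

   Σ-nsplits-swap : ∀ n (F : ℕ → ℕ → ℚ) → SumL (nsplits n) (λ p → F (proj₁ p) (proj₂ p)) ≡ SumL (nsplits n) (λ p → F (proj₂ p) (proj₁ p))
   Σ-nsplits-swap zero F = refl
   Σ-nsplits-swap (suc n) F = begin
     SumL (nsplits (suc n)) (λ p → F (proj₁ p) (proj₂ p)) ≡⟨ cong (λ L → SumL L (λ p → F (proj₁ p) (proj₂ p))) (nsplits-suc n) ⟩
     F 0 (suc n) ⊹ SumL (map (λ p → (suc (proj₁ p) , proj₂ p)) (nsplits n)) (λ p → F (proj₁ p) (proj₂ p)) ≡⟨ cong (F 0 (suc n) ⊹_) (Σ-map (nsplits n) incrˡ (λ p → F (proj₁ p) (proj₂ p))) ⟩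
     F 0 (suc n) ⊹ SumL (nsplits n) (λ p → F (suc (proj₁ p)) (proj₂ p)) ≡⟨ cong (F 0 (suc n) ⊹_) (Σ-nsplits-swap n (λ a b → F (suc a) b)) ⟩
     F 0 (suc n) ⊹ SumL (nsplits n) (λ p → F (suc (proj₂ p)) (proj₁ p)) ≡⟨ ⊹-comm (F 0 (suc n)) (SumL (nsplits n) (λ p → F (suc (proj₂ p)) (proj₁ p))) ⟩
     SumL (nsplits n) (λ p → F (suc (proj₂ p)) (proj₁ p)) ⊹ F 0 (suc n) ≡⟨ cong (SumL (nsplits n) (λ p → F (suc (proj₂ p)) (proj₁ p)) ⊹_) (sym (⊹-idʳ (F 0 (suc n)))) ⟩
     SumL (nsplits n) (λ p → F (suc (proj₂ p)) (proj₁ p)) ⊹ SumL ((suc n , 0) ∷ []) (λ p → F (proj₂ p) (proj₁ p)) ≡⟨ cong (_⊹ SumL ((suc n , 0) ∷ []) (λ p → F (proj₂ p) (proj₁ p))) (sym (Σ-map (nsplits n) (λ p → (proj₁ p , suc (proj₂ p))) (λ p → F (proj₂ p) (proj₁ p)))) ⟩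
     SumL (map (λ p → (proj₁ p , suc (proj₂ p))) (nsplits n)) (λ p → F (proj₂ p) (proj₁ p)) ⊹ SumL ((suc n , 0) ∷ []) (λ p → F (proj₂ p) (proj₁ p)) ≡⟨ sym (Σ-++ (map (λ p → (proj₁ p , suc (proj₂ p))) (nsplits n)) ((suc n , 0) ∷ []) (λ p → F (proj₂ p) (proj₁ p))) ⟩
     SumL (map (λ p → (proj₁ p , suc (proj₂ p))) (nsplits n) ++ (suc n , 0) ∷ []) (λ p → F (proj₂ p) (proj₁ p)) ≡⟨ cong (λ L → SumL L (λ p → F (proj₂ p) (proj₁ p))) (sym (nsplits-sucʳ n)) ⟩
     SumL (nsplits (suc n)) (λ p → F (proj₂ p) (proj₁ p)) ∎

   δN≢-· : ∀ m n (x : ℚ) → ¬ (m ≡ n) → δN m n · x ≡ 0ℚ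
   δN≢-· m n x ne = trans (cong (_· x) (δN-≢ ne)) (·-zeroˡ x)

   δN-refl-· : ∀ n (x : ℚ) → δN n n · x ≡ x
   δN-refl-· n x = trans (cong (_· x) (δN-refl n)) (·-idˡ x)

   Σ-nsplits-δ0 : ∀ n (G : ℕ → ℚ) → SumL (nsplits n) (λ p → δN 0 (proj₁ p) · G (proj₂ p)) ≡ G n
   Σ-nsplits-δ0 zero G = trans (⊹-idʳ _) (δN-refl-· 0 (G 0))
   Σ-nsplits-δ0 (suc n) G = begin
     SumL (nsplits (suc n)) (λ p → δN 0 (proj₁ p) · G (proj₂ p)) ≡⟨ cong (λ L → SumL L (λ p → δN 0 (proj₁ p) · G (proj₂ p))) (nsplits-suc n) ⟩
     δN 0 0 · G (suc n) ⊹ SumL (map incrˡ (nsplits n)) (λ p → δN 0 (proj₁ p) · G (proj₂ p)) ≡⟨ cong₂ _⊹_ (δN-refl-· 0 (G (suc n))) (trans (Σ-map (nsplits n) incrˡ (λ p → δN 0 (proj₁ p) · G (proj₂ p))) (Σ-0' (nsplits n) _ (λ p → δN≢-· 0 (suc (proj₁ p)) (G (proj₂ p)) (λ ())))) ⟩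
     G (suc n) ⊹ 0ℚ ≡⟨ ⊹-idʳ _ ⟩
     G (suc n) ∎

   Σ-nsplits-δ : ∀ a r (G : ℕ → ℚ) → SumL (nsplits (a + r)) (λ p → δN a (proj₁ p) · G (proj₂ p)) ≡ G r
   Σ-nsplits-δ zero r G = Σ-nsplits-δ0 r G
   Σ-nsplits-δ (suc a) r G = begin
     SumL (nsplits (suc (a + r))) (λ p → δN (suc a) (proj₁ p) · G (proj₂ p)) ≡⟨ cong (λ L → SumL L (λ p → δN (suc a) (proj₁ p) · G (proj₂ p))) (nsplits-suc (a + r)) ⟩
     δN (suc a) 0 · G (suc (a + r)) ⊹ SumL (map incrˡ (nsplits (a + r))) (λ p → δN (suc a) (proj₁ p) · G (proj₂ p)) ≡⟨ cong₂ _⊹_ (δN≢-· (suc a) 0 (G (suc (a + r))) (λ ())) (trans (Σ-map (nsplits (a + r)) incrˡ (λ p → δN (suc a) (proj₁ p) · G (proj₂ p))) (Σ-cong (nsplits (a + r)) (λ p → cong (_· G (proj₂ p)) (δN-suc a (proj₁ p))))) ⟩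
     0ℚ ⊹ SumL (nsplits (a + r)) (λ p → δN a (proj₁ p) · G (proj₂ p)) ≡⟨ ⊹-idˡ _ ⟩
     SumL (nsplits (a + r)) (λ p → δN a (proj₁ p) · G (proj₂ p)) ≡⟨ Σ-nsplits-δ a r G ⟩
     G r ∎

   Σ-nsplits-δ-beyond : ∀ n a (G : ℕ → ℚ) → n < a → SumL (nsplits n) (λ p → δN a (proj₁ p) · G (proj₂ p)) ≡ 0ℚ
   Σ-nsplits-δ-beyond zero (suc a) G lt = trans (⊹-idʳ _) (δN≢-· (suc a) 0 (G 0) (λ ()))
   Σ-nsplits-δ-beyond (suc n) (suc a) G (s≤s lt) = begin
     SumL (nsplits (suc n)) (λ p → δN (suc a) (proj₁ p) · G (proj₂ p)) ≡⟨ cong (λ L → SumL L (λ p → δN (suc a) (proj₁ p) · G (proj₂ p))) (nsplits-suc n) ⟩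
     δN (suc a) 0 · G (suc n) ⊹ SumL (map incrˡ (nsplits n)) (λ p → δN (suc a) (proj₁ p) · G (proj₂ p)) ≡⟨ cong₂ _⊹_ (δN≢-· (suc a) 0 (G (suc n)) (λ ())) (trans (Σ-map (nsplits n) incrˡ (λ p → δN (suc a) (proj₁ p) · G (proj₂ p))) (Σ-cong (nsplits n) (λ p → cong (_· G (proj₂ p)) (δN-suc a (proj₁ p))))) ⟩
     0ℚ ⊹ SumL (nsplits n) (λ p → δN a (proj₁ p) · G (proj₂ p)) ≡⟨ ⊹-idˡ _ ⟩
     SumL (nsplits n) (λ p → δN a (proj₁ p) · G (proj₂ p)) ≡⟨ Σ-nsplits-δ-beyond n a G lt ⟩
     0ℚ ∎

open TwoPartCompositions

module SeriesAlgebra where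

  infix 4 _≈_
  _≈_ : Series → Series → Set
  f ≈ g = ∀ w a b → f w a b ≡ g w a b

  ≈-refl : ∀ {f} → f ≈ f
  ≈-refl w a b = refl
  ≈-sym : ∀ {f g} → f ≈ g → g ≈ f
  ≈-sym e w a b = sym (e w a b)
  ≈-trans : ∀ {f g h} → f ≈ g → g ≈ h → f ≈ h
  ≈-trans e e' w a b = trans (e w a b) (e' w a b)

  series-setoid : Setoid _ _
  series-setoid = record { Carrier = Series ; _≈_ = _≈_ ; isEquivalence = record { refl = λ {f} → ≈-refl {f} ; sym = λ {f} {g} → ≈-sym {f} {g} ; trans = λ {f} {g} {h} → ≈-trans {f} {g} {h} } }

  module SR = SetR series-setoid

  convolution : Series → Series → Series
  convolution f g w a b = SumL (splits w) (λ P → SumL (nsplits a) (λ A → SumL (nsplits b) (λ B →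
    f (proj₁ P) (proj₁ A) (proj₁ B) · g (proj₂ P) (proj₂ A) (proj₂ B))))

  opaque
    unfolding SumL _⊹_ _·_
    ⊛-def : ∀ f g w a b → (f ⊛ g) w a b ≡ convolution f g w a b
    ⊛-def f g w a b = refl

  ⊛-via-convolution : ∀ f g f' g' → (∀ w a b → convolution f g w a b ≡ convolution f' g' w a b) → f ⊛ g ≈ f' ⊛ g'
  ⊛-via-convolution f g f' g' e w a b = trans (⊛-def f g w a b) (trans (e w a b) (sym (⊛-def f' g' w a b)))

  ⊛-cong : ∀ {f f' g g'} → f ≈ f' → g ≈ g' → f ⊛ g ≈ f' ⊛ g'
  ⊛-cong {f} {f'} {g} {g'} ef eg = ⊛-via-convolution f g f' g' λ w a b → Σ-cong (splits w) (λ P → Σ-cong (nsplits a) (λ A → Σ-cong (nsplits b) (λ B →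
    cong₂ _·_ (ef (proj₁ P) (proj₁ A) (proj₁ B)) (eg (proj₂ P) (proj₂ A) (proj₂ B)))))

  ⊛-congˡ : ∀ f {g g'} → g ≈ g' → f ⊛ g ≈ f ⊛ g'
  ⊛-congˡ f e = ⊛-cong {f} {f} ≈-refl e

  ⊛-congʳ : ∀ {f f'} g → f ≈ f' → f ⊛ g ≈ f' ⊛ g
  ⊛-congʳ {f} {f'} g e = ⊛-cong {f} {f'} {g} {g} e ≈-refl

  ⊕-cong : ∀ {f f' g g'} → f ≈ f' → g ≈ g' → f ⊕S g ≈ f' ⊕S g'
  ⊕-cong ef eg w a b = cong₂ ℚ._+_ (ef w a b) (eg w a b)

  ⊖-cong : ∀ {f f' g g'} → f ≈ f' → g ≈ g' → f ⊖S g ≈ f' ⊖S g'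
  ⊖-cong ef eg w a b = cong₂ ℚ._-_ (ef w a b) (eg w a b)

  ⊛-distribʳ : ∀ f g h → (f ⊕S g) ⊛ h ≈ f ⊛ h ⊕S g ⊛ h
  ⊛-distribʳ f g h w a b = trans (⊛-def (f ⊕S g) h w a b) (trans (trans (Σ-cong (splits w) (λ P → trans (Σ-cong (nsplits a) (λ A → trans
       (Σ-cong (nsplits b) (λ B → trans (cong (_· h (proj₂ P) (proj₂ A) (proj₂ B)) (⊹-def (f (proj₁ P) (proj₁ A) (proj₁ B)) (g (proj₁ P) (proj₁ A) (proj₁ B)))) (·-distribʳ (h (proj₂ P) (proj₂ A) (proj₂ B)) (f (proj₁ P) (proj₁ A) (proj₁ B)) (g (proj₁ P) (proj₁ A) (proj₁ B)))))
       (Σ-+ (nsplits b) _ _))) (Σ-+ (nsplits a) _ _))) (Σ-+ (splits w) _ _)) (sym (trans (⊹-def _ _) (cong₂ _⊹_ (⊛-def f h w a b) (⊛-def g h w a b)))))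

  ⊛-distribˡ : ∀ f g h → h ⊛ (f ⊕S g) ≈ h ⊛ f ⊕S h ⊛ g
  ⊛-distribˡ f g h w a b = trans (⊛-def h (f ⊕S g) w a b) (trans (trans (Σ-cong (splits w) (λ P → trans (Σ-cong (nsplits a) (λ A → trans
       (Σ-cong (nsplits b) (λ B → trans (cong (h (proj₁ P) (proj₁ A) (proj₁ B) ·_) (⊹-def (f (proj₂ P) (proj₂ A) (proj₂ B)) (g (proj₂ P) (proj₂ A) (proj₂ B)))) (·-distribˡ (h (proj₁ P) (proj₁ A) (proj₁ B)) (f (proj₂ P) (proj₂ A) (proj₂ B)) (g (proj₂ P) (proj₂ A) (proj₂ B)))))
       (Σ-+ (nsplits b) _ _))) (Σ-+ (nsplits a) _ _))) (Σ-+ (splits w) _ _)) (sym (trans (⊹-def _ _) (cong₂ _⊹_ (⊛-def h f w a b) (⊛-def h g w a b)))))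

  negS : Series → Series
  negS f w a b = ℚ.- f w a b

  ⊛-negʳ : ∀ f h → negS f ⊛ h ≈ negS (f ⊛ h)
  ⊛-negʳ f h w a b = trans (⊛-def (negS f) h w a b) (sym (trans (cong ℚ.-_ (⊛-def f h w a b)) (trans (Σ-neg (splits w) _) (Σ-cong (splits w) (λ P → trans (Σ-neg (nsplits a) _) (Σ-cong (nsplits a) (λ A →
    trans (Σ-neg (nsplits b) _) (Σ-cong (nsplits b) (λ B → neg-distribˡ-· (f (proj₁ P) (proj₁ A) (proj₁ B)) (h (proj₂ P) (proj₂ A) (proj₂ B)))))))))))

  ⊛-distribʳ-⊖ : ∀ f g h → (f ⊖S g) ⊛ h ≈ f ⊛ h ⊖S g ⊛ h
  ⊛-distribʳ-⊖ f g h = ≈-trans {(f ⊖S g) ⊛ h} (⊛-distribʳ f (negS g) h) (⊕-cong {f ⊛ h} ≈-refl (⊛-negʳ g h))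

  ⊛-negˡ : ∀ f h → h ⊛ negS f ≈ negS (h ⊛ f)
  ⊛-negˡ f h w a b = trans (⊛-def h (negS f) w a b) (sym (trans (cong ℚ.-_ (⊛-def h f w a b)) (trans (Σ-neg (splits w) _) (Σ-cong (splits w) (λ P → trans (Σ-neg (nsplits a) _) (Σ-cong (nsplits a) (λ A →
    trans (Σ-neg (nsplits b) _) (Σ-cong (nsplits b) (λ B → neg-distribʳ-· (h (proj₁ P) (proj₁ A) (proj₁ B)) (f (proj₂ P) (proj₂ A) (proj₂ B)))))))))))

  ⊛-distribˡ-⊖ : ∀ f g h → h ⊛ (f ⊖S g) ≈ h ⊛ f ⊖S h ⊛ g
  ⊛-distribˡ-⊖ f g h = ≈-trans {h ⊛ (f ⊖S g)} (⊛-distribˡ f (negS g) h) (⊕-cong {h ⊛ f} ≈-refl (⊛-negˡ g h))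

open SeriesAlgebra

module Associativity where

  open ≡-Reasoning

  Σ-splits≡listSplits : ∀ w (F : Word × Word → ℚ) → SumL (splits w) F ≡ SumL (listSplits w) F
  Σ-splits≡listSplits w F = cong (λ L → SumL L F) (splits≡listSplits w)

  Σ-interleave : {X X' Y Y' Z Z' : Set} (LX : List X) (MX : X → List X') (LY : List Y) (MY : Y → List Y') (LZ : List Z) (MZ : Z → List Z')
    (K : X → X' → Y → Y' → Z → Z' → ℚ) →
    SumL LX (λ x → SumL LY (λ y → SumL LZ (λ z → SumL (MX x) (λ x' → SumL (MY y) (λ y' → SumL (MZ z) (λ z' → K x x' y y' z z')))))) ≡
    SumL LX (λ x → SumL (MX x) (λ x' → SumL LY (λ y → SumL (MY y) (λ y' → SumL LZ (λ z → SumL (MZ z) (λ z' → K x x' y y' z z'))))))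
  Σ-interleave LX MX LY MY LZ MZ K = Σ-cong LX (λ x →
    trans (Σ-cong LY (λ y → Σ-swap LZ (MX x) (λ z x' → SumL (MY y) (λ y' → SumL (MZ z) (λ z' → K x x' y y' z z')))))
    (trans (Σ-swap LY (MX x) (λ y x' → SumL LZ (λ z → SumL (MY y) (λ y' → SumL (MZ z) (λ z' → K x x' y y' z z')))))
    (Σ-cong (MX x) (λ x' → Σ-cong LY (λ y → Σ-swap LZ (MY y) (λ z y' → SumL (MZ z) (λ z' → K x x' y y' z z')))))))

  tripleConvolution : Series → Series → Series → Series
  tripleConvolution f g h w a b = SumL (listSplits w) (λ P → SumL (listSplits (proj₂ P)) (λ Q → SumL (nsplits a) (λ A → SumL (nsplits (proj₂ A)) (λ A' →
    SumL (nsplits b) (λ B → SumL (nsplits (proj₂ B)) (λ B' →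
    f (proj₁ P) (proj₁ A) (proj₁ B) · (g (proj₁ Q) (proj₁ A') (proj₁ B') · h (proj₂ Q) (proj₂ A') (proj₂ B'))))))))

  ⊛-nestedʳ : ∀ f g h w a b → (f ⊛ (g ⊛ h)) w a b ≡ tripleConvolution f g h w a b
  ⊛-nestedʳ f g h w a b = begin
    (f ⊛ (g ⊛ h)) w a b ≡⟨ ⊛-def f (g ⊛ h) w a b ⟩
    SumL (splits w) (λ P → SumL (nsplits a) (λ A → SumL (nsplits b) (λ B →
      f (proj₁ P) (proj₁ A) (proj₁ B) · (g ⊛ h) (proj₂ P) (proj₂ A) (proj₂ B))))
      ≡⟨ Σ-cong (splits w) (λ P → Σ-cong (nsplits a) (λ A → Σ-cong (nsplits b) (λ B →
           trans (cong (f (proj₁ P) (proj₁ A) (proj₁ B) ·_) (⊛-def g h (proj₂ P) (proj₂ A) (proj₂ B)))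
           (trans (Σ-*ˡ (splits (proj₂ P)) _ _) (Σ-cong (splits (proj₂ P)) (λ Q →
           trans (Σ-*ˡ (nsplits (proj₂ A)) _ _) (Σ-cong (nsplits (proj₂ A)) (λ A' → Σ-*ˡ (nsplits (proj₂ B)) _ _)))))))) ⟩
    SumL (splits w) (λ P → SumL (nsplits a) (λ A → SumL (nsplits b) (λ B →
      SumL (splits (proj₂ P)) (λ Q → SumL (nsplits (proj₂ A)) (λ A' → SumL (nsplits (proj₂ B)) (λ B' →
      f (proj₁ P) (proj₁ A) (proj₁ B) · (g (proj₁ Q) (proj₁ A') (proj₁ B') · h (proj₂ Q) (proj₂ A') (proj₂ B'))))))))
      ≡⟨ Σ-interleave (splits w) (λ P → splits (proj₂ P)) (nsplits a) (λ A → nsplits (proj₂ A)) (nsplits b) (λ B → nsplits (proj₂ B))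
           (λ P Q A A' B B' → f (proj₁ P) (proj₁ A) (proj₁ B) · (g (proj₁ Q) (proj₁ A') (proj₁ B') · h (proj₂ Q) (proj₂ A') (proj₂ B'))) ⟩
    SumL (splits w) (λ P → SumL (splits (proj₂ P)) (λ Q → SumL (nsplits a) (λ A → SumL (nsplits (proj₂ A)) (λ A' →
      SumL (nsplits b) (λ B → SumL (nsplits (proj₂ B)) (λ B' →
      f (proj₁ P) (proj₁ A) (proj₁ B) · (g (proj₁ Q) (proj₁ A') (proj₁ B') · h (proj₂ Q) (proj₂ A') (proj₂ B'))))))))
      ≡⟨ trans (Σ-splits≡listSplits w _) (Σ-cong (listSplits w) (λ P → Σ-splits≡listSplits (proj₂ P) _)) ⟩
    tripleConvolution f g h w a b ∎

  ⊛-nestedˡ : ∀ f g h w a b → ((f ⊛ g) ⊛ h) w a b ≡ tripleConvolution f g h w a b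
  ⊛-nestedˡ f g h w a b = begin
    ((f ⊛ g) ⊛ h) w a b ≡⟨ ⊛-def (f ⊛ g) h w a b ⟩
    SumL (splits w) (λ P → SumL (nsplits a) (λ A → SumL (nsplits b) (λ B →
      (f ⊛ g) (proj₁ P) (proj₁ A) (proj₁ B) · h (proj₂ P) (proj₂ A) (proj₂ B))))
      ≡⟨ Σ-cong (splits w) (λ P → Σ-cong (nsplits a) (λ A → Σ-cong (nsplits b) (λ B →
           trans (cong (_· h (proj₂ P) (proj₂ A) (proj₂ B)) (⊛-def f g (proj₁ P) (proj₁ A) (proj₁ B)))
           (trans (Σ-*ʳ (splits (proj₁ P)) _ _) (Σ-cong (splits (proj₁ P)) (λ Q →
           trans (Σ-*ʳ (nsplits (proj₁ A)) _ _) (Σ-cong (nsplits (proj₁ A)) (λ A' → trans (Σ-*ʳ (nsplits (proj₁ B)) _ _)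
             (Σ-cong (nsplits (proj₁ B)) (λ B' → ·-assoc (f (proj₁ Q) (proj₁ A') (proj₁ B')) (g (proj₂ Q) (proj₂ A') (proj₂ B')) (h (proj₂ P) (proj₂ A) (proj₂ B)))))))))))) ⟩
    SumL (splits w) (λ P → SumL (nsplits a) (λ A → SumL (nsplits b) (λ B →
      SumL (splits (proj₁ P)) (λ Q → SumL (nsplits (proj₁ A)) (λ A' → SumL (nsplits (proj₁ B)) (λ B' →
      f (proj₁ Q) (proj₁ A') (proj₁ B') · (g (proj₂ Q) (proj₂ A') (proj₂ B') · h (proj₂ P) (proj₂ A) (proj₂ B))))))))
      ≡⟨ Σ-interleave (splits w) (λ P → splits (proj₁ P)) (nsplits a) (λ A → nsplits (proj₁ A)) (nsplits b) (λ B → nsplits (proj₁ B))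
           (λ P Q A A' B B' → f (proj₁ Q) (proj₁ A') (proj₁ B') · (g (proj₂ Q) (proj₂ A') (proj₂ B') · h (proj₂ P) (proj₂ A) (proj₂ B))) ⟩
    SumL (splits w) (λ P → SumL (splits (proj₁ P)) (λ Q → SumL (nsplits a) (λ A → SumL (nsplits (proj₁ A)) (λ A' →
      SumL (nsplits b) (λ B → SumL (nsplits (proj₁ B)) (λ B' →
      f (proj₁ Q) (proj₁ A') (proj₁ B') · (g (proj₂ Q) (proj₂ A') (proj₂ B') · h (proj₂ P) (proj₂ A) (proj₂ B))))))))
      ≡⟨ trans (Σ-splits≡listSplits w _) (Σ-cong (listSplits w) (λ P → Σ-splits≡listSplits (proj₁ P) _)) ⟩
    SumL (listSplits w) (λ P → SumL (listSplits (proj₁ P)) (λ Q → SumL (nsplits a) (λ A → SumL (nsplits (proj₁ A)) (λ A' →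
      SumL (nsplits b) (λ B → SumL (nsplits (proj₁ B)) (λ B' →
      f (proj₁ Q) (proj₁ A') (proj₁ B') · (g (proj₂ Q) (proj₂ A') (proj₂ B') · h (proj₂ P) (proj₂ A) (proj₂ B))))))))
      ≡⟨ listSplits-assoc w (λ q1 q2 p2 → SumL (nsplits a) (λ A → SumL (nsplits (proj₁ A)) (λ A' →
           SumL (nsplits b) (λ B → SumL (nsplits (proj₁ B)) (λ B' →
           f q1 (proj₁ A') (proj₁ B') · (g q2 (proj₂ A') (proj₂ B') · h p2 (proj₂ A) (proj₂ B))))))) ⟩
    SumL (listSplits w) (λ P → SumL (listSplits (proj₂ P)) (λ Q → SumL (nsplits a) (λ A → SumL (nsplits (proj₁ A)) (λ A' →
      SumL (nsplits b) (λ B → SumL (nsplits (proj₁ B)) (λ B' →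
      f (proj₁ P) (proj₁ A') (proj₁ B') · (g (proj₁ Q) (proj₂ A') (proj₂ B') · h (proj₂ Q) (proj₂ A) (proj₂ B))))))))
      ≡⟨ Σ-cong (listSplits w) (λ P → Σ-cong (listSplits (proj₂ P)) (λ Q →
           trans (Σ-nsplits-assoc a (λ α β γ → SumL (nsplits b) (λ B → SumL (nsplits (proj₁ B)) (λ B' →
                  f (proj₁ P) α (proj₁ B') · (g (proj₁ Q) β (proj₂ B') · h (proj₂ Q) γ (proj₂ B))))))
           (Σ-cong (nsplits a) (λ A → Σ-cong (nsplits (proj₂ A)) (λ A' →
             Σ-nsplits-assoc b (λ α β γ → f (proj₁ P) (proj₁ A) α · (g (proj₁ Q) (proj₁ A') β · h (proj₂ Q) (proj₂ A') γ))))))) ⟩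
    tripleConvolution f g h w a b ∎

  ⊛-assoc : ∀ f g h → (f ⊛ g) ⊛ h ≈ f ⊛ (g ⊛ h)
  ⊛-assoc f g h w a b = trans (⊛-nestedˡ f g h w a b) (sym (⊛-nestedʳ f g h w a b))

open Associativity

module MonomialProducts where

  open ≡-Reasoning

  -- Coefficient extraction after left multiplication by a letter, and by t or u
  -- (atPred n g = g (n − 1), and 0 when n = 0).
  afterLetter : Letter → Word → (Word → ℚ) → ℚ
  afterLetter c [] g = 0ℚ
  afterLetter X (X ∷ w) g = g w
  afterLetter X (Y ∷ w) g = 0ℚ
  afterLetter Y (X ∷ w) g = 0ℚ
  afterLetter Y (Y ∷ w) g = g w

  atPred : ℕ → (ℕ → ℚ) → ℚ
  atPred zero g = 0ℚ
  atPred (suc n) g = g n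

  Σ-splits-δ[]ˡ : ∀ w (G : Word → ℚ) → SumL (splits w) (λ P → δW [] (proj₁ P) · G (proj₂ P)) ≡ G w
  Σ-splits-δ[]ˡ [] G = trans (SumL-∷ _ _ _) (trans (cong₂ _⊹_ (trans (cong (_· G []) (δW-refl [])) (·-idˡ (G []))) (SumL-[] _)) (⊹-idʳ _))
  Σ-splits-δ[]ˡ (c ∷ w) G = trans (SumL-∷ _ _ _) (trans (cong₂ _⊹_ (trans (cong (_· G (c ∷ w)) (δW-refl [])) (·-idˡ (G (c ∷ w))))
    (trans (Σ-map (splits w) (λ p → (c ∷ proj₁ p , proj₂ p)) _) (Σ-0' (splits w) _ (λ P → trans (cong (_· G (proj₂ P)) (δW-[]∷ c (proj₁ P))) (·-zeroˡ _))))) (⊹-idʳ _))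

  Σ-splits-δ[]ʳ : ∀ w (G : Word → ℚ) → SumL (splits w) (λ P → G (proj₁ P) · δW [] (proj₂ P)) ≡ G w
  Σ-splits-δ[]ʳ [] G = trans (SumL-∷ _ _ _) (trans (cong₂ _⊹_ (trans (cong (G [] ·_) (δW-refl [])) (·-idʳ (G []))) (SumL-[] _)) (⊹-idʳ _))
  Σ-splits-δ[]ʳ (c ∷ w) G = trans (SumL-∷ _ _ _) (trans (cong₂ _⊹_ (trans (cong (G [] ·_) (δW-[]∷ c w)) (·-zeroʳ (G [])))
    (trans (Σ-map (splits w) (λ p → (c ∷ proj₁ p , proj₂ p)) _) (Σ-splits-δ[]ʳ w (λ v → G (c ∷ v))))) (⊹-idˡ _))

  Σ-splits-δLetter : ∀ c w (G : Word → ℚ) → SumL (splits w) (λ P → δW (c ∷ []) (proj₁ P) · G (proj₂ P)) ≡ afterLetter c w G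
  Σ-splits-δLetter c [] G = trans (SumL-∷ _ _ _) (trans (cong₂ _⊹_ (trans (cong (_· G []) (δW-∷[] c [])) (·-zeroˡ (G []))) (SumL-[] _)) (⊹-idʳ _))
  Σ-splits-δLetter c (d ∷ w) G = trans (SumL-∷ _ _ _) (trans (cong₂ _⊹_ (trans (cong (_· G (d ∷ w)) (δW-∷[] c [])) (·-zeroˡ (G (d ∷ w))))
    (Σ-map (splits w) (λ p → (d ∷ proj₁ p , proj₂ p)) _)) (trans (⊹-idˡ _) (h c d)))
    where
    rest : Letter → Letter → ℚ
    rest c d = SumL (splits w) (λ P → δW (c ∷ []) (d ∷ proj₁ P) · G (proj₂ P))
    same : ∀ c → rest c c ≡ G w
    same c = trans (Σ-cong (splits w) (λ P → cong (_· G (proj₂ P)) (δW-cons c [] (proj₁ P)))) (Σ-splits-δ[]ˡ w G)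
    diff : ∀ c d → ¬ (c ≡ d) → rest c d ≡ 0ℚ
    diff c d ne = Σ-0' (splits w) _ (λ P → trans (cong (_· G (proj₂ P)) (δW-cons≢ c d [] (proj₁ P) ne)) (·-zeroˡ _))
    h : ∀ c d → rest c d ≡ afterLetter c (d ∷ w) G
    h X X = same X
    h X Y = diff X Y (λ ())
    h Y X = diff Y X (λ ())
    h Y Y = same Y

  Σ-nsplits-δ1 : ∀ a (G : ℕ → ℚ) → SumL (nsplits a) (λ A → δN 1 (proj₁ A) · G (proj₂ A)) ≡ atPred a G
  Σ-nsplits-δ1 zero G = Σ-nsplits-δ-beyond 0 1 G (s≤s z≤n)
  Σ-nsplits-δ1 (suc a) G = Σ-nsplits-δ 1 a G

  ·-rotate : ∀ f w a b → f · (w · (a · b)) ≡ w · (a · (b · f))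
  ·-rotate f w a b = trans (·-comm f _) (trans (·-assoc w (a · b) f) (cong (w ·_) (·-assoc a b f)))

  mono-⊛ : ∀ v a0 b0 F w a b → (mono v a0 b0 ⊛ F) w a b ≡
    SumL (splits w) (λ P → δW v (proj₁ P) · SumL (nsplits a) (λ A → δN a0 (proj₁ A) · SumL (nsplits b) (λ B → δN b0 (proj₁ B) · F (proj₂ P) (proj₂ A) (proj₂ B))))
  mono-⊛ v a0 b0 F w a b = trans (⊛-def (mono v a0 b0) F w a b) (Σ-cong (splits w) (λ P →
    trans (Σ-cong (nsplits a) (λ A → trans (Σ-cong (nsplits b) (λ B →
      trans (cong (_· F (proj₂ P) (proj₂ A) (proj₂ B)) (trans (cong (ℚ._*_ (δW v (proj₁ P))) (·-def (δN a0 (proj₁ A)) (δN b0 (proj₁ B)))) (·-def (δW v (proj₁ P)) _)))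
      (trans (·-assoc (δW v (proj₁ P)) _ _) (cong (δW v (proj₁ P) ·_) (·-assoc (δN a0 (proj₁ A)) (δN b0 (proj₁ B)) _)))))
      (trans (sym (Σ-*ˡ (nsplits b) (δW v (proj₁ P)) _)) (cong (δW v (proj₁ P) ·_) (sym (Σ-*ˡ (nsplits b) (δN a0 (proj₁ A)) _))))))
    (sym (Σ-*ˡ (nsplits a) (δW v (proj₁ P)) _))))

  ⊛-mono : ∀ a0 b0 F w a b → (F ⊛ mono [] a0 b0) w a b ≡
    SumL (nsplits a) (λ A → δN a0 (proj₁ A) · SumL (nsplits b) (λ B → δN b0 (proj₁ B) · F w (proj₂ A) (proj₂ B)))
  ⊛-mono a0 b0 F w a b = begin
    (F ⊛ mono [] a0 b0) w a b ≡⟨ ⊛-def F (mono [] a0 b0) w a b ⟩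
    SumL (splits w) (λ P → SumL (nsplits a) (λ A → SumL (nsplits b) (λ B → F (proj₁ P) (proj₁ A) (proj₁ B) · mono [] a0 b0 (proj₂ P) (proj₂ A) (proj₂ B))))
      ≡⟨ Σ-cong (splits w) (λ P → trans (Σ-cong (nsplits a) (λ A → trans (Σ-cong (nsplits b) (λ B →
          trans (cong (F (proj₁ P) (proj₁ A) (proj₁ B) ·_) (trans (cong (ℚ._*_ (δW [] (proj₂ P))) (·-def (δN a0 (proj₂ A)) (δN b0 (proj₂ B)))) (·-def (δW [] (proj₂ P)) _)))
          (·-rotate _ _ _ _)))
          (sym (Σ-*ˡ (nsplits b) (δW [] (proj₂ P)) _)))) (sym (Σ-*ˡ (nsplits a) (δW [] (proj₂ P)) _))) ⟩
    SumL (splits w) (λ P → δW [] (proj₂ P) · SumL (nsplits a) (λ A → SumL (nsplits b) (λ B → δN a0 (proj₂ A) · (δN b0 (proj₂ B) · F (proj₁ P) (proj₁ A) (proj₁ B)))))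
      ≡⟨ trans (Σ-cong (splits w) (λ P → ·-comm _ _)) (Σ-splits-δ[]ʳ w (λ v → SumL (nsplits a) (λ A → SumL (nsplits b) (λ B → δN a0 (proj₂ A) · (δN b0 (proj₂ B) · F v (proj₁ A) (proj₁ B)))))) ⟩
    SumL (nsplits a) (λ A → SumL (nsplits b) (λ B → δN a0 (proj₂ A) · (δN b0 (proj₂ B) · F w (proj₁ A) (proj₁ B))))
      ≡⟨ trans (Σ-cong (nsplits a) (λ A → sym (Σ-*ˡ (nsplits b) (δN a0 (proj₂ A)) _))) (Σ-nsplits-swap a (λ x y → δN a0 y · SumL (nsplits b) (λ B → δN b0 (proj₂ B) · F w x (proj₁ B)))) ⟩
    SumL (nsplits a) (λ A → δN a0 (proj₁ A) · SumL (nsplits b) (λ B → δN b0 (proj₂ B) · F w (proj₂ A) (proj₁ B)))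
      ≡⟨ Σ-cong (nsplits a) (λ A → cong (δN a0 (proj₁ A) ·_) (Σ-nsplits-swap b (λ x y → δN b0 y · F w (proj₂ A) x))) ⟩
    SumL (nsplits a) (λ A → δN a0 (proj₁ A) · SumL (nsplits b) (λ B → δN b0 (proj₁ B) · F w (proj₂ A) (proj₂ B))) ∎

open MonomialProducts

module LetterProducts where

  open ≡-Reasoning

  Σ²-nsplits-δ0 : ∀ a b (G : ℕ → ℕ → ℚ) → SumL (nsplits a) (λ A → δN 0 (proj₁ A) · SumL (nsplits b) (λ B → δN 0 (proj₁ B) · G (proj₂ A) (proj₂ B))) ≡ G a b
  Σ²-nsplits-δ0 a b G = trans (Σ-cong (nsplits a) (λ A → cong (δN 0 (proj₁ A) ·_) (Σ-nsplits-δ0 b (G (proj₂ A))))) (Σ-nsplits-δ0 a (λ a' → G a' b))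

  𝕩⊛ : ∀ F w a b → (𝕩 ⊛ F) w a b ≡ afterLetter X w (λ w' → F w' a b)
  𝕩⊛ F w a b = trans (mono-⊛ (X ∷ []) 0 0 F w a b) (trans (Σ-cong (splits w) (λ P → cong (δW (X ∷ []) (proj₁ P) ·_) (Σ²-nsplits-δ0 a b (F (proj₂ P))))) (Σ-splits-δLetter X w (λ w' → F w' a b)))

  𝕪⊛ : ∀ F w a b → (𝕪 ⊛ F) w a b ≡ afterLetter Y w (λ w' → F w' a b)
  𝕪⊛ F w a b = trans (mono-⊛ (Y ∷ []) 0 0 F w a b) (trans (Σ-cong (splits w) (λ P → cong (δW (Y ∷ []) (proj₁ P) ·_) (Σ²-nsplits-δ0 a b (F (proj₂ P))))) (Σ-splits-δLetter Y w (λ w' → F w' a b)))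

  𝟙⊛ : ∀ F → 𝟙 ⊛ F ≈ F
  𝟙⊛ F w a b = trans (mono-⊛ [] 0 0 F w a b) (trans (Σ-cong (splits w) (λ P → cong (δW [] (proj₁ P) ·_) (Σ²-nsplits-δ0 a b (F (proj₂ P))))) (Σ-splits-δ[]ˡ w (λ w' → F w' a b)))

  𝕥⊛ : ∀ F w a b → (𝕥 ⊛ F) w a b ≡ atPred a (λ a' → F w a' b)
  𝕥⊛ F w a b = trans (mono-⊛ [] 1 0 F w a b) (trans (Σ-cong (splits w) (λ P → cong (δW [] (proj₁ P) ·_)
    (Σ-cong (nsplits a) (λ A → cong (δN 1 (proj₁ A) ·_) (Σ-nsplits-δ0 b (F (proj₂ P) (proj₂ A)))))))
    (trans (Σ-splits-δ[]ˡ w (λ w' → SumL (nsplits a) (λ A → δN 1 (proj₁ A) · F w' (proj₂ A) b))) (Σ-nsplits-δ1 a (λ a' → F w a' b))))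

  𝕦⊛ : ∀ F w a b → (𝕦 ⊛ F) w a b ≡ atPred b (λ b' → F w a b')
  𝕦⊛ F w a b = trans (mono-⊛ [] 0 1 F w a b) (trans (Σ-cong (splits w) (λ P → cong (δW [] (proj₁ P) ·_)
    (Σ-cong (nsplits a) (λ A → cong (δN 0 (proj₁ A) ·_) (Σ-nsplits-δ1 b (F (proj₂ P) (proj₂ A)))))))
    (trans (Σ-splits-δ[]ˡ w (λ w' → SumL (nsplits a) (λ A → δN 0 (proj₁ A) · atPred b (F w' (proj₂ A))))) (Σ-nsplits-δ0 a (λ a' → atPred b (F w a')))))

  ⊛𝟙 : ∀ F → F ⊛ 𝟙 ≈ F
  ⊛𝟙 F w a b = trans (⊛-mono 0 0 F w a b) (Σ²-nsplits-δ0 a b (F w))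

  ⊛𝕥 : ∀ F w a b → (F ⊛ 𝕥) w a b ≡ atPred a (λ a' → F w a' b)
  ⊛𝕥 F w a b = trans (⊛-mono 1 0 F w a b) (trans (Σ-cong (nsplits a) (λ A → cong (δN 1 (proj₁ A) ·_) (Σ-nsplits-δ0 b (F w (proj₂ A))))) (Σ-nsplits-δ1 a (λ a' → F w a' b)))

  ⊛𝕦 : ∀ F w a b → (F ⊛ 𝕦) w a b ≡ atPred b (λ b' → F w a b')
  ⊛𝕦 F w a b = trans (⊛-mono 0 1 F w a b) (trans (Σ-cong (nsplits a) (λ A → cong (δN 0 (proj₁ A) ·_) (Σ-nsplits-δ1 b (F w (proj₂ A))))) (Σ-nsplits-δ0 a (λ a' → atPred b (F w a'))))

  𝕥-central : ∀ F → 𝕥 ⊛ F ≈ F ⊛ 𝕥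
  𝕥-central F w a b = trans (𝕥⊛ F w a b) (sym (⊛𝕥 F w a b))

  𝕦-central : ∀ F → 𝕦 ⊛ F ≈ F ⊛ 𝕦
  𝕦-central F w a b = trans (𝕦⊛ F w a b) (sym (⊛𝕦 F w a b))

  xCoeff : Word → (ℕ → ℚ) → ℚ
  xCoeff [] g = g 0
  xCoeff (X ∷ w) g = xCoeff w (g ∘ suc)
  xCoeff (Y ∷ w) g = 0ℚ

  -- A series supported on the words xʲ; its coefficient of xʲ tᵃ uᵇ is φ j a b.
  xSeries : (ℕ → ℕ → ℕ → ℚ) → Series
  xSeries φ w a b = xCoeff w (λ j → φ j a b)

  xCoeff-cong : ∀ w {g h : ℕ → ℚ} → (∀ j → g j ≡ h j) → xCoeff w g ≡ xCoeff w h
  xCoeff-cong [] e = e 0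
  xCoeff-cong (X ∷ w) e = xCoeff-cong w (λ j → e (suc j))
  xCoeff-cong (Y ∷ w) e = refl

  xCoeff-0 : ∀ w → xCoeff w (λ _ → 0ℚ) ≡ 0ℚ
  xCoeff-0 [] = refl
  xCoeff-0 (X ∷ w) = xCoeff-0 w
  xCoeff-0 (Y ∷ w) = refl

  xCoeff-vanish : ∀ w (g : ℕ → ℚ) → (∀ j → g j ≡ 0ℚ) → xCoeff w g ≡ 0ℚ
  xCoeff-vanish w g e = trans (xCoeff-cong w e) (xCoeff-0 w)

  xCoeff-⊹ : ∀ w (g h : ℕ → ℚ) → xCoeff w (λ j → g j ⊹ h j) ≡ xCoeff w g ⊹ xCoeff w h
  xCoeff-⊹ [] g h = refl
  xCoeff-⊹ (X ∷ w) g h = xCoeff-⊹ w (g ∘ suc) (h ∘ suc)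
  xCoeff-⊹ (Y ∷ w) g h = sym (⊹-idˡ 0ℚ)

  xCoeff-neg : ∀ w (g : ℕ → ℚ) → xCoeff w (λ j → ℚ.- g j) ≡ ℚ.- xCoeff w g
  xCoeff-neg [] g = refl
  xCoeff-neg (X ∷ w) g = xCoeff-neg w (g ∘ suc)
  xCoeff-neg (Y ∷ w) g = refl

  xCoeff-Σ : ∀ {A : Set} w (L : List A) (g : ℕ → A → ℚ) → xCoeff w (λ j → SumL L (g j)) ≡ SumL L (λ n → xCoeff w (λ j → g j n))
  xCoeff-Σ [] L g = refl
  xCoeff-Σ (X ∷ w) L g = xCoeff-Σ w L (λ j → g (suc j))
  xCoeff-Σ (Y ∷ w) L g = sym (Σ-0 L)

  xSeries-cong : ∀ {φ ψ} → (∀ j a b → φ j a b ≡ ψ j a b) → xSeries φ ≈ xSeries ψ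
  xSeries-cong e w a b = xCoeff-cong w (λ j → e j a b)

  𝕩⊛xSeries : ∀ φ → 𝕩 ⊛ xSeries φ ≈ xSeries (λ j a b → atPred j (λ j' → φ j' a b))
  𝕩⊛xSeries φ w a b = trans (𝕩⊛ (xSeries φ) w a b) (h w)
    where
    h : ∀ w → afterLetter X w (λ w' → xSeries φ w' a b) ≡ xSeries (λ j a b → atPred j (λ j' → φ j' a b)) w a b
    h [] = refl
    h (X ∷ w) = refl
    h (Y ∷ w) = refl

  𝕥⊛xSeries : ∀ φ → 𝕥 ⊛ xSeries φ ≈ xSeries (λ j a b → atPred a (λ a' → φ j a' b))
  𝕥⊛xSeries φ w a b = trans (𝕥⊛ (xSeries φ) w a b) (h a)
    where
    h : ∀ a → atPred a (λ a' → xSeries φ w a' b) ≡ xSeries (λ j a b → atPred a (λ a' → φ j a' b)) w a b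
    h zero = sym (xCoeff-0 w)
    h (suc a) = refl

  𝕦⊛xSeries : ∀ φ → 𝕦 ⊛ xSeries φ ≈ xSeries (λ j a b → atPred b (λ b' → φ j a b'))
  𝕦⊛xSeries φ w a b = trans (𝕦⊛ (xSeries φ) w a b) (h b)
    where
    h : ∀ b → atPred b (λ b' → xSeries φ w a b') ≡ xSeries (λ j a b → atPred b (λ b' → φ j a b')) w a b
    h zero = sym (xCoeff-0 w)
    h (suc b) = refl

  xSeries-⊕ : ∀ φ ψ → xSeries φ ⊕S xSeries ψ ≈ xSeries (λ j a b → φ j a b ⊹ ψ j a b)
  xSeries-⊕ φ ψ w a b = trans (⊹-def _ _) (sym (xCoeff-⊹ w (λ j → φ j a b) (λ j → ψ j a b)))

  xSeries-⊖ : ∀ φ ψ → xSeries φ ⊖S xSeries ψ ≈ xSeries (λ j a b → φ j a b ⊹ ℚ.- ψ j a b)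
  xSeries-⊖ φ ψ w a b = trans (sub-def _ _) (trans (cong (xSeries φ w a b ⊹_) (sym (xCoeff-neg w (λ j → ψ j a b)))) (sym (xCoeff-⊹ w (λ j → φ j a b) (λ j → ℚ.- ψ j a b))))

  mono-coeff : ∀ v a0 b0 w a b → mono v a0 b0 w a b ≡ δW v w · (δN a0 a · δN b0 b)
  mono-coeff v a0 b0 w a b = trans (cong (ℚ._*_ (δW v w)) (·-def (δN a0 a) (δN b0 b))) (·-def (δW v w) _)

  𝟙≈xSeries : 𝟙 ≈ xSeries (λ j a b → δN j 0 · (δN 0 a · δN 0 b))
  𝟙≈xSeries [] a b = trans (mono-coeff [] 0 0 [] a b) (cong (_· (δN 0 a · δN 0 b)) (trans (δW-refl []) (sym (δN-refl 0))))
  𝟙≈xSeries (X ∷ w) a b = trans (mono-coeff [] 0 0 (X ∷ w) a b) (trans (trans (cong (_· (δN 0 a · δN 0 b)) (δW-[]∷ X w)) (·-zeroˡ _))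
    (sym (xCoeff-vanish w (λ j → δN (suc j) 0 · (δN 0 a · δN 0 b)) (λ j → trans (cong (_· (δN 0 a · δN 0 b)) (δN-≢ {suc j} {0} (λ ()))) (·-zeroˡ _)))))
  𝟙≈xSeries (Y ∷ w) a b = trans (mono-coeff [] 0 0 (Y ∷ w) a b) (trans (cong (_· (δN 0 a · δN 0 b)) (δW-[]∷ Y w)) (·-zeroˡ _))

open LetterProducts

module GeometricSeries where

  open ≡-Reasoning

  ≡0-· : ∀ {x} y → x ≡ 0ℚ → x · y ≡ 0ℚ
  ≡0-· y e = trans (cong (_· y) e) (·-zeroˡ y)
  ·-≡0 : ∀ x {y} → y ≡ 0ℚ → x · y ≡ 0ℚ
  ·-≡0 x e = trans (cong (x ·_) e) (·-zeroʳ x)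
  δN-suc-0 : ∀ n → δN (suc n) 0 ≡ 0ℚ
  δN-suc-0 n = δN-≢ {suc n} {0} (λ ())
  δN-0-suc : ∀ n → δN 0 (suc n) ≡ 0ℚ
  δN-0-suc n = δN-≢ {0} {suc n} (λ ())

  afterLetter-cong : ∀ c w {g h : Word → ℚ} → (∀ v → g v ≡ h v) → afterLetter c w g ≡ afterLetter c w h
  afterLetter-cong c [] e = refl
  afterLetter-cong X (X ∷ w) e = e w
  afterLetter-cong X (Y ∷ w) e = refl
  afterLetter-cong Y (X ∷ w) e = refl
  afterLetter-cong Y (Y ∷ w) e = e w

  afterLetter-vanish : ∀ c w (g : Word → ℚ) → (∀ v → g v ≡ 0ℚ) → afterLetter c w g ≡ 0ℚ
  afterLetter-vanish c [] g e = refl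
  afterLetter-vanish X (X ∷ w) g e = e w
  afterLetter-vanish X (Y ∷ w) g e = refl
  afterLetter-vanish Y (X ∷ w) g e = refl
  afterLetter-vanish Y (Y ∷ w) g e = e w

  atPred-cong : ∀ n {g h : ℕ → ℚ} → (∀ k → g k ≡ h k) → atPred n g ≡ atPred n h
  atPred-cong zero e = refl
  atPred-cong (suc n) e = e n

  atPred-vanish : ∀ n (g : ℕ → ℚ) → (∀ k → g k ≡ 0ℚ) → atPred n g ≡ 0ℚ
  atPred-vanish zero g e = refl
  atPred-vanish (suc n) g e = e n

  𝕩𝕥𝕦 𝕩𝕦 : Series
  𝕩𝕥𝕦 = 𝕩 ⊛ 𝕥 ⊛ 𝕦
  𝕩𝕦 = 𝕩 ⊛ 𝕦

  𝕩𝕥𝕦⊛ : ∀ F w a b → (𝕩𝕥𝕦 ⊛ F) w a b ≡ afterLetter X w (λ w' → atPred a (λ a' → atPred b (λ b' → F w' a' b')))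
  𝕩𝕥𝕦⊛ F w a b = trans (⊛-assoc (𝕩 ⊛ 𝕥) 𝕦 F w a b) (trans (⊛-assoc 𝕩 𝕥 (𝕦 ⊛ F) w a b) (trans (𝕩⊛ (𝕥 ⊛ (𝕦 ⊛ F)) w a b)
    (afterLetter-cong X w (λ v → trans (𝕥⊛ (𝕦 ⊛ F) v a b) (atPred-cong a (λ a' → 𝕦⊛ F v a' b))))))

  𝕩𝕦⊛ : ∀ F w a b → (𝕩𝕦 ⊛ F) w a b ≡ afterLetter X w (λ w' → atPred b (λ b' → F w' a b'))
  𝕩𝕦⊛ F w a b = trans (⊛-assoc 𝕩 𝕦 F w a b) (trans (𝕩⊛ (𝕦 ⊛ F) w a b) (afterLetter-cong X w (λ v → 𝕦⊛ F v a b)))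

  𝕩𝕥𝕦⊛xSeries : ∀ φ → 𝕩𝕥𝕦 ⊛ xSeries φ ≈ xSeries (λ j a b → atPred j (λ j' → atPred a (λ a' → atPred b (λ b' → φ j' a' b'))))
  𝕩𝕥𝕦⊛xSeries φ w a b = trans (⊛-assoc (𝕩 ⊛ 𝕥) 𝕦 (xSeries φ) w a b) (trans (⊛-assoc 𝕩 𝕥 (𝕦 ⊛ xSeries φ) w a b)
    (trans (⊛-cong {𝕩} ≈-refl (⊛-cong {𝕥} ≈-refl (𝕦⊛xSeries φ)) w a b) (trans (⊛-cong {𝕩} ≈-refl (𝕥⊛xSeries _) w a b) (𝕩⊛xSeries _ w a b))))

  𝕩𝕦⊛xSeries : ∀ φ → 𝕩𝕦 ⊛ xSeries φ ≈ xSeries (λ j a b → atPred j (λ j' → atPred b (λ b' → φ j' a b')))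
  𝕩𝕦⊛xSeries φ w a b = trans (⊛-assoc 𝕩 𝕦 (xSeries φ) w a b) (trans (⊛-cong {𝕩} ≈-refl (𝕦⊛xSeries φ) w a b) (𝕩⊛xSeries _ w a b))

  𝕩𝕥𝕦^S-coeffs : ℕ → ℕ → ℕ → ℕ → ℚ
  𝕩𝕥𝕦^S-coeffs n j a b = δN j n · (δN a n · δN b n)

  𝕩𝕥𝕦^S-coeff-suc : ∀ n j a b → atPred j (λ j' → atPred a (λ a' → atPred b (λ b' → 𝕩𝕥𝕦^S-coeffs n j' a' b'))) ≡ 𝕩𝕥𝕦^S-coeffs (suc n) j a b
  𝕩𝕥𝕦^S-coeff-suc n zero a b = sym (≡0-· _ (δN-0-suc n))
  𝕩𝕥𝕦^S-coeff-suc n (suc j) zero b = sym (·-≡0 _ (≡0-· _ (δN-0-suc n)))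
  𝕩𝕥𝕦^S-coeff-suc n (suc j) (suc a) zero = sym (·-≡0 _ (·-≡0 _ (δN-0-suc n)))
  𝕩𝕥𝕦^S-coeff-suc n (suc j) (suc a) (suc b) = sym (cong₂ _·_ (δN-suc j n) (cong₂ _·_ (δN-suc a n) (δN-suc b n)))

  𝕩𝕥𝕦^S-coeff : ∀ n → 𝕩𝕥𝕦 ^S n ≈ xSeries (𝕩𝕥𝕦^S-coeffs n)
  𝕩𝕥𝕦^S-coeff zero = ≈-trans {𝟙} 𝟙≈xSeries (xSeries-cong (λ j a b → cong (δN j 0 ·_) (cong₂ _·_ (δN-sym 0 a) (δN-sym 0 b))))
  𝕩𝕥𝕦^S-coeff (suc n) = ≈-trans {𝕩𝕥𝕦 ⊛ (𝕩𝕥𝕦 ^S n)} (⊛-cong {𝕩𝕥𝕦} ≈-refl (𝕩𝕥𝕦^S-coeff n)) (≈-trans {𝕩𝕥𝕦 ⊛ xSeries (𝕩𝕥𝕦^S-coeffs n)} (𝕩𝕥𝕦⊛xSeries (𝕩𝕥𝕦^S-coeffs n)) (xSeries-cong (𝕩𝕥𝕦^S-coeff-suc n)))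

  𝕩𝕦^S-coeffs : ℕ → ℕ → ℕ → ℕ → ℚ
  𝕩𝕦^S-coeffs n j a b = δN j n · (δN a 0 · δN b n)

  𝕩𝕦^S-coeff-suc : ∀ n j a b → atPred j (λ j' → atPred b (λ b' → 𝕩𝕦^S-coeffs n j' a b')) ≡ 𝕩𝕦^S-coeffs (suc n) j a b
  𝕩𝕦^S-coeff-suc n zero a b = sym (≡0-· _ (δN-0-suc n))
  𝕩𝕦^S-coeff-suc n (suc j) a zero = sym (·-≡0 _ (·-≡0 _ (δN-0-suc n)))
  𝕩𝕦^S-coeff-suc n (suc j) a (suc b) = sym (cong₂ _·_ (δN-suc j n) (cong (δN a 0 ·_) (δN-suc b n)))

  𝕩𝕦^S-coeff : ∀ n → 𝕩𝕦 ^S n ≈ xSeries (𝕩𝕦^S-coeffs n)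
  𝕩𝕦^S-coeff zero = ≈-trans {𝟙} 𝟙≈xSeries (xSeries-cong (λ j a b → cong (δN j 0 ·_) (cong₂ _·_ (δN-sym 0 a) (δN-sym 0 b))))
  𝕩𝕦^S-coeff (suc n) = ≈-trans {𝕩𝕦 ⊛ (𝕩𝕦 ^S n)} (⊛-cong {𝕩𝕦} ≈-refl (𝕩𝕦^S-coeff n)) (≈-trans {𝕩𝕦 ⊛ xSeries (𝕩𝕦^S-coeffs n)} (𝕩𝕦⊛xSeries (𝕩𝕦^S-coeffs n)) (xSeries-cong (𝕩𝕦^S-coeff-suc n)))

  Σ-upTo-δ : ∀ k b (G : ℕ → ℚ) → b < k → SumL (upTo k) (λ n → δN b n · G n) ≡ G b
  Σ-upTo-δ (suc k) b G lt = trans (SumL-∷ 0 (applyUpTo suc k) _) (trans (cong (δN b 0 · G 0 ⊹_)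
    (trans (cong (λ L → SumL L (λ n → δN b n · G n)) (sym (LP.map-upTo suc k))) (Σ-map (upTo k) suc (λ n → δN b n · G n)))) (h b lt))
    where
    h : ∀ b → b < suc k → δN b 0 · G 0 ⊹ SumL (upTo k) (λ n → δN b (suc n) · G (suc n)) ≡ G b
    h zero lt = trans (cong₂ _⊹_ (trans (cong (_· G 0) (δN-refl 0)) (·-idˡ (G 0))) (Σ-0' (upTo k) _ (λ n → ≡0-· _ (δN-0-suc n)))) (⊹-idʳ _)
    h (suc b) (s≤s lt) = trans (cong₂ _⊹_ (≡0-· _ (δN-suc-0 b)) (Σ-cong (upTo k) (λ n → cong (_· G (suc n)) (δN-suc b n)))) (trans (⊹-idˡ _) (Σ-upTo-δ k b (G ∘ suc) lt))

  geom-def : ∀ s w a b → geom s w a b ≡ SumL (upTo (suc (length w + a + b))) (λ n → (s ^S n) w a b)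
  geom-def s w a b = SumL-def (upTo (suc (length w + a + b))) (λ n → (s ^S n) w a b)

  geom𝕩𝕥𝕦-closed geom𝕩𝕦-closed : Series
  geom𝕩𝕥𝕦-closed = xSeries (λ j a b → δN j b · δN a b)
  geom𝕩𝕦-closed = xSeries (λ j a b → δN j b · δN a 0)

  geom𝕩𝕥𝕦≈closed : geom 𝕩𝕥𝕦 ≈ geom𝕩𝕥𝕦-closed
  geom𝕩𝕥𝕦≈closed w a b = begin
    geom 𝕩𝕥𝕦 w a b ≡⟨ geom-def 𝕩𝕥𝕦 w a b ⟩
    SumL (upTo (suc N)) (λ n → (𝕩𝕥𝕦 ^S n) w a b) ≡⟨ Σ-cong (upTo (suc N)) (λ n → 𝕩𝕥𝕦^S-coeff n w a b) ⟩
    SumL (upTo (suc N)) (λ n → xCoeff w (λ j → 𝕩𝕥𝕦^S-coeffs n j a b)) ≡⟨ sym (xCoeff-Σ w (upTo (suc N)) (λ j n → 𝕩𝕥𝕦^S-coeffs n j a b)) ⟩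
    xCoeff w (λ j → SumL (upTo (suc N)) (λ n → 𝕩𝕥𝕦^S-coeffs n j a b)) ≡⟨ xCoeff-cong w (λ j → trans (Σ-cong (upTo (suc N)) (λ n → r j n)) (Σ-upTo-δ (suc N) b (λ n → δN j n · δN a n) (s≤s (NP.m≤n+m b (length w + a))))) ⟩
    geom𝕩𝕥𝕦-closed w a b ∎
    where
    N : ℕ
    N = length w + a + b
    r : ∀ j n → 𝕩𝕥𝕦^S-coeffs n j a b ≡ δN b n · (δN j n · δN a n)
    r j n = trans (sym (·-assoc (δN j n) (δN a n) (δN b n))) (·-comm _ _)

  geom𝕩𝕦≈closed : geom 𝕩𝕦 ≈ geom𝕩𝕦-closed
  geom𝕩𝕦≈closed w a b = begin
    geom 𝕩𝕦 w a b ≡⟨ geom-def 𝕩𝕦 w a b ⟩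
    SumL (upTo (suc N)) (λ n → (𝕩𝕦 ^S n) w a b) ≡⟨ Σ-cong (upTo (suc N)) (λ n → 𝕩𝕦^S-coeff n w a b) ⟩
    SumL (upTo (suc N)) (λ n → xCoeff w (λ j → 𝕩𝕦^S-coeffs n j a b)) ≡⟨ sym (xCoeff-Σ w (upTo (suc N)) (λ j n → 𝕩𝕦^S-coeffs n j a b)) ⟩
    xCoeff w (λ j → SumL (upTo (suc N)) (λ n → 𝕩𝕦^S-coeffs n j a b)) ≡⟨ xCoeff-cong w (λ j → trans (Σ-cong (upTo (suc N)) (λ n → r j n)) (Σ-upTo-δ (suc N) b (λ n → δN j n · δN a 0) (s≤s (NP.m≤n+m b (length w + a))))) ⟩
    geom𝕩𝕦-closed w a b ∎
    where
    N : ℕ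
    N = length w + a + b
    r : ∀ j n → 𝕩𝕦^S-coeffs n j a b ≡ δN b n · (δN j n · δN a 0)
    r j n = trans (cong (δN j n ·_) (·-comm (δN a 0) (δN b n))) (trans (sym (·-assoc (δN j n) (δN b n) (δN a 0))) (trans (cong (_· δN a 0) (·-comm (δN j n) (δN b n))) (·-assoc _ _ _)))

  module UniqueFixpoint (F : Series) (L : Series → Series) (L0 : ∀ Yv w a → L Yv w a 0 ≡ 0ℚ)
    (Ls : ∀ Yv Zv b → (∀ w a → Yv w a b ≡ Zv w a b) → ∀ w a → L Yv w a (suc b) ≡ L Zv w a (suc b))
    (Y1 Y2 : Series) (e1 : Y1 ≈ F ⊕S L Y1) (e2 : Y2 ≈ F ⊕S L Y2) where
    level : ∀ b w a → Y1 w a b ≡ Y2 w a b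
    level zero w a = trans (e1 w a 0) (trans (cong (F w a 0 ℚ.+_) (trans (L0 Y1 w a) (sym (L0 Y2 w a)))) (sym (e2 w a 0)))
    level (suc b) w a = trans (e1 w a (suc b)) (trans (cong (F w a (suc b) ℚ.+_) (Ls Y1 Y2 b (level b) w a)) (sym (e2 w a (suc b))))
    result : Y1 ≈ Y2
    result w a b = level b w a

  𝕩𝕥𝕦-fixpoint-unique : ∀ F Y1 Y2 → Y1 ≈ F ⊕S 𝕩𝕥𝕦 ⊛ Y1 → Y2 ≈ F ⊕S 𝕩𝕥𝕦 ⊛ Y2 → Y1 ≈ Y2
  𝕩𝕥𝕦-fixpoint-unique F Y1 Y2 e1 e2 = UniqueFixpoint.result F (𝕩𝕥𝕦 ⊛_) L0 Ls Y1 Y2 e1 e2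
    where
    L0 : ∀ Yv w a → (𝕩𝕥𝕦 ⊛ Yv) w a 0 ≡ 0ℚ
    L0 Yv w a = trans (𝕩𝕥𝕦⊛ Yv w a 0) (afterLetter-vanish X w _ (λ v → atPred-vanish a _ (λ _ → refl)))
    Ls : ∀ Yv Zv b → (∀ w a → Yv w a b ≡ Zv w a b) → ∀ w a → (𝕩𝕥𝕦 ⊛ Yv) w a (suc b) ≡ (𝕩𝕥𝕦 ⊛ Zv) w a (suc b)
    Ls Yv Zv b e w a = trans (𝕩𝕥𝕦⊛ Yv w a (suc b)) (trans (afterLetter-cong X w (λ v → atPred-cong a (λ a' → e v a'))) (sym (𝕩𝕥𝕦⊛ Zv w a (suc b))))

  𝕩𝕦-fixpoint-unique : ∀ F Y1 Y2 → Y1 ≈ F ⊕S 𝕩𝕦 ⊛ Y1 → Y2 ≈ F ⊕S 𝕩𝕦 ⊛ Y2 → Y1 ≈ Y2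
  𝕩𝕦-fixpoint-unique F Y1 Y2 e1 e2 = UniqueFixpoint.result F (𝕩𝕦 ⊛_) L0 Ls Y1 Y2 e1 e2
    where
    L0 : ∀ Yv w a → (𝕩𝕦 ⊛ Yv) w a 0 ≡ 0ℚ
    L0 Yv w a = trans (𝕩𝕦⊛ Yv w a 0) (afterLetter-vanish X w _ (λ v → refl))
    Ls : ∀ Yv Zv b → (∀ w a → Yv w a b ≡ Zv w a b) → ∀ w a → (𝕩𝕦 ⊛ Yv) w a (suc b) ≡ (𝕩𝕦 ⊛ Zv) w a (suc b)
    Ls Yv Zv b e w a = trans (𝕩𝕦⊛ Yv w a (suc b)) (trans (afterLetter-cong X w (λ v → e v a)) (sym (𝕩𝕦⊛ Zv w a (suc b))))

open GeometricSeries

module Binomials where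

  ι : ℤ → ℚ
  ι i = i / 1

  toℚᵘ-/ : ∀ i k → toℚᵘ (i / suc k) U.≃ U.mkℚᵘ i k
  toℚᵘ-/ i k = QP.toℚᵘ-fromℚᵘ (U.mkℚᵘ i k)

  ι-+-numerator : ∀ i j → (i ℤ.* + 1 ℤ.+ j ℤ.* + 1) ℤ.* + 1 ≡ (i ℤ.+ j) ℤ.* + 1
  ι-+-numerator = solve-∀

  ι-+ : ∀ i j → ι (i ℤ.+ j) ≡ ι i ℚ.+ ι j
  ι-+ i j = QP.toℚᵘ-injective (UP.≃-trans (toℚᵘ-/ (i ℤ.+ j) 0) (UP.≃-sym (UP.≃-trans (QP.toℚᵘ-homo-+ (ι i) (ι j)) (UP.≃-trans (UP.+-cong (toℚᵘ-/ i 0) (toℚᵘ-/ j 0)) (U.*≡* e)))))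
    where
    e : (i ℤ.* + 1 ℤ.+ j ℤ.* + 1) ℤ.* + 1 ≡ (i ℤ.+ j) ℤ.* + 1
    e = ι-+-numerator i j

  ι-neg : ∀ i → ι (ℤ.- i) ≡ ℚ.- ι i
  ι-neg i = QP.toℚᵘ-injective (UP.≃-trans (toℚᵘ-/ (ℤ.- i) 0) (UP.≃-sym (UP.≃-trans (QP.toℚᵘ-homo‿- (ι i)) (UP.-‿cong (toℚᵘ-/ i 0)))))

  /-*-ι-denominator : ∀ i k → (i / suc k) ℚ.* ι (+ suc k) ≡ ι i
  /-*-ι-denominator i k = QP.toℚᵘ-injective (UP.≃-trans (QP.toℚᵘ-homo-* (i / suc k) (ι (+ suc k))) (UP.≃-trans (UP.*-cong (toℚᵘ-/ i k) (toℚᵘ-/ (+ suc k) 0)) (UP.≃-trans (U.*≡* e) (UP.≃-sym (toℚᵘ-/ i 0)))))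
    where
    e : (i ℤ.* + suc k) ℤ.* + 1 ≡ i ℤ.* + suc (k ℕ.* 1)
    e = trans (ZP.*-identityʳ _) (cong (λ n → i ℤ.* + suc n) (sym (NP.*-identityʳ k)))

  ι-suc≢0 : ∀ k → ι (+ suc k) ≢ 0ℚ
  ι-suc≢0 k e with UP.≃-trans (UP.≃-sym (toℚᵘ-/ (+ suc k) 0)) (QP.toℚᵘ-cong e)
  ... | U.*≡* p = h (trans (sym (ZP.*-identityʳ (+ suc k))) p)
    where
    h : + suc k ≡ + 0 ℤ.* + 1 → ⊥
    h ()

  *-cancelʳ-ι-suc : ∀ x y k → x ℚ.* ι (+ suc k) ≡ y ℚ.* ι (+ suc k) → x ≡ y
  *-cancelʳ-ι-suc x y k e = begin
    x ≡⟨ sym (QP.*-identityʳ x) ⟩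
    x ℚ.* 1ℚ ≡⟨ cong (x ℚ.*_) (sym (QP.*-inverseʳ d)) ⟩
    x ℚ.* (d ℚ.* ℚ.1/ d) ≡⟨ sym (QP.*-assoc x d _) ⟩
    (x ℚ.* d) ℚ.* ℚ.1/ d ≡⟨ cong (ℚ._* ℚ.1/ d) e ⟩
    (y ℚ.* d) ℚ.* ℚ.1/ d ≡⟨ QP.*-assoc y d _ ⟩
    y ℚ.* (d ℚ.* ℚ.1/ d) ≡⟨ cong (y ℚ.*_) (QP.*-inverseʳ d) ⟩
    y ℚ.* 1ℚ ≡⟨ QP.*-identityʳ y ⟩
    y ∎
    where
    open ≡-Reasoning
    d : ℚ
    d = ι (+ suc k)
    instance
      nzi : ℚ.NonZero d
      nzi = ℚ.≢-nonZero (ι-suc≢0 k)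

  open ℚ-Solver.+-*-Solver

  [z+1]-0≡[z-0]+1 : ∀ z → (z ℤ.+ + 1) ℤ.- + 0 ≡ (z ℤ.- + 0) ℤ.+ + 1
  [z+1]-0≡[z-0]+1 = solve-∀
  [z+1]-[1+m]≡z-m : ∀ z m → (z ℤ.+ + 1) ℤ.- (+ 1 ℤ.+ m) ≡ z ℤ.- m
  [z+1]-[1+m]≡z-m = solve-∀
  z-[1+m]≡[z-m]-1 : ∀ z m → z ℤ.- (+ 1 ℤ.+ m) ≡ (z ℤ.- m) ℤ.+ ℤ.- + 1
  z-[1+m]≡[z-m]-1 = solve-∀

  binomℤ-pascal : ∀ z k → binomℤ (z ℤ.+ + 1) (suc k) ≡ binomℤ z (suc k) ℚ.+ binomℤ z k
  binomℤ-pascal z zero = begin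
    1ℚ ℚ.* ι ((z ℤ.+ + 1) ℤ.- + 0) ≡⟨ cong (λ v → 1ℚ ℚ.* ι v) ([z+1]-0≡[z-0]+1 z) ⟩
    1ℚ ℚ.* ι ((z ℤ.- + 0) ℤ.+ + 1) ≡⟨ cong (1ℚ ℚ.*_) (ι-+ (z ℤ.- + 0) (+ 1)) ⟩
    1ℚ ℚ.* (ι (z ℤ.- + 0) ℚ.+ 1ℚ) ≡⟨ solve 1 (λ u → con 1ℚ :* (u :+ con 1ℚ) := con 1ℚ :* u :+ con 1ℚ) refl (ι (z ℤ.- + 0)) ⟩
    1ℚ ℚ.* ι (z ℤ.- + 0) ℚ.+ 1ℚ ∎
    where open ≡-Reasoning
  binomℤ-pascal z (suc k) = *-cancelʳ-ι-suc (binomℤ (z ℤ.+ + 1) (suc (suc k))) (binomℤ z (suc (suc k)) ℚ.+ binomℤ z (suc k)) (suc k) (begin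
    binomℤ (z ℤ.+ + 1) (suc k) ℚ.* q1 ℚ.* d2 ≡⟨ QP.*-assoc (binomℤ (z ℤ.+ + 1) (suc k)) q1 d2 ⟩
    binomℤ (z ℤ.+ + 1) (suc k) ℚ.* (q1 ℚ.* d2) ≡⟨ cong₂ ℚ._*_ (binomℤ-pascal z k) (/-*-ι-denominator ((z ℤ.+ + 1) ℤ.- + suc k) (suc k)) ⟩
    (b1 ℚ.+ b0) ℚ.* ι ((z ℤ.+ + 1) ℤ.- + suc k) ≡⟨ cong (λ v → (b1 ℚ.+ b0) ℚ.* ι v) ([z+1]-[1+m]≡z-m z (+ k)) ⟩
    (b1 ℚ.+ b0) ℚ.* u ≡⟨ solve 3 (λ b1 b0 u → (b1 :+ b0) :* u := b1 :* u :+ b0 :* u) refl b1 b0 u ⟩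
    b1 ℚ.* u ℚ.+ b0 ℚ.* u ≡⟨ cong (b1 ℚ.* u ℚ.+_) (sym b1d1≡b0u) ⟩
    b1 ℚ.* u ℚ.+ b1 ℚ.* d1 ≡⟨ solve 3 (λ b1 u d1 → b1 :* u :+ b1 :* d1 := b1 :* (u :+ (:- con 1ℚ)) :+ b1 :* (con 1ℚ :+ d1)) refl b1 u d1 ⟩
    b1 ℚ.* (u ℚ.+ ℚ.- 1ℚ) ℚ.+ b1 ℚ.* (1ℚ ℚ.+ d1) ≡⟨ cong₂ (λ v w → b1 ℚ.* v ℚ.+ b1 ℚ.* w) (sym q2d2≡u-1) (sym (ι-+ (+ 1) (+ suc k))) ⟩
    b1 ℚ.* (q2 ℚ.* d2) ℚ.+ b1 ℚ.* d2 ≡⟨ solve 4 (λ b1 q2 d2 one → b1 :* (q2 :* d2) :+ b1 :* d2 := (b1 :* q2 :+ b1) :* d2) refl b1 q2 d2 1ℚ ⟩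
    (b1 ℚ.* q2 ℚ.+ b1) ℚ.* d2 ∎)
    where
    open ≡-Reasoning
    q1 : ℚ
    q1 = ((z ℤ.+ + 1) ℤ.- + suc k) / suc (suc k)
    q2 : ℚ
    q2 = (z ℤ.- + suc k) / suc (suc k)
    d1 : ℚ
    d1 = ι (+ suc k)
    d2 : ℚ
    d2 = ι (+ suc (suc k))
    b1 : ℚ
    b1 = binomℤ z (suc k)
    b0 : ℚ
    b0 = binomℤ z k
    u : ℚ
    u = ι (z ℤ.- + k)
    b1d1≡b0u : b1 ℚ.* d1 ≡ b0 ℚ.* u
    b1d1≡b0u = trans (QP.*-assoc b0 _ d1) (cong (b0 ℚ.*_) (/-*-ι-denominator (z ℤ.- + k) k))
    q2d2≡u-1 : q2 ℚ.* d2 ≡ u ℚ.+ ℚ.- 1ℚ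
    q2d2≡u-1 = trans (/-*-ι-denominator (z ℤ.- + suc k) (suc k)) (trans (cong ι (z-[1+m]≡[z-m]-1 z (+ k))) (trans (ι-+ (z ℤ.- + k) (ℤ.- + 1)) (cong (u ℚ.+_) (ι-neg (+ 1)))))

  binomℤ-vanish : ∀ n k → n ℕ.< k → binomℤ (+ n) k ≡ 0ℚ
  binomℤ-vanish n (suc k) (s≤s le) with NP.m≤n⇒m<n∨m≡n le
  ... | inj₁ lt = trans (cong (ℚ._* ((+ n ℤ.- + k) / suc k)) (binomℤ-vanish n k lt)) (QP.*-zeroˡ ((+ n ℤ.- + k) / suc k))
  ... | inj₂ refl = trans (cong (λ v → binomℤ (+ n) n ℚ.* (v / suc n)) (ZP.+-inverseʳ (+ n))) (trans (cong (binomℤ (+ n) n ℚ.*_) (QP.0/n≡0 (suc n))) (QP.*-zeroʳ (binomℤ (+ n) n)))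

open Binomials

module BlockCoefficients where

  open ≡-Reasoning

  -- Coefficients of Σₐ β(a) x^(c+a) (tu)^a, of its product with (xt)^d, and of the
  -- further product with 1/(1 − xu).
  powCoeff : ℕ → (ℕ → ℚ) → ℕ → ℕ → ℕ → ℚ
  powCoeff c β j a b = δN j (c + a) · (δN a b · β a)

  powCoeff-fixpoint : ∀ c (β β' : ℕ → ℚ) → β' 0 ≡ β 0 → (∀ a → β' (suc a) ≡ β (suc a) ⊹ β' a) →
    ∀ j a b → powCoeff c β' j a b ≡ powCoeff c β j a b ⊹ atPred j (λ j' → atPred a (λ a' → atPred b (λ b' → powCoeff c β' j' a' b')))
  powCoeff-fixpoint c β β' eq₀ es zero zero b = trans (cong (λ v → δN 0 (c + 0) · (δN 0 b · v)) eq₀) (sym (⊹-idʳ _))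
  powCoeff-fixpoint c β β' eq₀ es (suc j) zero b = trans (cong (λ v → δN (suc j) (c + 0) · (δN 0 b · v)) eq₀) (sym (⊹-idʳ _))
  powCoeff-fixpoint c β β' eq₀ es j (suc a) zero = trans (·-≡0 _ (≡0-· _ (δN-suc-0 a))) (sym (trans (cong₂ _⊹_ (·-≡0 _ (≡0-· _ (δN-suc-0 a))) (atPred-vanish j _ (λ _ → refl))) (⊹-idˡ 0ℚ)))
  powCoeff-fixpoint c β β' eq₀ es zero (suc a) (suc b) = trans (≡0-· _ δ0) (sym (trans (cong (_⊹ 0ℚ) (≡0-· _ δ0)) (⊹-idˡ 0ℚ)))
    where
    δ0 : δN 0 (c + suc a) ≡ 0ℚ
    δ0 = trans (cong (δN 0) (NP.+-suc c a)) (δN-0-suc (c + a))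
  powCoeff-fixpoint c β β' eq₀ es (suc j) (suc a) (suc b) = begin
    δN (suc j) (c + suc a) · (δN (suc a) (suc b) · β' (suc a))
      ≡⟨ cong₂ (λ x y → x · (y · β' (suc a))) (trans (cong (δN (suc j)) (NP.+-suc c a)) (δN-suc j (c + a))) (δN-suc a b) ⟩
    D · (δa · β' (suc a)) ≡⟨ cong (λ v → D · (δa · v)) (es a) ⟩
    D · (δa · (β (suc a) ⊹ β' a)) ≡⟨ trans (cong (D ·_) (·-distribˡ δa (β (suc a)) (β' a))) (·-distribˡ D (δa · β (suc a)) (δa · β' a)) ⟩
    D · (δa · β (suc a)) ⊹ D · (δa · β' a)
      ≡⟨ cong (_⊹ D · (δa · β' a)) (sym (cong₂ (λ x y → x · (y · β (suc a))) (trans (cong (δN (suc j)) (NP.+-suc c a)) (δN-suc j (c + a))) (δN-suc a b))) ⟩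
    δN (suc j) (c + suc a) · (δN (suc a) (suc b) · β (suc a)) ⊹ D · (δa · β' a) ∎
    where
    D : ℚ
    D = δN j (c + a)
    δa : ℚ
    δa = δN a b

  xtPowCoeff : ℕ → ℕ → (ℕ → ℚ) → ℕ → ℕ → ℕ → ℚ
  xtPowCoeff c d β j a b = δN j (c + a) · (δN a (d + b) · β b)

  powCoeff≡xtPowCoeff-0 : ∀ c β j a b → powCoeff c β j a b ≡ xtPowCoeff c 0 β j a b
  powCoeff≡xtPowCoeff-0 c β j a b = h (a ℕ.≟ b)
    where
    h : Dec (a ≡ b) → powCoeff c β j a b ≡ xtPowCoeff c 0 β j a b
    h (yes refl) = refl
    h (no ne) = trans (·-≡0 _ (≡0-· _ (δN-≢ ne))) (sym (·-≡0 _ (≡0-· _ (δN-≢ ne))))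

  xtPowCoeff-suc : ∀ c d β j a b → atPred j (λ j' → atPred a (λ a' → xtPowCoeff c d β j' a' b)) ≡ xtPowCoeff c (suc d) β j a b
  xtPowCoeff-suc c d β zero zero b = sym (·-≡0 _ (≡0-· _ (δN-0-suc (d + b))))
  xtPowCoeff-suc c d β zero (suc a) b = sym (≡0-· _ (trans (cong (δN 0) (NP.+-suc c a)) (δN-0-suc (c + a))))
  xtPowCoeff-suc c d β (suc j) zero b = sym (·-≡0 _ (≡0-· _ (δN-0-suc (d + b))))
  xtPowCoeff-suc c d β (suc j) (suc a) b = sym (cong₂ (λ x y → x · (y · β b)) (trans (cong (δN (suc j)) (NP.+-suc c a)) (δN-suc j (c + a))) (δN-suc a (d + b)))

  blockCoeff : ℕ → ℕ → (ℕ → ℚ) → ℕ → ℕ → ℕ → ℚ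
  blockCoeff c d β j a b = δN j (c + d + b) · SumL (nsplits b) (λ p → δN a (d + proj₁ p) · β (proj₁ p))

  blockSum : ℕ → (ℕ → ℚ) → ℕ → ℕ → ℚ
  blockSum d β a b = SumL (nsplits b) (λ p → δN a (d + proj₁ p) · β (proj₁ p))

  blockSum-0 : ∀ d β a → blockSum d β a 0 ≡ δN a (d + 0) · β 0
  blockSum-0 d β a = trans (SumL-∷ (0 , 0) [] _) (trans (cong (δN a (d + 0) · β 0 ⊹_) (SumL-[] _)) (⊹-idʳ _))

  blockSum-suc : ∀ d β a b → blockSum d β a (suc b) ≡ blockSum d β a b ⊹ δN a (d + suc b) · β (suc b)
  blockSum-suc d β a b = begin
    SumL (nsplits (suc b)) h ≡⟨ cong (λ L → SumL L h) (nsplits-sucʳ b) ⟩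
    SumL (map (λ p → (proj₁ p , suc (proj₂ p))) (nsplits b) ++ (suc b , 0) ∷ []) h ≡⟨ Σ-++ _ _ h ⟩
    SumL (map (λ p → (proj₁ p , suc (proj₂ p))) (nsplits b)) h ⊹ SumL ((suc b , 0) ∷ []) h
      ≡⟨ cong₂ _⊹_ (Σ-map (nsplits b) (λ p → (proj₁ p , suc (proj₂ p))) h) (trans (SumL-∷ (suc b , 0) [] h) (trans (cong (h (suc b , 0) ⊹_) (SumL-[] h)) (⊹-idʳ _))) ⟩
    blockSum d β a b ⊹ δN a (d + suc b) · β (suc b) ∎
    where
    h : ℕ × ℕ → ℚ
    h p = δN a (d + proj₁ p) · β (proj₁ p)

  blockCoeff-fixpoint : ∀ c d β j a b → blockCoeff c d β j a b ≡ xtPowCoeff c d β j a b ⊹ atPred j (λ j' → atPred b (λ b' → blockCoeff c d β j' a b'))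
  blockCoeff-fixpoint c d β j a zero = h (a ℕ.≟ d + 0)
    where
    h : Dec (a ≡ d + 0) → blockCoeff c d β j a zero ≡ xtPowCoeff c d β j a zero ⊹ atPred j (λ j' → atPred zero (λ b' → blockCoeff c d β j' a b'))
    h (yes refl) = trans (cong (δN j (c + d + 0) ·_) (blockSum-0 d β a)) (trans (cong (λ v → δN j v · (δN a (d + 0) · β 0)) (NP.+-assoc c d 0)) (sym (trans (cong (xtPowCoeff c d β j a zero ⊹_) (atPred-vanish j _ (λ _ → refl))) (⊹-idʳ _))))
    h (no ne) = trans (trans (cong (δN j (c + d + 0) ·_) (blockSum-0 d β a)) (·-≡0 _ (≡0-· _ (δN-≢ ne)))) (sym (trans (cong₂ _⊹_ (·-≡0 _ (≡0-· _ (δN-≢ ne))) (atPred-vanish j _ (λ _ → refl))) (⊹-idˡ 0ℚ)))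
  blockCoeff-fixpoint c d β zero a (suc b) = trans (≡0-· _ (trans (cong (δN 0) (NP.+-suc (c + d) b)) (δN-0-suc (c + d + b)))) (sym (trans (cong (_⊹ 0ℚ) (h (a ℕ.≟ d + suc b))) (⊹-idˡ 0ℚ)))
    where
    h : Dec (a ≡ d + suc b) → xtPowCoeff c d β zero a (suc b) ≡ 0ℚ
    h (yes refl) = ≡0-· _ (trans (cong (δN 0) (trans (cong (λ v → c + v) (NP.+-suc d b)) (NP.+-suc c (d + b)))) (δN-0-suc (c + (d + b))))
    h (no ne) = ·-≡0 _ (≡0-· _ (δN-≢ ne))
  blockCoeff-fixpoint c d β (suc j) a (suc b) = begin
    δN (suc j) (c + d + suc b) · blockSum d β a (suc b) ≡⟨ cong₂ _·_ (cong (δN (suc j)) (NP.+-suc (c + d) b)) (blockSum-suc d β a b) ⟩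
    δN (suc j) (suc (c + d + b)) · (blockSum d β a b ⊹ δN a (d + suc b) · β (suc b)) ≡⟨ ·-distribˡ _ _ _ ⟩
    δN (suc j) (suc (c + d + b)) · blockSum d β a b ⊹ δN (suc j) (suc (c + d + b)) · (δN a (d + suc b) · β (suc b))
      ≡⟨ cong₂ _⊹_ (cong (_· blockSum d β a b) (δN-suc j (c + d + b))) (h (a ℕ.≟ d + suc b)) ⟩
    blockCoeff c d β j a b ⊹ xtPowCoeff c d β (suc j) a (suc b) ≡⟨ ⊹-comm _ _ ⟩
    xtPowCoeff c d β (suc j) a (suc b) ⊹ blockCoeff c d β j a b ∎
    where
    h : Dec (a ≡ d + suc b) → δN (suc j) (suc (c + d + b)) · (δN a (d + suc b) · β (suc b)) ≡ xtPowCoeff c d β (suc j) a (suc b)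
    h (yes refl) = cong (λ v → δN (suc j) v · (δN (d + suc b) (d + suc b) · β (suc b))) (trans (sym (NP.+-suc (c + d) b)) (NP.+-assoc c d (suc b)))
    h (no ne) = trans (·-≡0 _ (≡0-· _ (δN-≢ ne))) (sym (·-≡0 _ (≡0-· _ (δN-≢ ne))))

open BlockCoefficients

module Commutation where

  open SR

  geom𝕩𝕥𝕦-closed-unfold-coeff : ∀ j a b → δN j b · δN a b ≡ δN j 0 · (δN 0 a · δN 0 b) ⊹ atPred j (λ j' → atPred a (λ a' → atPred b (λ b' → δN j' b' · δN a' b')))
  geom𝕩𝕥𝕦-closed-unfold-coeff j a zero = trans (cong (δN j 0 ·_) (trans (δN-sym a 0) (sym (trans (cong (δN 0 a ·_) (δN-refl 0)) (·-idʳ _))))) (sym (trans (cong (δN j 0 · (δN 0 a · δN 0 0) ⊹_) (atPred-vanish j _ (λ j' → atPred-vanish a _ (λ _ → refl)))) (⊹-idʳ _)))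
  geom𝕩𝕥𝕦-closed-unfold-coeff zero a (suc b) = trans (≡0-· _ (δN-0-suc b)) (sym (trans (cong₂ _⊹_ (·-≡0 _ (·-≡0 _ (δN-0-suc b))) refl) (⊹-idˡ 0ℚ)))
  geom𝕩𝕥𝕦-closed-unfold-coeff (suc j) zero (suc b) = trans (·-≡0 _ (δN-0-suc b)) (sym (trans (cong₂ _⊹_ (·-≡0 _ (·-≡0 _ (δN-0-suc b))) refl) (⊹-idˡ 0ℚ)))
  geom𝕩𝕥𝕦-closed-unfold-coeff (suc j) (suc a) (suc b) = trans (cong₂ _·_ (δN-suc j b) (δN-suc a b)) (sym (trans (cong (_⊹ (δN j b · δN a b)) (·-≡0 _ (·-≡0 _ (δN-0-suc b)))) (⊹-idˡ _)))

  geom𝕩𝕦-closed-unfold-coeff : ∀ j a b → δN j b · δN a 0 ≡ δN j 0 · (δN 0 a · δN 0 b) ⊹ atPred j (λ j' → atPred b (λ b' → δN j' b' · δN a 0))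
  geom𝕩𝕦-closed-unfold-coeff j a zero = trans (cong (δN j 0 ·_) (trans (δN-sym a 0) (sym (trans (cong (δN 0 a ·_) (δN-refl 0)) (·-idʳ _))))) (sym (trans (cong (δN j 0 · (δN 0 a · δN 0 0) ⊹_) (atPred-vanish j _ (λ _ → refl))) (⊹-idʳ _)))
  geom𝕩𝕦-closed-unfold-coeff zero a (suc b) = trans (≡0-· _ (δN-0-suc b)) (sym (trans (cong₂ _⊹_ (·-≡0 _ (·-≡0 _ (δN-0-suc b))) refl) (⊹-idˡ 0ℚ)))
  geom𝕩𝕦-closed-unfold-coeff (suc j) a (suc b) = trans (cong (_· δN a 0) (δN-suc j b)) (sym (trans (cong (_⊹ (δN j b · δN a 0)) (·-≡0 _ (·-≡0 _ (δN-0-suc b)))) (⊹-idˡ _)))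

  geom𝕩𝕥𝕦-closed-unfold : geom𝕩𝕥𝕦-closed ≈ 𝟙 ⊕S 𝕩𝕥𝕦 ⊛ geom𝕩𝕥𝕦-closed
  geom𝕩𝕥𝕦-closed-unfold = ≈-sym {𝟙 ⊕S 𝕩𝕥𝕦 ⊛ geom𝕩𝕥𝕦-closed} (≈-trans {𝟙 ⊕S 𝕩𝕥𝕦 ⊛ geom𝕩𝕥𝕦-closed} (⊕-cong {𝟙} 𝟙≈xSeries (𝕩𝕥𝕦⊛xSeries _)) (≈-trans {xSeries _ ⊕S xSeries _} (xSeries-⊕ _ _) (xSeries-cong (λ j a b → sym (geom𝕩𝕥𝕦-closed-unfold-coeff j a b)))))

  geom𝕩𝕦-closed-unfold : geom𝕩𝕦-closed ≈ 𝟙 ⊕S 𝕩𝕦 ⊛ geom𝕩𝕦-closed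
  geom𝕩𝕦-closed-unfold = ≈-sym {𝟙 ⊕S 𝕩𝕦 ⊛ geom𝕩𝕦-closed} (≈-trans {𝟙 ⊕S 𝕩𝕦 ⊛ geom𝕩𝕦-closed} (⊕-cong {𝟙} 𝟙≈xSeries (𝕩𝕦⊛xSeries _)) (≈-trans {xSeries _ ⊕S xSeries _} (xSeries-⊕ _ _) (xSeries-cong (λ j a b → sym (geom𝕩𝕦-closed-unfold-coeff j a b)))))

  ⊛-commutesˡ : ∀ f g h → f ⊛ h ≈ h ⊛ f → g ⊛ h ≈ h ⊛ g → (f ⊛ g) ⊛ h ≈ h ⊛ (f ⊛ g)
  ⊛-commutesˡ f g h e1 e2 = begin
    (f ⊛ g) ⊛ h ≈⟨ ⊛-assoc f g h ⟩
    f ⊛ (g ⊛ h) ≈⟨ ⊛-congˡ f e2 ⟩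
    f ⊛ (h ⊛ g) ≈⟨ ≈-sym {(f ⊛ h) ⊛ g} (⊛-assoc f h g) ⟩
    (f ⊛ h) ⊛ g ≈⟨ ⊛-congʳ g e1 ⟩
    (h ⊛ f) ⊛ g ≈⟨ ⊛-assoc h f g ⟩
    h ⊛ (f ⊛ g) ∎

  ⊛-commutesʳ : ∀ f g h → f ⊛ g ≈ g ⊛ f → f ⊛ h ≈ h ⊛ f → f ⊛ (g ⊛ h) ≈ (g ⊛ h) ⊛ f
  ⊛-commutesʳ f g h e1 e2 = ≈-sym {(g ⊛ h) ⊛ f} (⊛-commutesˡ g h f (≈-sym {f ⊛ g} e1) (≈-sym {f ⊛ h} e2))

  𝕩-𝕥-comm : 𝕩 ⊛ 𝕥 ≈ 𝕥 ⊛ 𝕩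
  𝕩-𝕥-comm = ≈-sym {𝕥 ⊛ 𝕩} (𝕥-central 𝕩)
  𝕩-𝕦-comm : 𝕩 ⊛ 𝕦 ≈ 𝕦 ⊛ 𝕩
  𝕩-𝕦-comm = ≈-sym {𝕦 ⊛ 𝕩} (𝕦-central 𝕩)

  𝕩-𝕩𝕥-comm : 𝕩 ⊛ (𝕩 ⊛ 𝕥) ≈ (𝕩 ⊛ 𝕥) ⊛ 𝕩
  𝕩-𝕩𝕥-comm = ⊛-commutesʳ 𝕩 𝕩 𝕥 ≈-refl 𝕩-𝕥-comm

  𝕩-𝕩𝕥𝕦-comm : 𝕩 ⊛ 𝕩𝕥𝕦 ≈ 𝕩𝕥𝕦 ⊛ 𝕩
  𝕩-𝕩𝕥𝕦-comm = ⊛-commutesʳ 𝕩 (𝕩 ⊛ 𝕥) 𝕦 𝕩-𝕩𝕥-comm 𝕩-𝕦-comm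

  𝕩𝕥-𝕩𝕥𝕦-comm : (𝕩 ⊛ 𝕥) ⊛ 𝕩𝕥𝕦 ≈ 𝕩𝕥𝕦 ⊛ (𝕩 ⊛ 𝕥)
  𝕩𝕥-𝕩𝕥𝕦-comm = ⊛-commutesˡ 𝕩 𝕥 𝕩𝕥𝕦 𝕩-𝕩𝕥𝕦-comm (𝕥-central 𝕩𝕥𝕦)

  𝕩𝕦-𝕩𝕥𝕦-comm : 𝕩𝕦 ⊛ 𝕩𝕥𝕦 ≈ 𝕩𝕥𝕦 ⊛ 𝕩𝕦
  𝕩𝕦-𝕩𝕥𝕦-comm = ⊛-commutesˡ 𝕩 𝕦 𝕩𝕥𝕦 𝕩-𝕩𝕥𝕦-comm (𝕦-central 𝕩𝕥𝕦)

  geom𝕩𝕥𝕦-closed-⊛ : ∀ F Yv → Yv ≈ F ⊕S 𝕩𝕥𝕦 ⊛ Yv → geom𝕩𝕥𝕦-closed ⊛ F ≈ Yv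
  geom𝕩𝕥𝕦-closed-⊛ F Yv e = 𝕩𝕥𝕦-fixpoint-unique F (geom𝕩𝕥𝕦-closed ⊛ F) Yv eq1 e
    where
    eq1 : geom𝕩𝕥𝕦-closed ⊛ F ≈ F ⊕S 𝕩𝕥𝕦 ⊛ (geom𝕩𝕥𝕦-closed ⊛ F)
    eq1 = begin
      geom𝕩𝕥𝕦-closed ⊛ F ≈⟨ ⊛-congʳ F geom𝕩𝕥𝕦-closed-unfold ⟩
      (𝟙 ⊕S 𝕩𝕥𝕦 ⊛ geom𝕩𝕥𝕦-closed) ⊛ F ≈⟨ ⊛-distribʳ 𝟙 (𝕩𝕥𝕦 ⊛ geom𝕩𝕥𝕦-closed) F ⟩
      𝟙 ⊛ F ⊕S (𝕩𝕥𝕦 ⊛ geom𝕩𝕥𝕦-closed) ⊛ F ≈⟨ ⊕-cong {𝟙 ⊛ F} (𝟙⊛ F) (⊛-assoc 𝕩𝕥𝕦 geom𝕩𝕥𝕦-closed F) ⟩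
      F ⊕S 𝕩𝕥𝕦 ⊛ (geom𝕩𝕥𝕦-closed ⊛ F) ∎

  geom𝕩𝕦-closed-⊛ : ∀ F Yv → Yv ≈ F ⊕S 𝕩𝕦 ⊛ Yv → geom𝕩𝕦-closed ⊛ F ≈ Yv
  geom𝕩𝕦-closed-⊛ F Yv e = 𝕩𝕦-fixpoint-unique F (geom𝕩𝕦-closed ⊛ F) Yv eq1 e
    where
    eq1 : geom𝕩𝕦-closed ⊛ F ≈ F ⊕S 𝕩𝕦 ⊛ (geom𝕩𝕦-closed ⊛ F)
    eq1 = begin
      geom𝕩𝕦-closed ⊛ F ≈⟨ ⊛-congʳ F geom𝕩𝕦-closed-unfold ⟩
      (𝟙 ⊕S 𝕩𝕦 ⊛ geom𝕩𝕦-closed) ⊛ F ≈⟨ ⊛-distribʳ 𝟙 (𝕩𝕦 ⊛ geom𝕩𝕦-closed) F ⟩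
      𝟙 ⊛ F ⊕S (𝕩𝕦 ⊛ geom𝕩𝕦-closed) ⊛ F ≈⟨ ⊕-cong {𝟙 ⊛ F} (𝟙⊛ F) (⊛-assoc 𝕩𝕦 geom𝕩𝕦-closed F) ⟩
      F ⊕S 𝕩𝕦 ⊛ (geom𝕩𝕦-closed ⊛ F) ∎

  𝕩-geom𝕩𝕥𝕦-closed-comm : 𝕩 ⊛ geom𝕩𝕥𝕦-closed ≈ geom𝕩𝕥𝕦-closed ⊛ 𝕩
  𝕩-geom𝕩𝕥𝕦-closed-comm = ≈-sym {geom𝕩𝕥𝕦-closed ⊛ 𝕩} (geom𝕩𝕥𝕦-closed-⊛ 𝕩 (𝕩 ⊛ geom𝕩𝕥𝕦-closed) e)
    where
    e : 𝕩 ⊛ geom𝕩𝕥𝕦-closed ≈ 𝕩 ⊕S 𝕩𝕥𝕦 ⊛ (𝕩 ⊛ geom𝕩𝕥𝕦-closed)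
    e = begin
      𝕩 ⊛ geom𝕩𝕥𝕦-closed ≈⟨ ⊛-congˡ 𝕩 geom𝕩𝕥𝕦-closed-unfold ⟩
      𝕩 ⊛ (𝟙 ⊕S 𝕩𝕥𝕦 ⊛ geom𝕩𝕥𝕦-closed) ≈⟨ ⊛-distribˡ 𝟙 (𝕩𝕥𝕦 ⊛ geom𝕩𝕥𝕦-closed) 𝕩 ⟩
      𝕩 ⊛ 𝟙 ⊕S 𝕩 ⊛ (𝕩𝕥𝕦 ⊛ geom𝕩𝕥𝕦-closed) ≈⟨ ⊕-cong {𝕩 ⊛ 𝟙} (⊛𝟙 𝕩) (≈-trans {𝕩 ⊛ (𝕩𝕥𝕦 ⊛ geom𝕩𝕥𝕦-closed)} (≈-sym {(𝕩 ⊛ 𝕩𝕥𝕦) ⊛ geom𝕩𝕥𝕦-closed} (⊛-assoc 𝕩 𝕩𝕥𝕦 geom𝕩𝕥𝕦-closed)) (≈-trans {(𝕩 ⊛ 𝕩𝕥𝕦) ⊛ geom𝕩𝕥𝕦-closed} (⊛-congʳ geom𝕩𝕥𝕦-closed 𝕩-𝕩𝕥𝕦-comm) (⊛-assoc 𝕩𝕥𝕦 𝕩 geom𝕩𝕥𝕦-closed))) ⟩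
      𝕩 ⊕S 𝕩𝕥𝕦 ⊛ (𝕩 ⊛ geom𝕩𝕥𝕦-closed) ∎

  𝕩𝕥𝕦-geom𝕩𝕦-closed-comm : 𝕩𝕥𝕦 ⊛ geom𝕩𝕦-closed ≈ geom𝕩𝕦-closed ⊛ 𝕩𝕥𝕦
  𝕩𝕥𝕦-geom𝕩𝕦-closed-comm = ≈-sym {geom𝕩𝕦-closed ⊛ 𝕩𝕥𝕦} (geom𝕩𝕦-closed-⊛ 𝕩𝕥𝕦 (𝕩𝕥𝕦 ⊛ geom𝕩𝕦-closed) e)
    where
    e : 𝕩𝕥𝕦 ⊛ geom𝕩𝕦-closed ≈ 𝕩𝕥𝕦 ⊕S 𝕩𝕦 ⊛ (𝕩𝕥𝕦 ⊛ geom𝕩𝕦-closed)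
    e = begin
      𝕩𝕥𝕦 ⊛ geom𝕩𝕦-closed ≈⟨ ⊛-congˡ 𝕩𝕥𝕦 geom𝕩𝕦-closed-unfold ⟩
      𝕩𝕥𝕦 ⊛ (𝟙 ⊕S 𝕩𝕦 ⊛ geom𝕩𝕦-closed) ≈⟨ ⊛-distribˡ 𝟙 (𝕩𝕦 ⊛ geom𝕩𝕦-closed) 𝕩𝕥𝕦 ⟩
      𝕩𝕥𝕦 ⊛ 𝟙 ⊕S 𝕩𝕥𝕦 ⊛ (𝕩𝕦 ⊛ geom𝕩𝕦-closed) ≈⟨ ⊕-cong {𝕩𝕥𝕦 ⊛ 𝟙} (⊛𝟙 𝕩𝕥𝕦) (≈-trans {𝕩𝕥𝕦 ⊛ (𝕩𝕦 ⊛ geom𝕩𝕦-closed)} (≈-sym {(𝕩𝕥𝕦 ⊛ 𝕩𝕦) ⊛ geom𝕩𝕦-closed} (⊛-assoc 𝕩𝕥𝕦 𝕩𝕦 geom𝕩𝕦-closed)) (≈-trans {(𝕩𝕥𝕦 ⊛ 𝕩𝕦) ⊛ geom𝕩𝕦-closed} (⊛-congʳ geom𝕩𝕦-closed (≈-sym {𝕩𝕦 ⊛ 𝕩𝕥𝕦} 𝕩𝕦-𝕩𝕥𝕦-comm)) (⊛-assoc 𝕩𝕦 𝕩𝕥𝕦 geom𝕩𝕦-closed))) ⟩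
      𝕩𝕥𝕦 ⊕S 𝕩𝕦 ⊛ (𝕩𝕥𝕦 ⊛ geom𝕩𝕦-closed) ∎

  ^S-+ : ∀ f m n → f ^S m ⊛ f ^S n ≈ f ^S (m + n)
  ^S-+ f zero n = 𝟙⊛ (f ^S n)
  ^S-+ f (suc m) n = ≈-trans {(f ⊛ f ^S m) ⊛ f ^S n} (⊛-assoc f (f ^S m) (f ^S n)) (⊛-congˡ f (^S-+ f m n))

  ^S-comm : ∀ f g n → f ⊛ g ≈ g ⊛ f → f ^S n ⊛ g ≈ g ⊛ f ^S n
  ^S-comm f g zero e = ≈-trans {𝟙 ⊛ g} (𝟙⊛ g) (≈-sym {g ⊛ 𝟙} (⊛𝟙 g))
  ^S-comm f g (suc n) e = begin
    (f ⊛ f ^S n) ⊛ g ≈⟨ ⊛-assoc f (f ^S n) g ⟩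
    f ⊛ (f ^S n ⊛ g) ≈⟨ ⊛-congˡ f (^S-comm f g n e) ⟩
    f ⊛ (g ⊛ f ^S n) ≈⟨ ≈-sym {(f ⊛ g) ⊛ f ^S n} (⊛-assoc f g (f ^S n)) ⟩
    (f ⊛ g) ⊛ f ^S n ≈⟨ ⊛-congʳ (f ^S n) e ⟩
    (g ⊛ f) ⊛ f ^S n ≈⟨ ⊛-assoc g f (f ^S n) ⟩
    g ⊛ (f ⊛ f ^S n) ∎

  ^S-cong : ∀ {f g} n → f ≈ g → f ^S n ≈ g ^S n
  ^S-cong zero e = ≈-refl
  ^S-cong {f} {g} (suc n) e = ⊛-cong {f} {g} e (^S-cong n e)

open Commutation

module BinomialRecurrences where

  open ≡-Reasoning

  -- binom(c + e + δ − 2, e) from h_m, for a block with wt − dep = c; and binom(c + a, a),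
  -- the coefficients of (x/(1 − xtu))^c/(1 − xtu).
  blockBinom : ℕ → ℕ → ℕ → ℚ
  blockBinom δ c e = binomℤ (+ (c + e) ℤ.+ + δ ℤ.- + 2) e

  powBinom : ℕ → ℕ → ℚ
  powBinom c a = binomℤ (+ (c + a)) a

  [1+m]+1-2≡m : ∀ m → (+ 1 ℤ.+ m) ℤ.+ + 1 ℤ.- + 2 ≡ m
  [1+m]+1-2≡m = solve-∀
  1+m≡m+1 : ∀ m → + 1 ℤ.+ m ≡ m ℤ.+ + 1
  1+m≡m+1 = solve-∀
  [[1+m]+0-2]+1≡[1+m]+1-2 : ∀ m → ((+ 1 ℤ.+ m) ℤ.+ + 0 ℤ.- + 2) ℤ.+ + 1 ≡ (+ 1 ℤ.+ m) ℤ.+ + 1 ℤ.- + 2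
  [[1+m]+0-2]+1≡[1+m]+1-2 = solve-∀
  m+1-2≡[1+m]+0-2 : ∀ m → m ℤ.+ + 1 ℤ.- + 2 ≡ (+ 1 ℤ.+ m) ℤ.+ + 0 ℤ.- + 2
  m+1-2≡[1+m]+0-2 = solve-∀

  +-suc-ℤ : ∀ c a → + (c + suc a) ≡ + 1 ℤ.+ + (c + a)
  +-suc-ℤ c a = cong +_ (NP.+-suc c a)

  powBinom-pascal : ∀ c a → powBinom c (suc a) ≡ blockBinom 1 c (suc a) ⊹ powBinom c a
  powBinom-pascal c a = begin
    binomℤ (+ (c + suc a)) (suc a) ≡⟨ cong (λ v → binomℤ v (suc a)) (trans (+-suc-ℤ c a) (1+m≡m+1 (+ (c + a)))) ⟩
    binomℤ (+ (c + a) ℤ.+ + 1) (suc a) ≡⟨ binomℤ-pascal (+ (c + a)) a ⟩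
    binomℤ (+ (c + a)) (suc a) ℚ.+ binomℤ (+ (c + a)) a ≡⟨ cong₂ ℚ._+_ (cong (λ v → binomℤ v (suc a)) (sym (trans (cong (λ v → v ℤ.+ + 1 ℤ.- + 2) (+-suc-ℤ c a)) ([1+m]+1-2≡m (+ (c + a)))))) refl ⟩
    blockBinom 1 c (suc a) ℚ.+ powBinom c a ≡⟨ ⊹-def _ _ ⟩
    blockBinom 1 c (suc a) ⊹ powBinom c a ∎

  blockBinom-pascal : ∀ c a → blockBinom 1 c (suc a) ≡ blockBinom 0 c (suc a) ⊹ blockBinom 1 c a
  blockBinom-pascal c a = begin
    binomℤ (+ (c + suc a) ℤ.+ + 1 ℤ.- + 2) (suc a) ≡⟨ cong (λ v → binomℤ v (suc a)) (trans (cong (λ v → v ℤ.+ + 1 ℤ.- + 2) (+-suc-ℤ c a)) (sym ([[1+m]+0-2]+1≡[1+m]+1-2 (+ (c + a))))) ⟩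
    binomℤ (z ℤ.+ + 1) (suc a) ≡⟨ binomℤ-pascal z a ⟩
    binomℤ z (suc a) ℚ.+ binomℤ z a ≡⟨ cong₂ ℚ._+_ (cong (λ v → binomℤ (v ℤ.+ + 0 ℤ.- + 2) (suc a)) (sym (+-suc-ℤ c a))) (cong (λ v → binomℤ v a) (sym (m+1-2≡[1+m]+0-2 (+ (c + a))))) ⟩
    blockBinom 0 c (suc a) ℚ.+ blockBinom 1 c a ≡⟨ ⊹-def _ _ ⟩
    blockBinom 0 c (suc a) ⊹ blockBinom 1 c a ∎
    where
    z : ℤ
    z = (+ 1 ℤ.+ + (c + a)) ℤ.+ + 0 ℤ.- + 2

  blockBinom-base : ∀ j a b → δN j 0 · (δN 0 a · δN 0 b) ≡ powCoeff 0 (blockBinom 1 0) j a b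
  blockBinom-base j zero b = cong (δN j 0 ·_) (trans (cong (_· δN 0 b) (δN-refl 0)) (trans (·-idˡ _) (sym (·-idʳ _))))
  blockBinom-base j (suc a) b = trans (·-≡0 _ (≡0-· _ (δN-0-suc a))) (sym (·-≡0 _ (·-≡0 _ (trans (cong (λ v → binomℤ v (suc a)) ([1+m]+1-2≡m (+ a))) (binomℤ-vanish a (suc a) (NP.n<1+n a))))))

  𝕩-powCoeff-step : ∀ c j a b → atPred j (λ j' → powCoeff c (powBinom c) j' a b) ≡ powCoeff (suc c) (blockBinom 1 (suc c)) j a b
  𝕩-powCoeff-step c zero a b = sym (≡0-· _ (δN-0-suc (c + a)))
  𝕩-powCoeff-step c (suc j) a b = cong₂ (λ x y → x · (δN a b · y)) (sym (δN-suc j (c + a))) (cong (λ v → binomℤ v a) (sym ([1+m]+1-2≡m (+ (c + a)))))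

  ⊹-cancelʳ : ∀ x y z → x ≡ y ⊹ z → x ⊹ ℚ.- z ≡ y
  ⊹-cancelʳ x y z e = trans (cong (_⊹ ℚ.- z) e) (trans (⊹-assoc y z _) (trans (cong (y ⊹_) (trans (sym (⊹-def z (ℚ.- z))) (QP.+-inverseʳ z))) (⊹-idʳ y)))

open BinomialRecurrences

module BlockSeries where

  open SR

  𝕩Geom : Series
  𝕩Geom = 𝕩 ⊛ geom (𝕩 ⊛ 𝕥 ⊛ 𝕦)

  𝕩𝕥^ : ℕ → Series
  𝕩𝕥^ d = (𝕩 ⊛ 𝕥) ^S d

  -- H_δ: the first block has δ = 1, later blocks carry the factor
  -- 1 − xtu of y(1 − xtu)/(1 − xu).
  startFactor : ℕ → Series
  startFactor zero = 𝟙 ⊖S 𝕩 ⊛ 𝕥 ⊛ 𝕦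
  startFactor (suc _) = 𝟙

  xPow≈xSeries : ∀ c → xPow c ≈ xSeries (powCoeff c (blockBinom 1 c))
  xPow≈xSeries zero = ≈-trans {𝟙} 𝟙≈xSeries (xSeries-cong blockBinom-base)
  xPow≈xSeries (suc c) = begin
    𝕩Geom ⊛ xPow c ≈⟨ ⊛-congˡ 𝕩Geom (xPow≈xSeries c) ⟩
    𝕩Geom ⊛ xSeries (powCoeff c (blockBinom 1 c)) ≈⟨ ⊛-assoc 𝕩 (geom 𝕩𝕥𝕦) _ ⟩
    𝕩 ⊛ (geom 𝕩𝕥𝕦 ⊛ xSeries (powCoeff c (blockBinom 1 c))) ≈⟨ ⊛-congˡ 𝕩 (⊛-congʳ (xSeries (powCoeff c (blockBinom 1 c))) geom𝕩𝕥𝕦≈closed) ⟩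
    𝕩 ⊛ (geom𝕩𝕥𝕦-closed ⊛ xSeries (powCoeff c (blockBinom 1 c))) ≈⟨ ⊛-congˡ 𝕩 (geom𝕩𝕥𝕦-closed-⊛ _ _ hyp) ⟩
    𝕩 ⊛ xSeries (powCoeff c (powBinom c)) ≈⟨ 𝕩⊛xSeries _ ⟩
    xSeries (λ j a b → atPred j (λ j' → powCoeff c (powBinom c) j' a b)) ≈⟨ xSeries-cong (𝕩-powCoeff-step c) ⟩
    xSeries (powCoeff (suc c) (blockBinom 1 (suc c))) ∎
    where
    hyp : xSeries (powCoeff c (powBinom c)) ≈ xSeries (powCoeff c (blockBinom 1 c)) ⊕S 𝕩𝕥𝕦 ⊛ xSeries (powCoeff c (powBinom c))
    hyp = ≈-sym {xSeries (powCoeff c (blockBinom 1 c)) ⊕S 𝕩𝕥𝕦 ⊛ xSeries (powCoeff c (powBinom c))} (≈-trans {xSeries (powCoeff c (blockBinom 1 c)) ⊕S 𝕩𝕥𝕦 ⊛ xSeries (powCoeff c (powBinom c))} (⊕-cong {xSeries (powCoeff c (blockBinom 1 c))} ≈-refl (𝕩𝕥𝕦⊛xSeries _))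
          (≈-trans {xSeries (powCoeff c (blockBinom 1 c)) ⊕S xSeries _} (xSeries-⊕ _ _) (xSeries-cong (λ j a b → sym (powCoeff-fixpoint c (blockBinom 1 c) (powBinom c) refl (powBinom-pascal c) j a b)))))

  startFactor-⊛-xPow : ∀ δ c → δ ≤ 1 → startFactor δ ⊛ xPow c ≈ xSeries (powCoeff c (blockBinom δ c))
  startFactor-⊛-xPow (suc (suc δ)) c (s≤s ())
  startFactor-⊛-xPow (suc zero) c _ = ≈-trans {𝟙 ⊛ xPow c} (𝟙⊛ (xPow c)) (xPow≈xSeries c)
  startFactor-⊛-xPow zero c _ = begin
    (𝟙 ⊖S 𝕩𝕥𝕦) ⊛ xPow c ≈⟨ ⊛-congˡ (𝟙 ⊖S 𝕩𝕥𝕦) (xPow≈xSeries c) ⟩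
    (𝟙 ⊖S 𝕩𝕥𝕦) ⊛ X1 ≈⟨ ⊛-distribʳ-⊖ 𝟙 𝕩𝕥𝕦 X1 ⟩
    𝟙 ⊛ X1 ⊖S 𝕩𝕥𝕦 ⊛ X1 ≈⟨ ⊖-cong {𝟙 ⊛ X1} (𝟙⊛ X1) (𝕩𝕥𝕦⊛xSeries _) ⟩
    X1 ⊖S xSeries _ ≈⟨ xSeries-⊖ _ _ ⟩
    xSeries _ ≈⟨ xSeries-cong (λ j a b → ⊹-cancelʳ _ _ _ (powCoeff-fixpoint c (blockBinom 0 c) (blockBinom 1 c) refl (blockBinom-pascal c) j a b)) ⟩
    xSeries (powCoeff c (blockBinom 0 c)) ∎
    where
    X1 : Series
    X1 = xSeries (powCoeff c (blockBinom 1 c))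

  𝕩𝕥^-⊛-xSeries : ∀ c d β → 𝕩𝕥^ d ⊛ xSeries (powCoeff c β) ≈ xSeries (xtPowCoeff c d β)
  𝕩𝕥^-⊛-xSeries c zero β = ≈-trans {𝟙 ⊛ xSeries (powCoeff c β)} (𝟙⊛ _) (xSeries-cong (powCoeff≡xtPowCoeff-0 c β))
  𝕩𝕥^-⊛-xSeries c (suc d) β = begin
    ((𝕩 ⊛ 𝕥) ⊛ 𝕩𝕥^ d) ⊛ xSeries (powCoeff c β) ≈⟨ ⊛-assoc (𝕩 ⊛ 𝕥) (𝕩𝕥^ d) _ ⟩
    (𝕩 ⊛ 𝕥) ⊛ (𝕩𝕥^ d ⊛ xSeries (powCoeff c β)) ≈⟨ ⊛-congˡ (𝕩 ⊛ 𝕥) (𝕩𝕥^-⊛-xSeries c d β) ⟩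
    (𝕩 ⊛ 𝕥) ⊛ xSeries (xtPowCoeff c d β) ≈⟨ ⊛-assoc 𝕩 𝕥 _ ⟩
    𝕩 ⊛ (𝕥 ⊛ xSeries (xtPowCoeff c d β)) ≈⟨ ⊛-congˡ 𝕩 (𝕥⊛xSeries _) ⟩
    𝕩 ⊛ xSeries _ ≈⟨ 𝕩⊛xSeries _ ⟩
    xSeries _ ≈⟨ xSeries-cong (xtPowCoeff-suc c d β) ⟩
    xSeries (xtPowCoeff c (suc d) β) ∎

  geom𝕩𝕦-⊛-xSeries : ∀ c d β → geom (𝕩 ⊛ 𝕦) ⊛ xSeries (xtPowCoeff c d β) ≈ xSeries (blockCoeff c d β)
  geom𝕩𝕦-⊛-xSeries c d β = ≈-trans {geom 𝕩𝕦 ⊛ xSeries (xtPowCoeff c d β)} (⊛-congʳ (xSeries (xtPowCoeff c d β)) geom𝕩𝕦≈closed) (geom𝕩𝕦-closed-⊛ _ _ hyp)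
    where
    hyp : xSeries (blockCoeff c d β) ≈ xSeries (xtPowCoeff c d β) ⊕S 𝕩𝕦 ⊛ xSeries (blockCoeff c d β)
    hyp = ≈-sym {xSeries (xtPowCoeff c d β) ⊕S 𝕩𝕦 ⊛ xSeries (blockCoeff c d β)} (≈-trans {xSeries (xtPowCoeff c d β) ⊕S 𝕩𝕦 ⊛ xSeries (blockCoeff c d β)} (⊕-cong {xSeries (xtPowCoeff c d β)} ≈-refl (𝕩𝕦⊛xSeries _))
          (≈-trans {xSeries (xtPowCoeff c d β) ⊕S xSeries _} (xSeries-⊕ _ _) (xSeries-cong (λ j a b → sym (blockCoeff-fixpoint c d β j a b)))))

  -- The series of a block with wt − dep = c and dep = d + 1.
  block : ℕ → ℕ → ℕ → Series
  block δ c d = 𝕪 ⊛ (geom (𝕩 ⊛ 𝕦) ⊛ (𝕩𝕥^ d ⊛ (startFactor δ ⊛ xPow c)))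

  block≈xSeries : ∀ δ c d → δ ≤ 1 → block δ c d ≈ 𝕪 ⊛ xSeries (blockCoeff c d (blockBinom δ c))
  block≈xSeries δ c d le = ⊛-congˡ 𝕪 (≈-trans {geom (𝕩 ⊛ 𝕦) ⊛ (𝕩𝕥^ d ⊛ (startFactor δ ⊛ xPow c))}
    (⊛-congˡ (geom (𝕩 ⊛ 𝕦)) (≈-trans {𝕩𝕥^ d ⊛ (startFactor δ ⊛ xPow c)} (⊛-congˡ (𝕩𝕥^ d) (startFactor-⊛-xPow δ c le)) (𝕩𝕥^-⊛-xSeries c d (blockBinom δ c)))) (geom𝕩𝕦-⊛-xSeries c d (blockBinom δ c)))

open BlockSeries

module RightHandSide where

  open SR

  𝕩𝕥 : Series
  𝕩𝕥 = 𝕩 ⊛ 𝕥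
  geom𝕩𝕦 : Series
  geom𝕩𝕦 = geom (𝕩 ⊛ 𝕦)

  geom𝕩𝕥𝕦-𝕩-comm : geom 𝕩𝕥𝕦 ⊛ 𝕩 ≈ 𝕩 ⊛ geom 𝕩𝕥𝕦
  geom𝕩𝕥𝕦-𝕩-comm = begin
    geom 𝕩𝕥𝕦 ⊛ 𝕩 ≈⟨ ⊛-congʳ 𝕩 geom𝕩𝕥𝕦≈closed ⟩
    geom𝕩𝕥𝕦-closed ⊛ 𝕩 ≈⟨ ≈-sym {𝕩 ⊛ geom𝕩𝕥𝕦-closed} 𝕩-geom𝕩𝕥𝕦-closed-comm ⟩
    𝕩 ⊛ geom𝕩𝕥𝕦-closed ≈⟨ ⊛-congˡ 𝕩 (≈-sym {geom 𝕩𝕥𝕦} geom𝕩𝕥𝕦≈closed) ⟩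
    𝕩 ⊛ geom 𝕩𝕥𝕦 ∎

  𝕩Geom-𝕩-comm : 𝕩Geom ⊛ 𝕩 ≈ 𝕩 ⊛ 𝕩Geom
  𝕩Geom-𝕩-comm = ⊛-commutesˡ 𝕩 (geom 𝕩𝕥𝕦) 𝕩 ≈-refl geom𝕩𝕥𝕦-𝕩-comm

  𝕩Geom-𝕩𝕥-comm : 𝕩Geom ⊛ 𝕩𝕥 ≈ 𝕩𝕥 ⊛ 𝕩Geom
  𝕩Geom-𝕩𝕥-comm = ⊛-commutesʳ 𝕩Geom 𝕩 𝕥 𝕩Geom-𝕩-comm (≈-sym {𝕥 ⊛ 𝕩Geom} (𝕥-central 𝕩Geom))

  xPow-𝕩𝕥-comm : ∀ c → xPow c ⊛ 𝕩𝕥 ≈ 𝕩𝕥 ⊛ xPow c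
  xPow-𝕩𝕥-comm c = ^S-comm 𝕩Geom 𝕩𝕥 c 𝕩Geom-𝕩𝕥-comm

  startFactor-𝕩𝕥-comm : ∀ δ → startFactor δ ⊛ 𝕩𝕥 ≈ 𝕩𝕥 ⊛ startFactor δ
  startFactor-𝕩𝕥-comm (suc δ) = ≈-trans {𝟙 ⊛ 𝕩𝕥} (𝟙⊛ 𝕩𝕥) (≈-sym {𝕩𝕥 ⊛ 𝟙} (⊛𝟙 𝕩𝕥))
  startFactor-𝕩𝕥-comm zero = begin
    (𝟙 ⊖S 𝕩𝕥𝕦) ⊛ 𝕩𝕥 ≈⟨ ⊛-distribʳ-⊖ 𝟙 𝕩𝕥𝕦 𝕩𝕥 ⟩
    𝟙 ⊛ 𝕩𝕥 ⊖S 𝕩𝕥𝕦 ⊛ 𝕩𝕥 ≈⟨ ⊖-cong {𝟙 ⊛ 𝕩𝕥} (≈-trans {𝟙 ⊛ 𝕩𝕥} (𝟙⊛ 𝕩𝕥) (≈-sym {𝕩𝕥 ⊛ 𝟙} (⊛𝟙 𝕩𝕥))) (≈-sym {𝕩𝕥 ⊛ 𝕩𝕥𝕦} 𝕩𝕥-𝕩𝕥𝕦-comm) ⟩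
    𝕩𝕥 ⊛ 𝟙 ⊖S 𝕩𝕥 ⊛ 𝕩𝕥𝕦 ≈⟨ ≈-sym {𝕩𝕥 ⊛ (𝟙 ⊖S 𝕩𝕥𝕦)} (⊛-distribˡ-⊖ 𝟙 𝕩𝕥𝕦 𝕩𝕥) ⟩
    𝕩𝕥 ⊛ (𝟙 ⊖S 𝕩𝕥𝕦) ∎

  geom𝕩𝕦-𝕩𝕥𝕦-comm : geom𝕩𝕦 ⊛ 𝕩𝕥𝕦 ≈ 𝕩𝕥𝕦 ⊛ geom𝕩𝕦
  geom𝕩𝕦-𝕩𝕥𝕦-comm = begin
    geom𝕩𝕦 ⊛ 𝕩𝕥𝕦 ≈⟨ ⊛-congʳ 𝕩𝕥𝕦 geom𝕩𝕦≈closed ⟩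
    geom𝕩𝕦-closed ⊛ 𝕩𝕥𝕦 ≈⟨ ≈-sym {𝕩𝕥𝕦 ⊛ geom𝕩𝕦-closed} 𝕩𝕥𝕦-geom𝕩𝕦-closed-comm ⟩
    𝕩𝕥𝕦 ⊛ geom𝕩𝕦-closed ≈⟨ ⊛-congˡ 𝕩𝕥𝕦 (≈-sym {geom 𝕩𝕦} geom𝕩𝕦≈closed) ⟩
    𝕩𝕥𝕦 ⊛ geom𝕩𝕦 ∎

  startFactor-geom𝕩𝕦-comm : startFactor 0 ⊛ geom𝕩𝕦 ≈ geom𝕩𝕦 ⊛ startFactor 0
  startFactor-geom𝕩𝕦-comm = begin
    (𝟙 ⊖S 𝕩𝕥𝕦) ⊛ geom𝕩𝕦 ≈⟨ ⊛-distribʳ-⊖ 𝟙 𝕩𝕥𝕦 geom𝕩𝕦 ⟩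
    𝟙 ⊛ geom𝕩𝕦 ⊖S 𝕩𝕥𝕦 ⊛ geom𝕩𝕦 ≈⟨ ⊖-cong {𝟙 ⊛ geom𝕩𝕦} (≈-trans {𝟙 ⊛ geom𝕩𝕦} (𝟙⊛ geom𝕩𝕦) (≈-sym {geom𝕩𝕦 ⊛ 𝟙} (⊛𝟙 geom𝕩𝕦))) (≈-sym {geom𝕩𝕦 ⊛ 𝕩𝕥𝕦} geom𝕩𝕦-𝕩𝕥𝕦-comm) ⟩
    geom𝕩𝕦 ⊛ 𝟙 ⊖S geom𝕩𝕦 ⊛ 𝕩𝕥𝕦 ≈⟨ ≈-sym {geom𝕩𝕦 ⊛ (𝟙 ⊖S 𝕩𝕥𝕦)} (⊛-distribˡ-⊖ 𝟙 𝕩𝕥𝕦 geom𝕩𝕦) ⟩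
    geom𝕩𝕦 ⊛ (𝟙 ⊖S 𝕩𝕥𝕦) ∎

  head≈block : ∀ c → 𝕪 ⊛ geom𝕩𝕦 ⊛ xPow c ≈ block 1 c 0
  head≈block c = begin
    (𝕪 ⊛ geom𝕩𝕦) ⊛ xPow c ≈⟨ ⊛-assoc 𝕪 geom𝕩𝕦 (xPow c) ⟩
    𝕪 ⊛ (geom𝕩𝕦 ⊛ xPow c) ≈⟨ ⊛-congˡ 𝕪 (⊛-congˡ geom𝕩𝕦 (≈-sym {𝟙 ⊛ (𝟙 ⊛ xPow c)} (≈-trans {𝟙 ⊛ (𝟙 ⊛ xPow c)} (𝟙⊛ _) (𝟙⊛ _)))) ⟩
    block 1 c 0 ∎

  yFactor : Series
  yFactor = 𝕪 ⊛ (𝟙 ⊖S 𝕩 ⊛ 𝕥 ⊛ 𝕦) ⊛ geom (𝕩 ⊛ 𝕦)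

  yFactor-⊛-xPow : ∀ n → yFactor ⊛ xPow n ≈ block 0 n 0
  yFactor-⊛-xPow n = begin
    ((𝕪 ⊛ startFactor 0) ⊛ geom𝕩𝕦) ⊛ xPow n ≈⟨ ⊛-assoc (𝕪 ⊛ startFactor 0) geom𝕩𝕦 (xPow n) ⟩
    (𝕪 ⊛ startFactor 0) ⊛ (geom𝕩𝕦 ⊛ xPow n) ≈⟨ ⊛-assoc 𝕪 (startFactor 0) _ ⟩
    𝕪 ⊛ (startFactor 0 ⊛ (geom𝕩𝕦 ⊛ xPow n)) ≈⟨ ⊛-congˡ 𝕪 (≈-sym {(startFactor 0 ⊛ geom𝕩𝕦) ⊛ xPow n} (⊛-assoc (startFactor 0) geom𝕩𝕦 (xPow n))) ⟩
    𝕪 ⊛ ((startFactor 0 ⊛ geom𝕩𝕦) ⊛ xPow n) ≈⟨ ⊛-congˡ 𝕪 (⊛-congʳ (xPow n) startFactor-geom𝕩𝕦-comm) ⟩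
    𝕪 ⊛ ((geom𝕩𝕦 ⊛ startFactor 0) ⊛ xPow n) ≈⟨ ⊛-congˡ 𝕪 (⊛-assoc geom𝕩𝕦 (startFactor 0) (xPow n)) ⟩
    𝕪 ⊛ (geom𝕩𝕦 ⊛ (startFactor 0 ⊛ xPow n)) ≈⟨ ⊛-congˡ 𝕪 (⊛-congˡ geom𝕩𝕦 (≈-sym {𝟙 ⊛ (startFactor 0 ⊛ xPow n)} (𝟙⊛ _))) ⟩
    block 0 n 0 ∎

  startFactor-xPow-⊛-𝕩𝕥 : ∀ δ c n → (startFactor δ ⊛ xPow c) ⊛ (𝕩𝕥 ⊛ xPow n) ≈ 𝕩𝕥 ⊛ (startFactor δ ⊛ xPow (c + n))
  startFactor-xPow-⊛-𝕩𝕥 δ c n = begin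
    (startFactor δ ⊛ xPow c) ⊛ (𝕩𝕥 ⊛ xPow n) ≈⟨ ⊛-assoc (startFactor δ) (xPow c) _ ⟩
    startFactor δ ⊛ (xPow c ⊛ (𝕩𝕥 ⊛ xPow n)) ≈⟨ ⊛-congˡ (startFactor δ) (≈-sym {(xPow c ⊛ 𝕩𝕥) ⊛ xPow n} (⊛-assoc (xPow c) 𝕩𝕥 (xPow n))) ⟩
    startFactor δ ⊛ ((xPow c ⊛ 𝕩𝕥) ⊛ xPow n) ≈⟨ ⊛-congˡ (startFactor δ) (⊛-congʳ (xPow n) (xPow-𝕩𝕥-comm c)) ⟩
    startFactor δ ⊛ ((𝕩𝕥 ⊛ xPow c) ⊛ xPow n) ≈⟨ ⊛-congˡ (startFactor δ) (⊛-assoc 𝕩𝕥 (xPow c) (xPow n)) ⟩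
    startFactor δ ⊛ (𝕩𝕥 ⊛ (xPow c ⊛ xPow n)) ≈⟨ ⊛-congˡ (startFactor δ) (⊛-congˡ 𝕩𝕥 (^S-+ 𝕩Geom c n)) ⟩
    startFactor δ ⊛ (𝕩𝕥 ⊛ xPow (c + n)) ≈⟨ ≈-sym {(startFactor δ ⊛ 𝕩𝕥) ⊛ xPow (c + n)} (⊛-assoc (startFactor δ) 𝕩𝕥 _) ⟩
    (startFactor δ ⊛ 𝕩𝕥) ⊛ xPow (c + n) ≈⟨ ⊛-congʳ (xPow (c + n)) (startFactor-𝕩𝕥-comm δ) ⟩
    (𝕩𝕥 ⊛ startFactor δ) ⊛ xPow (c + n) ≈⟨ ⊛-assoc 𝕩𝕥 (startFactor δ) _ ⟩
    𝕩𝕥 ⊛ (startFactor δ ⊛ xPow (c + n)) ∎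

  block-⊛-𝕩𝕥 : ∀ δ c d n → block δ c d ⊛ (𝕩𝕥 ⊛ xPow n) ≈ block δ (c + n) (suc d)
  block-⊛-𝕩𝕥 δ c d n = begin
    (𝕪 ⊛ (geom𝕩𝕦 ⊛ (𝕩𝕥^ d ⊛ Z))) ⊛ W ≈⟨ ⊛-assoc 𝕪 _ W ⟩
    𝕪 ⊛ ((geom𝕩𝕦 ⊛ (𝕩𝕥^ d ⊛ Z)) ⊛ W) ≈⟨ ⊛-congˡ 𝕪 (⊛-assoc geom𝕩𝕦 _ W) ⟩
    𝕪 ⊛ (geom𝕩𝕦 ⊛ ((𝕩𝕥^ d ⊛ Z) ⊛ W)) ≈⟨ ⊛-congˡ 𝕪 (⊛-congˡ geom𝕩𝕦 (⊛-assoc (𝕩𝕥^ d) Z W)) ⟩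
    𝕪 ⊛ (geom𝕩𝕦 ⊛ (𝕩𝕥^ d ⊛ (Z ⊛ W))) ≈⟨ ⊛-congˡ 𝕪 (⊛-congˡ geom𝕩𝕦 (⊛-congˡ (𝕩𝕥^ d) (startFactor-xPow-⊛-𝕩𝕥 δ c n))) ⟩
    𝕪 ⊛ (geom𝕩𝕦 ⊛ (𝕩𝕥^ d ⊛ (𝕩𝕥 ⊛ Z'))) ≈⟨ ⊛-congˡ 𝕪 (⊛-congˡ geom𝕩𝕦 (≈-sym {(𝕩𝕥^ d ⊛ 𝕩𝕥) ⊛ Z'} (⊛-assoc (𝕩𝕥^ d) 𝕩𝕥 Z'))) ⟩
    𝕪 ⊛ (geom𝕩𝕦 ⊛ ((𝕩𝕥^ d ⊛ 𝕩𝕥) ⊛ Z')) ≈⟨ ⊛-congˡ 𝕪 (⊛-congˡ geom𝕩𝕦 (⊛-congʳ Z' (^S-comm 𝕩𝕥 𝕩𝕥 d ≈-refl))) ⟩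
    𝕪 ⊛ (geom𝕩𝕦 ⊛ ((𝕩𝕥 ⊛ 𝕩𝕥^ d) ⊛ Z')) ∎
    where
    Z : Series
    Z = startFactor δ ⊛ xPow c
    W : Series
    W = 𝕩𝕥 ⊛ xPow n
    Z' : Series
    Z' = startFactor δ ⊛ xPow (c + n)

  tailProduct : List ℕ → Series
  tailProduct [] = 𝟙
  tailProduct (k ∷ ks) = middle ⊛ xPow (k ∸ 1) ⊛ tailProduct ks

  block-⊛-tailProduct : ∀ δ c d k ks → block δ c d ⊛ tailProduct (k ∷ ks) ≈ block δ c d ⊛ (block 0 (k ∸ 1) 0 ⊛ tailProduct ks) ⊕S block δ (c + (k ∸ 1)) (suc d) ⊛ tailProduct ks
  block-⊛-tailProduct δ c d k ks = begin
    B ⊛ ((middle ⊛ P) ⊛ R) ≈⟨ ⊛-congˡ B (⊛-congʳ R (⊛-distribʳ yFactor 𝕩𝕥 P)) ⟩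
    B ⊛ ((yFactor ⊛ P ⊕S 𝕩𝕥 ⊛ P) ⊛ R) ≈⟨ ⊛-congˡ B (⊛-distribʳ (yFactor ⊛ P) (𝕩𝕥 ⊛ P) R) ⟩
    B ⊛ ((yFactor ⊛ P) ⊛ R ⊕S (𝕩𝕥 ⊛ P) ⊛ R) ≈⟨ ⊛-distribˡ _ _ B ⟩
    B ⊛ ((yFactor ⊛ P) ⊛ R) ⊕S B ⊛ ((𝕩𝕥 ⊛ P) ⊛ R) ≈⟨ ⊕-cong {B ⊛ ((yFactor ⊛ P) ⊛ R)} (⊛-congˡ B (⊛-congʳ R (yFactor-⊛-xPow (k ∸ 1)))) (≈-trans {B ⊛ ((𝕩𝕥 ⊛ P) ⊛ R)} (≈-sym {(B ⊛ (𝕩𝕥 ⊛ P)) ⊛ R} (⊛-assoc B (𝕩𝕥 ⊛ P) R)) (⊛-congʳ R (block-⊛-𝕩𝕥 δ c d (k ∸ 1)))) ⟩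
    B ⊛ (block 0 (k ∸ 1) 0 ⊛ R) ⊕S block δ (c + (k ∸ 1)) (suc d) ⊛ R ∎
    where
    B : Series
    B = block δ c d
    P : Series
    P = xPow (k ∸ 1)
    R : Series
    R = tailProduct ks

open RightHandSide

module Compositions where

  open ≡-Reasoning

  Σ-comps-suc : ∀ n m (g : List ℕ → ℚ) → SumL (comps (suc n) m) g ≡ SumL (nsplits m) (λ p → SumL (comps n (proj₂ p)) (λ ee → g (proj₁ p ∷ ee)))
  Σ-comps-suc n m g = trans (Σ-concatMap (nsplits m) (λ p → map (proj₁ p ∷_) (comps n (proj₂ p))) g)
    (Σ-cong (nsplits m) (λ p → Σ-map (comps n (proj₂ p)) (proj₁ p ∷_) g))

  Σ-comps-0 : ∀ r (G : List ℕ → ℕ → ℚ) → SumL (nsplits r) (λ p → SumL (comps 0 (proj₁ p)) (λ u → G u (proj₂ p))) ≡ G [] r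
  Σ-comps-0 zero G = trans (SumL-∷ (0 , 0) [] _) (trans (cong₂ _⊹_ (trans (SumL-∷ [] [] _) (trans (cong (G [] 0 ⊹_) (SumL-[] _)) (⊹-idʳ _))) (SumL-[] _)) (⊹-idʳ _))
  Σ-comps-0 (suc r) G = begin
    SumL (nsplits (suc r)) F ≡⟨ cong (λ L → SumL L F) (nsplits-suc r) ⟩
    SumL ((0 , suc r) ∷ map incrˡ (nsplits r)) F ≡⟨ SumL-∷ (0 , suc r) _ F ⟩
    F (0 , suc r) ⊹ SumL (map incrˡ (nsplits r)) F ≡⟨ cong₂ _⊹_ (trans (SumL-∷ [] [] _) (trans (cong (G [] (suc r) ⊹_) (SumL-[] _)) (⊹-idʳ _))) (trans (Σ-map (nsplits r) incrˡ F) (Σ-0' (nsplits r) _ (λ p → SumL-[] _))) ⟩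
    G [] (suc r) ⊹ 0ℚ ≡⟨ ⊹-idʳ _ ⟩
    G [] (suc r) ∎
    where
    F : ℕ × ℕ → ℚ
    F p = SumL (comps 0 (proj₁ p)) (λ u → G u (proj₂ p))

  comps-split : ∀ j k r (g : List ℕ → ℚ) → SumL (comps (j + k) r) g ≡
    SumL (nsplits r) (λ p → SumL (comps j (proj₁ p)) (λ u → SumL (comps k (proj₂ p)) (λ v → g (u ++ v))))
  comps-split zero k r g = sym (Σ-comps-0 r (λ u s → SumL (comps k s) (λ v → g (u ++ v))))
  comps-split (suc j) k r g = begin
    SumL (comps (suc (j + k)) r) g ≡⟨ Σ-comps-suc (j + k) r g ⟩
    SumL (nsplits r) (λ p → SumL (comps (j + k) (proj₂ p)) (λ ee → g (proj₁ p ∷ ee))) ≡⟨ Σ-cong (nsplits r) (λ p → comps-split j k (proj₂ p) (λ ee → g (proj₁ p ∷ ee))) ⟩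
    SumL (nsplits r) (λ p → SumL (nsplits (proj₂ p)) (λ q → F (proj₁ p) (proj₁ q) (proj₂ q))) ≡⟨ sym (Σ-nsplits-assoc r F) ⟩
    SumL (nsplits r) (λ p → SumL (nsplits (proj₁ p)) (λ q → F (proj₁ q) (proj₂ q) (proj₂ p))) ≡⟨ Σ-cong (nsplits r) (λ p → sym (Σ-comps-suc j (proj₁ p) (λ u → SumL (comps k (proj₂ p)) (λ v → g (u ++ v))))) ⟩
    SumL (nsplits r) (λ p → SumL (comps (suc j) (proj₁ p)) (λ u → SumL (comps k (proj₂ p)) (λ v → g (u ++ v)))) ∎
    where
    F : ℕ → ℕ → ℕ → ℚ
    F x y z = SumL (comps j y) (λ u → SumL (comps k z) (λ v → g (x ∷ u ++ v)))

  comps-len : ∀ n m → All (λ u → length u ≡ n) (comps n m)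
  comps-len zero zero = refl ∷ []
  comps-len zero (suc m) = []
  comps-len (suc n) m = AllP.concat⁺ (AllP.map⁺ (go (nsplits m)))
    where
    go : ∀ (L : List (ℕ × ℕ)) → All (λ p → All (λ u → length u ≡ suc n) (map (proj₁ p ∷_) (comps n (proj₂ p)))) L
    go [] = []
    go (p ∷ L) = AllP.map⁺ (All.map (cong suc) (comps-len n (proj₂ p))) ∷ go L

  take-length-++ : ∀ {A : Set} (u v : List A) → take (length u) (u ++ v) ≡ u
  take-length-++ [] v = refl
  take-length-++ (x ∷ u) v = cong (x ∷_) (take-length-++ u v)

  drop-length-++ : ∀ {A : Set} (u v : List A) → drop (length u) (u ++ v) ≡ v
  drop-length-++ [] v = refl
  drop-length-++ (x ∷ u) v = drop-length-++ u v

  take-drop-++ : ∀ n (F : List ℕ → List ℕ → ℚ) u v → length u ≡ n → F (take n (u ++ v)) (drop n (u ++ v)) ≡ F u v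
  take-drop-++ n F u v refl = cong₂ F (take-length-++ u v) (drop-length-++ u v)

  Σ-comps-halves : ∀ n m (F : List ℕ → List ℕ → ℚ) → SumL (comps (n + n) m) (λ ee → F (take n ee) (drop n ee)) ≡
    SumL (nsplits m) (λ p → SumL (comps n (proj₁ p)) (λ u → SumL (comps n (proj₂ p)) (λ v → F u v)))
  Σ-comps-halves n m F = trans (comps-split n n m (λ ee → F (take n ee) (drop n ee)))
    (Σ-cong (nsplits m) (λ p → Σ-congAll (All.map (λ {u} lu → Σ-cong (comps n (proj₂ p)) (λ v → take-drop-++ n F u v lu)) (comps-len n (proj₁ p)))))

  Σ-nsplits-transpose : ∀ m (K : ℕ → ℕ → ℕ → ℕ → ℚ) →
    SumL (nsplits m) (λ p → SumL (nsplits (proj₁ p)) (λ q → SumL (nsplits (proj₂ p)) (λ q' → K (proj₁ q) (proj₂ q) (proj₁ q') (proj₂ q')))) ≡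
    SumL (nsplits m) (λ p → SumL (nsplits (proj₁ p)) (λ r → SumL (nsplits (proj₂ p)) (λ t → K (proj₁ r) (proj₁ t) (proj₂ r) (proj₂ t))))
  Σ-nsplits-transpose m K = begin
    SumL (nsplits m) (λ p → SumL (nsplits (proj₁ p)) (λ q → F1 (proj₁ q) (proj₂ q) (proj₂ p))) ≡⟨ Σ-nsplits-assoc m F1 ⟩
    SumL (nsplits m) (λ p → SumL (nsplits (proj₂ p)) (λ t → SumL (nsplits (proj₂ t)) (λ q' → K (proj₁ p) (proj₁ t) (proj₁ q') (proj₂ q'))))
      ≡⟨ Σ-cong (nsplits m) (λ p → trans (sym (Σ-nsplits-assoc (proj₂ p) (λ x y z → K (proj₁ p) x y z)))
          (trans (Σ-cong (nsplits (proj₂ p)) (λ t → Σ-nsplits-swap (proj₁ t) (λ x y → K (proj₁ p) x y (proj₂ t))))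
          (Σ-nsplits-assoc (proj₂ p) (λ x y z → K (proj₁ p) y x z)))) ⟩
    SumL (nsplits m) (λ p → SumL (nsplits (proj₂ p)) (λ t → F5 (proj₁ p) (proj₁ t) (proj₂ t))) ≡⟨ sym (Σ-nsplits-assoc m F5) ⟩
    SumL (nsplits m) (λ p → SumL (nsplits (proj₁ p)) (λ r → SumL (nsplits (proj₂ p)) (λ t → K (proj₁ r) (proj₁ t) (proj₂ r) (proj₂ t)))) ∎
    where
    F1 : ℕ → ℕ → ℕ → ℚ
    F1 x y z = SumL (nsplits z) (λ q' → K x y (proj₁ q') (proj₂ q'))
    F5 : ℕ → ℕ → ℕ → ℚ
    F5 x y z = SumL (nsplits z) (λ q → K x (proj₁ q) y (proj₂ q))

  Σ-comps-suc-halves : ∀ l m (F : List ℕ → List ℕ → ℚ) →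
    SumL (comps (suc l + suc l) m) (λ ee → F (take (suc l) ee) (drop (suc l) ee)) ≡
    SumL (nsplits m) (λ M → SumL (nsplits (proj₁ M)) (λ r → SumL (comps (l + l) (proj₂ M)) (λ ee → F (proj₁ r ∷ take l ee) (proj₂ r ∷ drop l ee))))
  Σ-comps-suc-halves l m F = begin
    SumL (comps (suc l + suc l) m) (λ ee → F (take (suc l) ee) (drop (suc l) ee)) ≡⟨ Σ-comps-halves (suc l) m F ⟩
    SumL (nsplits m) (λ p → SumL (comps (suc l) (proj₁ p)) (λ u → SumL (comps (suc l) (proj₂ p)) (λ v → F u v)))
      ≡⟨ Σ-cong (nsplits m) (λ p → trans (Σ-comps-suc l (proj₁ p) _) (Σ-cong (nsplits (proj₁ p)) (λ q →
           trans (Σ-cong (comps l (proj₂ q)) (λ u' → Σ-comps-suc l (proj₂ p) _)) (Σ-swap (comps l (proj₂ q)) (nsplits (proj₂ p)) _)))) ⟩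
    SumL (nsplits m) (λ p → SumL (nsplits (proj₁ p)) (λ q → SumL (nsplits (proj₂ p)) (λ q' → K (proj₁ q) (proj₂ q) (proj₁ q') (proj₂ q')))) ≡⟨ Σ-nsplits-transpose m K ⟩
    SumL (nsplits m) (λ p → SumL (nsplits (proj₁ p)) (λ r → SumL (nsplits (proj₂ p)) (λ t → K (proj₁ r) (proj₁ t) (proj₂ r) (proj₂ t))))
      ≡⟨ Σ-cong (nsplits m) (λ M → Σ-cong (nsplits (proj₁ M)) (λ r → sym (Σ-comps-halves l (proj₂ M) (λ u v → F (proj₁ r ∷ u) (proj₂ r ∷ v))))) ⟩
    SumL (nsplits m) (λ M → SumL (nsplits (proj₁ M)) (λ r → SumL (comps (l + l) (proj₂ M)) (λ ee → F (proj₁ r ∷ take l ee) (proj₂ r ∷ drop l ee)))) ∎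
    where
    K : ℕ → ℕ → ℕ → ℕ → ℚ
    K e s e' s' = SumL (comps l s) (λ u' → SumL (comps l s') (λ v' → F (e ∷ u') (e' ∷ v')))

open Compositions

module MonomialConvolution where

  open ≡-Reasoning

  Σ-splits-δW-++ : ∀ u v w → SumL (splits w) (λ P → δW u (proj₁ P) · δW v (proj₂ P)) ≡ δW (u ++ v) w
  Σ-splits-δW-++ [] v w = Σ-splits-δ[]ˡ w (δW v)
  Σ-splits-δW-++ (c ∷ u) v [] = trans (SumL-∷ _ _ _) (trans (cong₂ _⊹_ (≡0-· _ (δW-∷[] c u)) (SumL-[] _)) (trans (⊹-idˡ 0ℚ) (sym (δW-∷[] c (u ++ v)))))
  Σ-splits-δW-++ (c ∷ u) v (d ∷ w) = trans (SumL-∷ _ _ _) (trans (cong₂ _⊹_ (≡0-· _ (δW-∷[] c u)) (Σ-map (splits w) (λ p → (d ∷ proj₁ p , proj₂ p)) _)) (trans (⊹-idˡ _) (h c d)))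
    where
    h : ∀ c d → SumL (splits w) (λ P → δW (c ∷ u) (d ∷ proj₁ P) · δW v (proj₂ P)) ≡ δW (c ∷ u ++ v) (d ∷ w)
    h c d = h' c d (c ≟L d)
      where
      h' : ∀ c d → Dec (c ≡ d) → SumL (splits w) (λ P → δW (c ∷ u) (d ∷ proj₁ P) · δW v (proj₂ P)) ≡ δW (c ∷ u ++ v) (d ∷ w)
      h' c .c (yes refl) = trans (Σ-cong (splits w) (λ P → cong (_· δW v (proj₂ P)) (δW-cons c u (proj₁ P)))) (trans (Σ-splits-δW-++ u v w) (sym (δW-cons c (u ++ v) w)))
      h' c d (no ne) = trans (Σ-0' (splits w) _ (λ P → ≡0-· _ (δW-cons≢ c d u (proj₁ P) ne))) (sym (δW-cons≢ c d (u ++ v) w ne))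

  δN-+ : ∀ x y r → δN (x + y) (x + r) ≡ δN y r
  δN-+ zero y r = refl
  δN-+ (suc x) y r = trans (δN-suc (x + y) (x + r)) (δN-+ x y r)

  Σ-nsplits-δN-+ : ∀ x y a → SumL (nsplits a) (λ A → δN x (proj₁ A) · δN y (proj₂ A)) ≡ δN (x + y) a
  Σ-nsplits-δN-+ x y a = h (x ≤? a)
    where
    h : Dec (x ≤ a) → SumL (nsplits a) (λ A → δN x (proj₁ A) · δN y (proj₂ A)) ≡ δN (x + y) a
    h (yes le) = trans (cong (λ n → SumL (nsplits n) (λ A → δN x (proj₁ A) · δN y (proj₂ A))) (sym e)) (trans (Σ-nsplits-δ x (a ∸ x) (δN y)) (trans (sym (δN-+ x y (a ∸ x))) (cong (δN (x + y)) e)))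
      where
        e : x + (a ∸ x) ≡ a
        e = NP.m+[n∸m]≡n le
    h (no nle) = trans (Σ-nsplits-δ-beyond a x (δN y) (NP.≰⇒> nle)) (sym (δN-≢ {x + y} {a} (λ eq → nle (subst (x ≤_) eq (NP.m≤m+n x y)))))

  Σ-pull : ∀ {X Y Z : Set} (LX : List X) (LY : List Y) (LZ : List Z) (F : X → Y → Z → ℚ) →
    SumL LX (λ x → SumL LY (λ y → SumL LZ (λ z → F x y z))) ≡ SumL LZ (λ z → SumL LX (λ x → SumL LY (λ y → F x y z)))
  Σ-pull LX LY LZ F = trans (Σ-cong LX (λ x → Σ-swap LY LZ (F x))) (Σ-swap LX LZ (λ x z → SumL LY (λ y → F x y z)))

  Σ-splits-nsplits-collapse : ∀ b1 b2 u v s t w a →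
    SumL (splits w) (λ P → SumL (nsplits a) (λ A → (b1 · (δW u (proj₁ P) · δN s (proj₁ A))) · (b2 · (δW v (proj₂ P) · δN t (proj₂ A))))) ≡
    (b1 · b2) · (δW (u ++ v) w · δN (s + t) a)
  Σ-splits-nsplits-collapse b1 b2 u v s t w a = begin
    SumL (splits w) (λ P → SumL (nsplits a) (λ A → (b1 · (δW u (proj₁ P) · δN s (proj₁ A))) · (b2 · (δW v (proj₂ P) · δN t (proj₂ A)))))
      ≡⟨ Σ-cong (splits w) (λ P → trans (Σ-cong (nsplits a) (λ A → trans (·-interchange b1 _ b2 _) (cong ((b1 · b2) ·_) (·-interchange _ _ _ _)))) (trans (sym (Σ-*ˡ (nsplits a) (b1 · b2) _)) (cong ((b1 · b2) ·_) (trans (sym (Σ-*ˡ (nsplits a) _ _)) (cong ((δW u (proj₁ P) · δW v (proj₂ P)) ·_) (Σ-nsplits-δN-+ s t a)))))) ⟩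
    SumL (splits w) (λ P → (b1 · b2) · ((δW u (proj₁ P) · δW v (proj₂ P)) · δN (s + t) a))
      ≡⟨ trans (sym (Σ-*ˡ (splits w) (b1 · b2) _)) (cong ((b1 · b2) ·_) (trans (sym (Σ-*ʳ (splits w) (δN (s + t) a) _)) (cong (_· δN (s + t) a) (Σ-splits-δW-++ u v w)))) ⟩
    (b1 · b2) · (δW (u ++ v) w · δN (s + t) a) ∎

open MonomialConvolution

module BlockTerms where

  open ≡-Reasoning

  tExponent : List (List ℕ) → ℕ
  tExponent D = sum (map (λ b → dep b ∸ 1) D)

  termIndex : List (List ℕ) → List ℕ → List ℕ → List ℕ
  termIndex D e e' = zipWith _+_ (zipWith _+_ (map wt D) e) e'

  termCoeff : ℕ → List (List ℕ) → List ℕ → List ℕ → Word → ℕ → ℚ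
  termCoeff δ D e e' w a = binomProd δ D e · (δW (idxWord (termIndex D e e')) w · δN (tExponent D + sum e) a)

  decompSeries : ℕ → List (List ℕ) → Series
  decompSeries δ D w a m = SumL (comps (length D + length D) m) (λ ee → termCoeff δ D (take (length D) ee) (drop (length D) ee) w a)

  blockBinomTerm : ℕ → List ℕ → ℕ → ℚ
  blockBinomTerm δ b e = binomℤ (+ wt b ℤ.- + dep b ℤ.+ + e ℤ.+ + δ ℤ.- + 2) e

  blockSeries : ℕ → List ℕ → Series
  blockSeries δ b w a m = SumL (nsplits m) (λ q → blockBinomTerm δ b (proj₁ q) · (δW (idxWord (wt b + proj₁ q + proj₂ q ∷ [])) w · δN (dep b ∸ 1 + proj₁ q) a))

  termCoeff-∷ : ∀ δ b D r1 r2 e e' w a → termCoeff δ (b ∷ D) (r1 ∷ e) (r2 ∷ e') w a ≡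
    (blockBinomTerm δ b r1 · binomProd 0 D e) · (δW (idxWord (wt b + r1 + r2 ∷ []) ++ idxWord (termIndex D e e')) w · δN ((dep b ∸ 1 + r1) + (tExponent D + sum e)) a)
  termCoeff-∷ δ b D r1 r2 e e' w a = cong₂ _·_ (·-def _ _) (cong₂ _·_ (cong (λ v → δW v w) (cong (_++ idxWord (termIndex D e e')) (sym (LP.++-identityʳ (Y ∷ replicate (wt b + r1 + r2 ∸ 1) X)))))
    (cong (λ n → δN n a) (interchange NP.+-commutativeSemigroup (dep b ∸ 1) (tExponent D) r1 (sum e))))

  decompSeries-∷ : ∀ δ b D → decompSeries δ (b ∷ D) ≈ blockSeries δ b ⊛ decompSeries 0 D
  decompSeries-∷ δ b D w a m = begin
    decompSeries δ (b ∷ D) w a m ≡⟨ Σ-comps-suc-halves l m (λ u v → termCoeff δ (b ∷ D) u v w a) ⟩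
    SumL (nsplits m) (λ M → SumL (nsplits (proj₁ M)) (λ r → SumL (comps (l + l) (proj₂ M)) (λ ee → termCoeff δ (b ∷ D) (proj₁ r ∷ take l ee) (proj₂ r ∷ drop l ee) w a)))
      ≡⟨ Σ-cong (nsplits m) (λ M → Σ-cong (nsplits (proj₁ M)) (λ r → Σ-cong (comps (l + l) (proj₂ M)) (λ ee →
           trans (termCoeff-∷ δ b D (proj₁ r) (proj₂ r) (take l ee) (drop l ee) w a)
           (sym (Σ-splits-nsplits-collapse (blockBinomTerm δ b (proj₁ r)) (binomProd 0 D (take l ee)) (idxWord (wt b + proj₁ r + proj₂ r ∷ [])) (idxWord (termIndex D (take l ee) (drop l ee))) (dep b ∸ 1 + proj₁ r) (tExponent D + sum (take l ee)) w a))))) ⟩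
    SumL (nsplits m) (λ M → SumL (nsplits (proj₁ M)) (λ r → SumL (comps (l + l) (proj₂ M)) (λ ee → SumL (splits w) (λ P → SumL (nsplits a) (λ A → Xf r P A · Yf ee P A)))))
      ≡⟨ Σ-cong (nsplits m) (λ M → trans (Σ-cong (nsplits (proj₁ M)) (λ r → sym (Σ-pull (splits w) (nsplits a) (comps (l + l) (proj₂ M)) (λ P A ee → Xf r P A · Yf ee P A))))
           (sym (Σ-pull (splits w) (nsplits a) (nsplits (proj₁ M)) (λ P A r → SumL (comps (l + l) (proj₂ M)) (λ ee → Xf r P A · Yf ee P A))))) ⟩
    SumL (nsplits m) (λ M → SumL (splits w) (λ P → SumL (nsplits a) (λ A → SumL (nsplits (proj₁ M)) (λ r → SumL (comps (l + l) (proj₂ M)) (λ ee → Xf r P A · Yf ee P A)))))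
      ≡⟨ sym (Σ-pull (splits w) (nsplits a) (nsplits m) (λ P A M → SumL (nsplits (proj₁ M)) (λ r → SumL (comps (l + l) (proj₂ M)) (λ ee → Xf r P A · Yf ee P A)))) ⟩
    SumL (splits w) (λ P → SumL (nsplits a) (λ A → SumL (nsplits m) (λ M → SumL (nsplits (proj₁ M)) (λ r → SumL (comps (l + l) (proj₂ M)) (λ ee → Xf r P A · Yf ee P A)))))
      ≡⟨ Σ-cong (splits w) (λ P → Σ-cong (nsplits a) (λ A → Σ-cong (nsplits m) (λ M →
           trans (Σ-cong (nsplits (proj₁ M)) (λ r → sym (Σ-*ˡ (comps (l + l) (proj₂ M)) (Xf r P A) (λ ee → Yf ee P A)))) (sym (Σ-*ʳ (nsplits (proj₁ M)) _ (λ r → Xf r P A)))))) ⟩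
    SumL (splits w) (λ P → SumL (nsplits a) (λ A → SumL (nsplits m) (λ M → blockSeries δ b (proj₁ P) (proj₁ A) (proj₁ M) · decompSeries 0 D (proj₂ P) (proj₂ A) (proj₂ M))))
      ≡⟨ sym (⊛-def (blockSeries δ b) (decompSeries 0 D) w a m) ⟩
    (blockSeries δ b ⊛ decompSeries 0 D) w a m ∎
    where
    l : ℕ
    l = length D
    Xf : ℕ × ℕ → Word × Word → ℕ × ℕ → ℚ
    Xf r P A = blockBinomTerm δ b (proj₁ r) · (δW (idxWord (wt b + proj₁ r + proj₂ r ∷ [])) (proj₁ P) · δN (dep b ∸ 1 + proj₁ r) (proj₁ A))
    Yf : List ℕ → Word × Word → ℕ × ℕ → ℚ
    Yf ee P A = termCoeff 0 D (take l ee) (drop l ee) (proj₂ P) (proj₂ A)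

  decompSeries-[] : ∀ δ → decompSeries δ [] ≈ 𝟙
  decompSeries-[] δ w a zero = trans (SumL-∷ [] [] _) (trans (cong₂ _⊹_ (trans (·-idˡ _) refl) (SumL-[] _)) (trans (⊹-idʳ _) (sym (trans (mono-coeff [] 0 0 w a 0) (cong (δW [] w ·_) (trans (cong (δN 0 a ·_) (δN-refl 0)) (·-idʳ _)))))))
  decompSeries-[] δ w a (suc m) = trans (SumL-[] _) (sym (trans (mono-coeff [] 0 0 w a (suc m)) (·-≡0 _ (·-≡0 _ (δN-0-suc m)))))

open BlockTerms

module LeftHandSide where

  open ≡-Reasoning

  -- `decomps` and `RHS` use where-bound helpers, which can only be reached through the
  -- definitional unfoldings recorded by decomps-step and RHS-tail.
  decomps-step : ∀ k ks → Σ (List (List ℕ) → List (List (List ℕ))) (λ f → decomps (k ∷ ks) ≡ concatMap f (decomps ks))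
  decomps-step k ks = (_ , refl)

  extendDecomp : ℕ → List ℕ → List (List ℕ) → List (List (List ℕ))
  extendDecomp k ks = proj₁ (decomps-step k ks)

  prependBlock : List ℕ → List (List ℕ) → List (List (List ℕ))
  prependBlock p [] = (p ∷ []) ∷ []
  prependBlock p (b ∷ bs) = (p ∷ b ∷ bs) ∷ ((p ++ b) ∷ bs) ∷ []

  extendDecomp≡prependBlock : ∀ k ks D → extendDecomp k ks D ≡ prependBlock (k ∷ []) D
  extendDecomp≡prependBlock k ks [] = refl
  extendDecomp≡prependBlock k ks (b ∷ bs) = refl

  IsDecompOf : List ℕ → List (List ℕ) → Set
  IsDecompOf K D = (sum (map length D) ≡ length K) × All (λ b → 1 ≤ length b) D

  decomps-valid : ∀ K → All (IsDecompOf K) (decomps K)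
  decomps-valid [] = (refl , []) ∷ []
  decomps-valid (k ∷ ks) = AllP.concat⁺ (AllP.map⁺ (All.map (λ {D} inv → subst (All (IsDecompOf (k ∷ ks))) (sym (extendDecomp≡prependBlock k ks D)) (h D inv)) (decomps-valid ks)))
    where
    h : ∀ D → IsDecompOf ks D → All (IsDecompOf (k ∷ ks)) (prependBlock (k ∷ []) D)
    h [] (e , _) = (cong suc e , s≤s z≤n ∷ []) ∷ []
    h (b ∷ bs) (e , ne ∷ nes) = (cong suc e , s≤s z≤n ∷ ne ∷ nes) ∷ (cong suc e , s≤s z≤n ∷ nes) ∷ []

  tExponent-+-length : ∀ D → All (λ b → 1 ≤ length b) D → tExponent D + length D ≡ sum (map length D)
  tExponent-+-length [] [] = refl
  tExponent-+-length ((x ∷ b) ∷ D) (ne ∷ nes) = begin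
    (length b + tExponent D) + suc (length D) ≡⟨ NP.+-suc _ (length D) ⟩
    suc ((length b + tExponent D) + length D) ≡⟨ cong suc (NP.+-assoc (length b) (tExponent D) (length D)) ⟩
    suc (length b + (tExponent D + length D)) ≡⟨ cong (λ z → suc (length b + z)) (tExponent-+-length D nes) ⟩
    suc (length b + sum (map length D)) ∎

  tExponent≡length-∸ : ∀ K D → IsDecompOf K D → length K ∸ length D ≡ tExponent D
  tExponent≡length-∸ K D (e , ne) = trans (cong (_∸ length D) (trans (sym e) (sym (tExponent-+-length D ne)))) (NP.m+n∸n≡m (tExponent D) (length D))

  LHS≡Σ-decompSeries : ∀ K w a m → LHS K w a m ≡ SumL (decomps K) (λ D → decompSeries 1 D w a m)
  LHS≡Σ-decompSeries K w a m = begin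
    LHS K w a m ≡⟨ SumL-def (hTerms m K) _ ⟩
    SumL (hTerms m K) f ≡⟨ Σ-concatMap (decomps K) _ f ⟩
    SumL (decomps K) (λ D → SumL (map (hD D) (comps (length D + length D) m)) f) ≡⟨ Σ-cong (decomps K) (λ D → Σ-map (comps (length D + length D) m) (hD D) f) ⟩
    SumL (decomps K) (λ D → SumL (comps (length D + length D) m) (λ ee → f (hD D ee)))
      ≡⟨ Σ-congAll (All.map (λ {D} inv → Σ-cong (comps (length D + length D) m) (λ ee →
           trans (·-def _ _) (cong (binomProd 1 D (take (length D) ee) ·_) (trans (·-def _ _)
           (cong (λ n → δW (idxWord (termIndex D (take (length D) ee) (drop (length D) ee))) w · δN (n + sum (take (length D) ee)) a) (tExponent≡length-∸ K D inv)))))) (decomps-valid K)) ⟩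
    SumL (decomps K) (λ D → decompSeries 1 D w a m) ∎
    where
    f : Term → ℚ
    f τ = Term.coeff τ ℚ.* (δW (idxWord (Term.index τ)) w ℚ.* δN (Term.texp τ) a)
    hD : List (List ℕ) → List ℕ → Term
    hD D ee = term (binomProd 1 D (take (length D) ee)) (length K ∸ length D + sum (take (length D) ee)) (termIndex D (take (length D) ee) (drop (length D) ee))

  ΣS : ∀ {A : Set} → List A → (A → Series) → Series
  ΣS L F w a m = SumL L (λ x → F x w a m)

  ⊛-ΣS : ∀ {A : Set} B (L : List A) (F : A → Series) → B ⊛ ΣS L F ≈ ΣS L (λ x → B ⊛ F x)
  ⊛-ΣS B L F w a m = begin
    (B ⊛ ΣS L F) w a m ≡⟨ ⊛-def B (ΣS L F) w a m ⟩
    SumL (splits w) (λ P → SumL (nsplits a) (λ A → SumL (nsplits m) (λ M → B (proj₁ P) (proj₁ A) (proj₁ M) · SumL L (λ x → F x (proj₂ P) (proj₂ A) (proj₂ M)))))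
      ≡⟨ Σ-cong (splits w) (λ P → trans (Σ-cong (nsplits a) (λ A → Σ-cong (nsplits m) (λ M → Σ-*ˡ L _ _)))
          (Σ-pull (nsplits a) (nsplits m) L (λ A M x → B (proj₁ P) (proj₁ A) (proj₁ M) · F x (proj₂ P) (proj₂ A) (proj₂ M)))) ⟩
    SumL (splits w) (λ P → SumL L (λ x → SumL (nsplits a) (λ A → SumL (nsplits m) (λ M → B (proj₁ P) (proj₁ A) (proj₁ M) · F x (proj₂ P) (proj₂ A) (proj₂ M)))))
      ≡⟨ Σ-swap (splits w) L _ ⟩
    SumL L (λ x → SumL (splits w) (λ P → SumL (nsplits a) (λ A → SumL (nsplits m) (λ M → B (proj₁ P) (proj₁ A) (proj₁ M) · F x (proj₂ P) (proj₂ A) (proj₂ M)))))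
      ≡⟨ Σ-cong L (λ x → sym (⊛-def B (F x) w a m)) ⟩
    ΣS L (λ x → B ⊛ F x) w a m ∎

  decompsFrom : ℕ → List ℕ → List ℕ → Series
  decompsFrom δ p ks = ΣS (decomps ks) (λ D → ΣS (prependBlock p D) (decompSeries δ))

  LHS≈decompsFrom : ∀ k₁ ks → LHS (k₁ ∷ ks) ≈ decompsFrom 1 (k₁ ∷ []) ks
  LHS≈decompsFrom k₁ ks w a m = trans (LHS≡Σ-decompSeries (k₁ ∷ ks) w a m) (trans (Σ-concatMap (decomps ks) (extendDecomp k₁ ks) (λ D → decompSeries 1 D w a m))
    (Σ-cong (decomps ks) (λ D → cong (λ L → SumL L (λ D' → decompSeries 1 D' w a m)) (extendDecomp≡prependBlock k₁ ks D))))

open LeftHandSide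

module BlockRecursion where

  open ≡-Reasoning

  SumL-singleton : ∀ {A : Set} (x : A) (f : A → ℚ) → SumL (x ∷ []) f ≡ f x
  SumL-singleton x f = trans (SumL-∷ x [] f) (trans (cong (f x ⊹_) (SumL-[] f)) (⊹-idʳ (f x)))

  SumL-pair : ∀ {A : Set} (x y : A) (f : A → ℚ) → SumL (x ∷ y ∷ []) f ≡ f x ⊹ f y
  SumL-pair x y f = trans (SumL-∷ x (y ∷ []) f) (cong (f x ⊹_) (SumL-singleton y f))

  decompsFrom-∷ : ∀ δ p k ks → decompsFrom δ p (k ∷ ks) ≈ blockSeries δ p ⊛ decompsFrom 0 (k ∷ []) ks ⊕S decompsFrom δ (p ++ k ∷ []) ks
  decompsFrom-∷ δ p k ks w a m = begin
    SumL (decomps (k ∷ ks)) (λ D → SumL (prependBlock p D) termAt) ≡⟨ Σ-concatMap (decomps ks) (extendDecomp k ks) (λ D → SumL (prependBlock p D) termAt) ⟩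
    SumL (decomps ks) (λ D → SumL (extendDecomp k ks D) (λ D' → SumL (prependBlock p D') termAt)) ≡⟨ Σ-cong (decomps ks) (λ D → trans (cong (λ L → SumL L (λ D' → SumL (prependBlock p D') termAt)) (extendDecomp≡prependBlock k ks D)) (h D)) ⟩
    SumL (decomps ks) (λ D → SumL (prependBlock (k ∷ []) D) (λ D' → (blockSeries δ p ⊛ decompSeries 0 D') w a m) ⊹ SumL (prependBlock (p ++ k ∷ []) D) termAt)
      ≡⟨ Σ-+ (decomps ks) _ _ ⟩
    SumL (decomps ks) (λ D → SumL (prependBlock (k ∷ []) D) (λ D' → (blockSeries δ p ⊛ decompSeries 0 D') w a m)) ⊹ decompsFrom δ (p ++ k ∷ []) ks w a m
      ≡⟨ cong (_⊹ decompsFrom δ (p ++ k ∷ []) ks w a m) (sym (trans (⊛-ΣS (blockSeries δ p) (decomps ks) (λ D → ΣS (prependBlock (k ∷ []) D) (decompSeries 0)) w a m)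
           (Σ-cong (decomps ks) (λ D → ⊛-ΣS (blockSeries δ p) (prependBlock (k ∷ []) D) (decompSeries 0) w a m)))) ⟩
    (blockSeries δ p ⊛ decompsFrom 0 (k ∷ []) ks) w a m ⊹ decompsFrom δ (p ++ k ∷ []) ks w a m ≡⟨ sym (⊹-def _ _) ⟩
    (blockSeries δ p ⊛ decompsFrom 0 (k ∷ []) ks ⊕S decompsFrom δ (p ++ k ∷ []) ks) w a m ∎
    where
    termAt : List (List ℕ) → ℚ
    termAt D = decompSeries δ D w a m
    blockTerm : List (List ℕ) → ℚ
    blockTerm D = (blockSeries δ p ⊛ decompSeries 0 D) w a m
    h : ∀ D → SumL (prependBlock (k ∷ []) D) (λ D' → SumL (prependBlock p D') termAt) ≡ SumL (prependBlock (k ∷ []) D) blockTerm ⊹ SumL (prependBlock (p ++ k ∷ []) D) termAt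
    h [] = begin
      SumL (((k ∷ []) ∷ []) ∷ []) (λ D' → SumL (prependBlock p D') termAt) ≡⟨ SumL-singleton _ _ ⟩
      SumL ((p ∷ (k ∷ []) ∷ []) ∷ ((p ++ k ∷ []) ∷ []) ∷ []) termAt ≡⟨ SumL-pair _ _ termAt ⟩
      termAt (p ∷ (k ∷ []) ∷ []) ⊹ termAt ((p ++ k ∷ []) ∷ []) ≡⟨ cong₂ _⊹_ (trans (decompSeries-∷ δ p ((k ∷ []) ∷ []) w a m) (sym (SumL-singleton _ blockTerm))) (sym (SumL-singleton _ termAt)) ⟩
      SumL (((k ∷ []) ∷ []) ∷ []) blockTerm ⊹ SumL (((p ++ k ∷ []) ∷ []) ∷ []) termAt ∎
    h (b ∷ bs) = begin
      SumL (((k ∷ []) ∷ b ∷ bs) ∷ ((k ∷ b) ∷ bs) ∷ []) (λ D' → SumL (prependBlock p D') termAt) ≡⟨ SumL-pair _ _ _ ⟩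
      SumL (prependBlock p ((k ∷ []) ∷ b ∷ bs)) termAt ⊹ SumL (prependBlock p ((k ∷ b) ∷ bs)) termAt ≡⟨ cong₂ _⊹_ (SumL-pair _ _ termAt) (SumL-pair _ _ termAt) ⟩
      (termAt (p ∷ (k ∷ []) ∷ b ∷ bs) ⊹ termAt ((p ++ k ∷ []) ∷ b ∷ bs)) ⊹ (termAt (p ∷ (k ∷ b) ∷ bs) ⊹ termAt ((p ++ k ∷ b) ∷ bs)) ≡⟨ ⊹-interchange _ _ _ _ ⟩
      (termAt (p ∷ (k ∷ []) ∷ b ∷ bs) ⊹ termAt (p ∷ (k ∷ b) ∷ bs)) ⊹ (termAt ((p ++ k ∷ []) ∷ b ∷ bs) ⊹ termAt ((p ++ k ∷ b) ∷ bs))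
        ≡⟨ cong₂ _⊹_ (cong₂ _⊹_ (decompSeries-∷ δ p ((k ∷ []) ∷ b ∷ bs) w a m) (decompSeries-∷ δ p ((k ∷ b) ∷ bs) w a m))
             (cong (termAt ((p ++ k ∷ []) ∷ b ∷ bs) ⊹_) (cong (λ q → termAt (q ∷ bs)) (sym (LP.++-assoc p (k ∷ []) b)))) ⟩
      (blockTerm ((k ∷ []) ∷ b ∷ bs) ⊹ blockTerm ((k ∷ b) ∷ bs)) ⊹ (termAt ((p ++ k ∷ []) ∷ b ∷ bs) ⊹ termAt (((p ++ k ∷ []) ++ b) ∷ bs))
        ≡⟨ sym (cong₂ _⊹_ (SumL-pair _ _ blockTerm) (SumL-pair _ _ termAt)) ⟩
      SumL (prependBlock (k ∷ []) (b ∷ bs)) blockTerm ⊹ SumL (prependBlock (p ++ k ∷ []) (b ∷ bs)) termAt ∎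

open BlockRecursion

module BlockValues where

  open ≡-Reasoning

  xCoeff-·ʳ : ∀ w (g : ℕ → ℚ) s → xCoeff w (λ j → g j · s) ≡ xCoeff w g · s
  xCoeff-·ʳ [] g s = refl
  xCoeff-·ʳ (X ∷ w) g s = xCoeff-·ʳ w (λ j → g (suc j)) s
  xCoeff-·ʳ (Y ∷ w) g s = sym (·-zeroˡ s)

  afterLetter-·ʳ : ∀ c w (g : Word → ℚ) s → afterLetter c w (λ v → g v · s) ≡ afterLetter c w g · s
  afterLetter-·ʳ c [] g s = sym (·-zeroˡ s)
  afterLetter-·ʳ X (X ∷ w) g s = refl
  afterLetter-·ʳ X (Y ∷ w) g s = sym (·-zeroˡ s)
  afterLetter-·ʳ Y (X ∷ w) g s = sym (·-zeroˡ s)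
  afterLetter-·ʳ Y (Y ∷ w) g s = refl

  xCoeff-δN≡δW-replicate : ∀ N w → xCoeff w (λ j → δN j N) ≡ δW (replicate N X) w
  xCoeff-δN≡δW-replicate zero [] = trans (δN-refl 0) (sym (δW-refl []))
  xCoeff-δN≡δW-replicate (suc N) [] = trans (δN-0-suc N) (sym (δW-∷[] X (replicate N X)))
  xCoeff-δN≡δW-replicate zero (X ∷ w) = trans (xCoeff-vanish w _ (λ j → δN-suc-0 j)) (sym (δW-[]∷ X w))
  xCoeff-δN≡δW-replicate (suc N) (X ∷ w) = trans (xCoeff-cong w (λ j → δN-suc j N)) (trans (xCoeff-δN≡δW-replicate N w) (sym (δW-cons X (replicate N X) w)))
  xCoeff-δN≡δW-replicate zero (Y ∷ w) = sym (δW-[]∷ Y w)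
  xCoeff-δN≡δW-replicate (suc N) (Y ∷ w) = sym (δW-cons≢ X Y (replicate N X) w (λ ()))

  afterY-δW : ∀ v w → afterLetter Y w (λ w' → δW v w') ≡ δW (Y ∷ v) w
  afterY-δW v [] = sym (δW-∷[] Y v)
  afterY-δW v (X ∷ w) = sym (δW-cons≢ Y X v w (λ ()))
  afterY-δW v (Y ∷ w) = sym (δW-cons Y v w)

  𝕪⊛blockCoeff : ∀ c d β w a m → (𝕪 ⊛ xSeries (blockCoeff c d β)) w a m ≡ δW (Y ∷ replicate (c + d + m) X) w · blockSum d β a m
  𝕪⊛blockCoeff c d β w a m = trans (𝕪⊛ (xSeries (blockCoeff c d β)) w a m) (trans (afterLetter-cong Y w (λ w' → xCoeff-·ʳ w' (λ j → δN j (c + d + m)) (blockSum d β a m)))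
    (trans (afterLetter-·ʳ Y w _ (blockSum d β a m)) (cong (_· blockSum d β a m) (trans (afterLetter-cong Y w (λ w' → xCoeff-δN≡δW-replicate (c + d + m) w')) (afterY-δW (replicate (c + d + m) X) w)))))

  nsplits-sum : ∀ m → All (λ q → proj₁ q + proj₂ q ≡ m) (nsplits m)
  nsplits-sum zero = refl ∷ []
  nsplits-sum (suc m) = subst (All (λ q → proj₁ q + proj₂ q ≡ suc m)) (sym (nsplits-suc m)) (refl ∷ AllP.map⁺ (All.map (cong suc) (nsplits-sum m)))

  dep≤wt : ∀ p → All (1 ≤_) p → dep p ≤ wt p
  dep≤wt [] [] = z≤n
  dep≤wt (x ∷ p) (h ∷ hs) = NP.+-mono-≤ h (dep≤wt p hs)

  exponent-arith : ∀ D' c q1 q2 m → q1 + q2 ≡ m → suc D' + c + q1 + q2 ∸ 1 ≡ c + D' + m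
  exponent-arith D' c q1 q2 m e = begin
    D' + c + q1 + q2 ≡⟨ NP.+-assoc (D' + c) q1 q2 ⟩
    D' + c + (q1 + q2) ≡⟨ cong (λ z → D' + c + z) e ⟩
    D' + c + m ≡⟨ cong (_+ m) (NP.+-comm D' c) ⟩
    c + D' + m ∎

  binomTop-arith : ∀ W D e δ → D ≤ W → + W ℤ.- + D ℤ.+ + e ℤ.+ + δ ℤ.- + 2 ≡ + ((W ∸ D) + e) ℤ.+ + δ ℤ.- + 2
  binomTop-arith W D e δ le = cong (λ z → z ℤ.+ + e ℤ.+ + δ ℤ.- + 2) (trans (ZP.[+m]-[+n]≡m⊖n W D) (ZP.⊖-≥ le))

  blockSeries-coeff : ∀ δ x p → All (1 ≤_) (x ∷ p) → ∀ w a m →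
    blockSeries δ (x ∷ p) w a m ≡ δW (Y ∷ replicate ((wt (x ∷ p) ∸ dep (x ∷ p)) + length p + m) X) w · blockSum (length p) (blockBinom δ (wt (x ∷ p) ∸ dep (x ∷ p))) a m
  blockSeries-coeff δ x p hs w a m = trans (Σ-congAll (All.map (λ {q} e → step q e) (nsplits-sum m))) (sym (Σ-*ˡ (nsplits m) _ _))
    where
    P : List ℕ
    P = x ∷ p
    c : ℕ
    c = wt P ∸ dep P
    le : dep P ≤ wt P
    le = dep≤wt P hs
    eW : wt P ≡ suc (length p) + c
    eW = sym (NP.m+[n∸m]≡n le)
    N : ℕ
    N = c + length p + m
    step : ∀ q → proj₁ q + proj₂ q ≡ m →
      blockBinomTerm δ P (proj₁ q) · (δW (idxWord (wt P + proj₁ q + proj₂ q ∷ [])) w · δN (dep P ∸ 1 + proj₁ q) a) ≡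
      δW (Y ∷ replicate N X) w · (δN a (length p + proj₁ q) · blockBinom δ c (proj₁ q))
    step q e = begin
      blockBinomTerm δ P (proj₁ q) · (δW (idxWord (wt P + proj₁ q + proj₂ q ∷ [])) w · δN (length p + proj₁ q) a)
        ≡⟨ cong₂ (λ u v → u · (δW v w · δN (length p + proj₁ q) a)) (cong (λ z → binomℤ z (proj₁ q)) (binomTop-arith (wt P) (dep P) (proj₁ q) δ le))
             (trans (LP.++-identityʳ _) (cong (λ n → Y ∷ replicate n X) (trans (cong (λ z → z + proj₁ q + proj₂ q ∸ 1) eW) (exponent-arith (length p) c (proj₁ q) (proj₂ q) m e)))) ⟩
      blockBinom δ c (proj₁ q) · (δW (Y ∷ replicate N X) w · δN (length p + proj₁ q) a)
        ≡⟨ trans (·-comm _ _) (trans (·-assoc _ _ _) (cong (δW (Y ∷ replicate N X) w ·_) (cong (_· blockBinom δ c (proj₁ q)) (δN-sym _ a)))) ⟩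
      δW (Y ∷ replicate N X) w · (δN a (length p + proj₁ q) · blockBinom δ c (proj₁ q)) ∎

  blockSeries≈block : ∀ δ x p → δ ≤ 1 → All (1 ≤_) (x ∷ p) → blockSeries δ (x ∷ p) ≈ block δ (wt (x ∷ p) ∸ dep (x ∷ p)) (dep (x ∷ p) ∸ 1)
  blockSeries≈block δ x p le hs w a m = trans (blockSeries-coeff δ x p hs w a m) (sym (trans (block≈xSeries δ c (length p) le w a m) (𝕪⊛blockCoeff c (length p) (blockBinom δ c) w a m)))
    where
      c : ℕ
      c = wt (x ∷ p) ∸ dep (x ∷ p)

open BlockValues

module IndexArithmetic where

  open ≡-Reasoning
  open ℕ-Solver.+-*-Solver

  +-regroup : ∀ D c k' → (D + c) + ((1 + k') + 0) ≡ (D + 1) + (c + k')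
  +-regroup = solve 3 (λ D c k → (D :+ c) :+ ((con 1 :+ k) :+ con 0) := (D :+ con 1) :+ (c :+ k)) refl

  wt∸dep-∷ʳ : ∀ P k → All (1 ≤_) P → 1 ≤ k → wt (P ++ k ∷ []) ∸ dep (P ++ k ∷ []) ≡ (wt P ∸ dep P) + (k ∸ 1)
  wt∸dep-∷ʳ P (suc k') hs _ = begin
    wt (P ++ suc k' ∷ []) ∸ dep (P ++ suc k' ∷ []) ≡⟨ cong₂ _∸_ (sum-++ P (suc k' ∷ [])) (LP.length-++ P) ⟩
    (wt P + (suc k' + 0)) ∸ (dep P + 1) ≡⟨ cong (λ z → (z + (suc k' + 0)) ∸ (dep P + 1)) (sym (NP.m+[n∸m]≡n le)) ⟩
    ((dep P + c) + (suc k' + 0)) ∸ (dep P + 1) ≡⟨ cong (_∸ (dep P + 1)) (+-regroup (dep P) c k') ⟩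
    ((dep P + 1) + (c + k')) ∸ (dep P + 1) ≡⟨ NP.m+n∸m≡n (dep P + 1) (c + k') ⟩
    c + k' ∎
    where
    le : dep P ≤ wt P
    le = dep≤wt P hs
    c : ℕ
    c = wt P ∸ dep P

  length-∷ʳ : ∀ (p : List ℕ) (k : ℕ) → length (p ++ k ∷ []) ≡ suc (length p)
  length-∷ʳ p k = trans (LP.length-++ p {k ∷ []}) (NP.+-comm (length p) 1)

  +0∸1 : ∀ k → k + 0 ∸ 1 ≡ k ∸ 1
  +0∸1 k = cong (_∸ 1) (NP.+-identityʳ k)

open IndexArithmetic

module MainIdentity where

  open SR

  ≡⇒≈ : ∀ {f g : Series} → f ≡ g → f ≈ g
  ≡⇒≈ refl = ≈-refl

  decompsFrom-[] : ∀ δ P → decompsFrom δ P [] ≈ decompSeries δ (P ∷ [])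
  decompsFrom-[] δ P w a m = trans (SumL-singleton [] (λ D → SumL (prependBlock P D) (λ D' → decompSeries δ D' w a m))) (SumL-singleton (P ∷ []) (λ D' → decompSeries δ D' w a m))

  decompsFrom≈block-⊛-tailProduct : ∀ δ x p ks → δ ≤ 1 → All (1 ≤_) (x ∷ p) → All (1 ≤_) ks →
    decompsFrom δ (x ∷ p) ks ≈ block δ (wt (x ∷ p) ∸ dep (x ∷ p)) (length p) ⊛ tailProduct ks
  decompsFrom≈block-⊛-tailProduct δ x p [] le hs hks = begin
    decompsFrom δ (x ∷ p) [] ≈⟨ decompsFrom-[] δ (x ∷ p) ⟩
    decompSeries δ ((x ∷ p) ∷ []) ≈⟨ decompSeries-∷ δ (x ∷ p) [] ⟩
    blockSeries δ (x ∷ p) ⊛ decompSeries 0 [] ≈⟨ ⊛-congˡ (blockSeries δ (x ∷ p)) (decompSeries-[] 0) ⟩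
    blockSeries δ (x ∷ p) ⊛ 𝟙 ≈⟨ ⊛𝟙 _ ⟩
    blockSeries δ (x ∷ p) ≈⟨ blockSeries≈block δ x p le hs ⟩
    block δ c (length p) ≈⟨ ≈-sym {block δ c (length p) ⊛ 𝟙} (⊛𝟙 _) ⟩
    block δ c (length p) ⊛ 𝟙 ∎
    where
      c : ℕ
      c = wt (x ∷ p) ∸ dep (x ∷ p)
  decompsFrom≈block-⊛-tailProduct δ x p (k ∷ ks) le hs (hk ∷ hks) = begin
    decompsFrom δ (x ∷ p) (k ∷ ks) ≈⟨ decompsFrom-∷ δ (x ∷ p) k ks ⟩
    blockSeries δ (x ∷ p) ⊛ decompsFrom 0 (k ∷ []) ks ⊕S decompsFrom δ (x ∷ p ++ k ∷ []) ks
      ≈⟨ ⊕-cong {blockSeries δ (x ∷ p) ⊛ decompsFrom 0 (k ∷ []) ks} (⊛-cong {blockSeries δ (x ∷ p)} (blockSeries≈block δ x p le hs)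
           (≈-trans {decompsFrom 0 (k ∷ []) ks} (decompsFrom≈block-⊛-tailProduct 0 k [] ks z≤n (hk ∷ []) hks) (⊛-congʳ (tailProduct ks) (≡⇒≈ (cong (λ z → block 0 z 0) (+0∸1 k))))))
           (≈-trans {decompsFrom δ (x ∷ p ++ k ∷ []) ks} (decompsFrom≈block-⊛-tailProduct δ x (p ++ k ∷ []) ks le (AllP.++⁺ hs (hk ∷ [])) hks)
             (⊛-congʳ (tailProduct ks) (≡⇒≈ (cong₂ (block δ) (wt∸dep-∷ʳ (x ∷ p) k hs hk) (length-∷ʳ p k))))) ⟩
    block δ c (length p) ⊛ (block 0 (k ∸ 1) 0 ⊛ tailProduct ks) ⊕S block δ (c + (k ∸ 1)) (suc (length p)) ⊛ tailProduct ks
      ≈⟨ ≈-sym {block δ c (length p) ⊛ tailProduct (k ∷ ks)} (block-⊛-tailProduct δ c (length p) k ks) ⟩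
    block δ c (length p) ⊛ tailProduct (k ∷ ks) ∎
    where
      c : ℕ
      c = wt (x ∷ p) ∸ dep (x ∷ p)

  headFactor : ℕ → Series
  headFactor k₁ = 𝕪 ⊛ geom (𝕩 ⊛ 𝕦) ⊛ xPow (k₁ ∸ 1)

  RHS-tail : ∀ k₁ y → Σ Series (λ rest → RHS k₁ y ≡ headFactor k₁ ⊛ rest)
  RHS-tail k₁ y = (_ , refl)

  RHS-tailFactor : ℕ → List ℕ → Series
  RHS-tailFactor k₁ y = proj₁ (RHS-tail k₁ y)

  RHS-tailFactor≈tailProduct : ∀ k₁ y → RHS-tailFactor k₁ y ≈ tailProduct y
  RHS-tailFactor≈tailProduct k₁ [] = ≈-refl
  RHS-tailFactor≈tailProduct k₁ (k ∷ y) = ⊛-congˡ (middle ⊛ xPow (k ∸ 1)) (RHS-tailFactor≈tailProduct k₁ y)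

  RHS≈headFactor-⊛-tailProduct : ∀ k₁ ks → RHS k₁ ks ≈ headFactor k₁ ⊛ tailProduct ks
  RHS≈headFactor-⊛-tailProduct k₁ ks = ≈-trans {RHS k₁ ks} (≡⇒≈ (proj₂ (RHS-tail k₁ ks))) (⊛-congˡ (headFactor k₁) (RHS-tailFactor≈tailProduct k₁ ks))

open MainIdentity

lemma3p3 : (k₁ : ℕ) (ks : List ℕ) → All (1 ≤_) (k₁ ∷ ks) →
    (w : Word) (a m : ℕ) → LHS (k₁ ∷ ks) w a m ≡ RHS k₁ ks w a m
lemma3p3 k₁ ks (k₁≥1 ∷ ks≥1) = begin
  LHS (k₁ ∷ ks)                            ≈⟨ LHS≈decompsFrom k₁ ks ⟩
  decompsFrom 1 (k₁ ∷ []) ks               ≈⟨ decompsFrom≈block-⊛-tailProduct 1 k₁ [] ks (s≤s z≤n) (k₁≥1 ∷ []) ks≥1 ⟩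
  block 1 (k₁ + 0 ∸ 1) 0 ⊛ tailProduct ks  ≈⟨ ⊛-congʳ (tailProduct ks) (≡⇒≈ (cong (λ c → block 1 c 0) (+0∸1 k₁))) ⟩
  block 1 (k₁ ∸ 1) 0 ⊛ tailProduct ks      ≈⟨ ⊛-congʳ (tailProduct ks) (≈-sym {headFactor k₁} (head≈block (k₁ ∸ 1))) ⟩
  headFactor k₁ ⊛ tailProduct ks           ≈⟨ ≈-sym {RHS k₁ ks} (RHS≈headFactor-⊛-tailProduct k₁ ks) ⟩
  RHS k₁ ks                                ∎
  where open SR
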